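{- No differentially closed field of characteristic $0$ has any automorphism of finite order greater than $2$.
   Context: A differentially closed field of characteristic $0$ is a model of $\mathrm{DCF}_0$, the model completion of the theory of fields of characteristic $0$ with a single derivation. Automorphisms are automorphisms of the differential field (preserving $+$, $\cdot$ and the derivation). -}

module Defs where

open import Level using (Level; _⊔_) renaming (suc to lsuc)
open import Algebra.Bundles using (CommutativeRing)
open import Data.Nat using (ℕ; zero; suc; _<_)
open import Data.Fin using (Fin)
open import Data.List using (List)
open import Data.List.Relation.Unary.All using (All)
open import Data.Product using (Σ; ∃; _×_)
open import Relation.Nullary using (¬_)
open import Function using (id)

record DiffField (c ℓ : Level) : Set (lsuc (c ⊔ ℓ)) where
  field
    commRing : CommutativeRing c ℓ
  open CommutativeRing commRing public
  field
    1≉0     : ¬ (1# ≈ 0#)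
    inverse : ∀ x → ¬ (x ≈ 0#) → ∃ λ y → x * y ≈ 1#
    ∂       : Carrier → Carrier
    ∂-cong  : ∀ {x y} → x ≈ y → ∂ x ≈ ∂ y
    ∂-+     : ∀ x y → ∂ (x + y) ≈ ∂ x + ∂ y
    ∂-*     : ∀ x y → ∂ (x * y) ≈ (x * ∂ y) + (∂ x * y)

module _ {c ℓ : Level} (K : DiffField c ℓ) where
  open DiffField K

  natCast : ℕ → Carrier
  natCast zero    = 0#
  natCast (suc n) = 1# + natCast n

  Char0 : Set ℓ
  Char0 = ∀ n → ¬ (natCast (suc n) ≈ 0#)

  ∂^ : ℕ → Carrier → Carrier
  ∂^ zero    x = x
  ∂^ (suc k) x = ∂ (∂^ k x)

-- Differential polynomials with coefficients in A in the differential
-- indeterminates x_0,…,x_{m-1}:  var j i  stands for the i-th derivative x_j^{(i)}.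
data DPoly {a : Level} (A : Set a) (m : ℕ) : Set a where
  const : A → DPoly A m
  var   : Fin m → ℕ → DPoly A m
  _⊕_   : DPoly A m → DPoly A m → DPoly A m
  _⊗_   : DPoly A m → DPoly A m → DPoly A m
  ⊖_    : DPoly A m → DPoly A m

module _ {a c ℓ : Level} {A : Set a} (L : DiffField c ℓ) where
  open DiffField L

  evalD : ∀ {m} → (A → Carrier) → DPoly A m → (Fin m → Carrier) → Carrier
  evalD ι (const x) v = ι x
  evalD ι (var j i) v = ∂^ L i (v j)
  evalD ι (p ⊕ q)   v = evalD ι p v + evalD ι q v
  evalD ι (p ⊗ q)   v = evalD ι p v * evalD ι q v
  evalD ι (⊖ p)     v = - evalD ι p v

  Solves : ∀ {m} → (A → Carrier) → List (DPoly A m) → List (DPoly A m)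
         → (Fin m → Carrier) → Set (a ⊔ ℓ)
  Solves ι fs gs v = All (λ f → evalD ι f v ≈ 0#) fs
                   × All (λ g → ¬ (evalD ι g v ≈ 0#)) gs

record IsDiffHom {c ℓ c' ℓ' : Level} (K : DiffField c ℓ) (L : DiffField c' ℓ')
                 (φ : DiffField.Carrier K → DiffField.Carrier L) : Set (c ⊔ ℓ ⊔ ℓ') where
  private
    module K = DiffField K
    module L = DiffField L
  field
    cong : ∀ {x y} → x K.≈ y → φ x L.≈ φ y
    hom+ : ∀ x y → φ (x K.+ y) L.≈ (φ x L.+ φ y)
    hom* : ∀ x y → φ (x K.* y) L.≈ (φ x L.* φ y)
    hom1 : φ K.1# L.≈ L.1#
    hom∂ : ∀ x → φ (K.∂ x) L.≈ L.∂ (φ x)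

-- K is differentially closed (existentially closed among differential fields):
-- every finite system of differential polynomial equations and inequations
-- over K which has a solution in some differential field extension of K
-- already has a solution in K.
DiffClosed : ∀ {c ℓ} → DiffField c ℓ → Set (lsuc (c ⊔ ℓ))
DiffClosed {c} {ℓ} K =
  (L : DiffField c ℓ) (φ : DiffField.Carrier K → DiffField.Carrier L) → IsDiffHom K L φ →
  (m : ℕ) (fs gs : List (DPoly (DiffField.Carrier K) m)) →
  (∃ λ v → Solves L φ fs gs v) → ∃ λ w → Solves K id fs gs w

IsDCF0 : ∀ {c ℓ} → DiffField c ℓ → Set (lsuc (c ⊔ ℓ))
IsDCF0 K = Char0 K × DiffClosed K

record IsDiffAut {c ℓ : Level} (K : DiffField c ℓ) (σ : DiffField.Carrier K → DiffField.Carrier K)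
                 : Set (c ⊔ ℓ) where
  open DiffField K
  field
    isHom      : IsDiffHom K K σ
    injective  : ∀ x y → σ x ≈ σ y → x ≈ y
    surjective : ∀ y → ∃ λ x → σ x ≈ y

iterate : ∀ {a} {A : Set a} → (A → A) → ℕ → A → A
iterate f zero    x = x
iterate f (suc k) x = f (iterate f k x)

HasOrder : ∀ {c ℓ} (K : DiffField c ℓ) → (DiffField.Carrier K → DiffField.Carrier K) → ℕ → Set (c ⊔ ℓ)
HasOrder K σ n =
  (0 < n) ×
  (∀ x → iterate σ n x ≈ x) ×
  (∀ k → 0 < k → k < n → ¬ (∀ x → iterate σ k x ≈ x))
  where open DiffField K

{-# OPTIONS --safe #-}
module Submission where

-- The Artin-Schreier argument: if σ has order n > 2 then 4 ∣ n or an odd prime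
-- q ∣ n, so some power τ of σ has order 4 or q.  If τ has order 4, then
-- ρ = τ² fixes i = √-1, and a square root z of u ≠ 0 with ρ u = -u has ρ z = w z
-- with w² = -1, whence z = ρ² z = -z.  If τ has odd prime order q, it fixes a
-- primitive q-th root of unity ζ (its conjugates are among ζ, …, ζ^(q-1)); a
-- Lagrange resolvent y ≠ 0 has τ y = ζ^k y, and z = y^(1/q) gives τ^q z = ζ^k z ≠ z.
--
-- The roots used come from differential closedness: a root of X^q - a lies in
-- e·K[X]/(f), e cutting out an irreducible factor of f, which is a differential
-- field since f is separable; its inverses are given by a norm built from
-- X ↦ ζ X resp. X ↦ X^b.  Differential closedness also makes equality in K
-- ¬¬-stable, so the argument runs in the double-negation monad.

open import Defs
open import Level using (Level)
open import Data.Nat as ℕ using (ℕ; suc; _<_)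
open import Data.Product using (_,_)
open import Data.Sum using ([_,_])
open import Relation.Binary.PropositionalEquality using (_≡_; subst)
open import Data.Empty using (⊥)
open import Algebra.Bundles using (CommutativeRing)

module DoubleNegation where
  open import Level using (Level)
  open import Data.Nat using (ℕ; _<_)
  open import Data.Nat.Induction using (<-rec)
  open import Data.Fin using (Fin; zero; suc)
  open import Data.Product using (Σ; _,_; _×_)
  open import Relation.Nullary using (¬_; yes; no)
  open import Data.Empty using (⊥)
  open import Relation.Nullary.Decidable using (¬¬-excluded-middle)

  private variable
    a b p r : Level
    A : Set a
    B : Set b

  infixl 1 _>>=_
  _>>=_ : ¬ ¬ A → (A → ¬ ¬ B) → ¬ ¬ B
  (m >>= f) k = m (λ x → f x k)

  pure : A → ¬ ¬ A
  pure x k = k x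

  run : ¬ ¬ ⊥ → ⊥
  run m = m (λ x → x)

  ¬¬-least : (P : ℕ → Set p) → ∀ n → P n → ¬ ¬ (Σ ℕ λ m → P m × (∀ k → k < m → ¬ P k))
  ¬¬-least P = <-rec (λ n → P n → ¬ ¬ (Σ ℕ λ m → P m × (∀ k → k < m → ¬ P k))) λ n smaller Pn →
    ¬¬-excluded-middle {A = Σ ℕ λ k → k < n × P k} >>= λ where
      (yes (k , k<n , Pk)) → smaller k<n Pk
      (no none)            → pure (n , Pn , λ k k<n Pk → none (k , k<n , Pk))

  ¬¬-finite-choice : ∀ n (R : Fin n → B → Set r) →
                     (∀ i → ¬ ¬ Σ B (R i)) → ¬ ¬ Σ (Fin n → B) λ f → ∀ i → R i (f i)
  ¬¬-finite-choice ℕ.zero R h = pure ((λ ()) , λ ())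
  ¬¬-finite-choice (ℕ.suc n) R h =
    h zero >>= λ (x , Rx) → ¬¬-finite-choice n (λ i → R (suc i)) (λ i → h (suc i)) >>= λ (f , Rf) →
    pure ((λ { zero → x ; (suc i) → f i }) , λ { zero → Rx ; (suc i) → Rf i })

module IntegerCoefficientSolver {c ℓ} (R : CommutativeRing c ℓ) where
  open import Data.Nat as ℕ using (ℕ; zero; suc)
  import Data.Nat.Properties as ℕ
  open import Data.Integer as ℤ using (ℤ; +_; -[1+_])
  import Data.Integer.Properties as ℤ
  open import Data.Sign as Sign using (Sign)
  open import Data.Maybe using (Maybe; just; nothing)
  open import Relation.Nullary using (yes; no)
  import Relation.Binary.PropositionalEquality as ≡
  open import Algebra.Solver.Ring.AlmostCommutativeRing
    using (_-Raw-AlmostCommutative⟶_; fromCommutativeRing)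

  open CommutativeRing R
  open import Algebra.Properties.Ring ring using (-0#≈0#; -‿involutive; -‿distribˡ-*; -‿distribʳ-*; -‿anti-homo-+)
  open import Algebra.Properties.Semiring.Mult.TCOptimised semiring using (_×_; ×-homo-+; ×1-homo-*; 1+×)
  open import Relation.Binary.Reasoning.Setoid setoid

  private
    ⟦_⟧ : ℤ → Carrier
    ⟦ + n ⟧      = n × 1#
    ⟦ -[1+ n ] ⟧ = - (suc n × 1#)

    -‿homo-+ : ∀ x y → - (x + y) ≈ - x + - y
    -‿homo-+ x y = trans (-‿anti-homo-+ x y) (+-comm _ _)

    ⊖-homo : ∀ m n → ⟦ m ℤ.⊖ n ⟧ ≈ m × 1# - n × 1#
    ⊖-homo zero    zero    = sym (trans (+-congˡ -0#≈0#) (+-identityʳ _))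
    ⊖-homo (suc m) zero    = sym (trans (+-congˡ -0#≈0#) (+-identityʳ _))
    ⊖-homo zero    (suc n) = sym (+-identityˡ _)
    ⊖-homo (suc m) (suc n) rewrite ℤ.[1+m]⊖[1+n]≡m⊖n m n = begin
      ⟦ m ℤ.⊖ n ⟧                          ≈⟨ ⊖-homo m n ⟩
      m × 1# - n × 1#                      ≈⟨ sym (+-identityˡ _) ⟩
      0# + (m × 1# - n × 1#)               ≈⟨ +-congʳ (sym (-‿inverseʳ 1#)) ⟩
      (1# - 1#) + (m × 1# - n × 1#)        ≈⟨ +-assoc _ _ _ ⟩
      1# + (- 1# + (m × 1# - n × 1#))      ≈⟨ +-congˡ (trans (sym (+-assoc _ _ _)) (trans (+-congʳ (+-comm _ _)) (+-assoc _ _ _))) ⟩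
      1# + (m × 1# + (- 1# - n × 1#))      ≈⟨ sym (+-assoc _ _ _) ⟩
      (1# + m × 1#) + (- 1# - n × 1#)      ≈⟨ +-congˡ (sym (-‿homo-+ 1# (n × 1#))) ⟩
      (1# + m × 1#) - (1# + n × 1#)        ≈⟨ +-cong (sym (1+× m 1#)) (-‿cong (sym (1+× n 1#))) ⟩
      suc m × 1# - suc n × 1#              ∎

    +-homo : ∀ i j → ⟦ i ℤ.+ j ⟧ ≈ ⟦ i ⟧ + ⟦ j ⟧
    +-homo (+ m)    (+ n)    = ×-homo-+ 1# m n
    +-homo (+ m)    -[1+ n ] = ⊖-homo m (suc n)
    +-homo -[1+ m ] (+ n)    = trans (⊖-homo n (suc m)) (+-comm _ _)
    +-homo -[1+ m ] -[1+ n ] = begin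
      - (suc (suc (m ℕ.+ n)) × 1#)      ≡⟨ ≡.cong (λ k → - (suc k × 1#)) (≡.sym (ℕ.+-suc m n)) ⟩
      - ((suc m ℕ.+ suc n) × 1#)        ≈⟨ -‿cong (×-homo-+ 1# (suc m) (suc n)) ⟩
      - (suc m × 1# + suc n × 1#)       ≈⟨ -‿homo-+ _ _ ⟩
      - (suc m × 1#) + - (suc n × 1#)   ∎

    signed : Sign → Carrier → Carrier
    signed Sign.+ x = x
    signed Sign.- x = - x

    signed-cong : ∀ s {x y} → x ≈ y → signed s x ≈ signed s y
    signed-cong Sign.+ e = e
    signed-cong Sign.- e = -‿cong e

    ◃-homo : ∀ s n → ⟦ s ℤ.◃ n ⟧ ≈ signed s (n × 1#)
    ◃-homo Sign.+ zero    = refl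
    ◃-homo Sign.- zero    = sym -0#≈0#
    ◃-homo Sign.+ (suc n) = refl
    ◃-homo Sign.- (suc n) = refl

    sign-abs : ∀ i → ⟦ i ⟧ ≈ signed (ℤ.sign i) (ℤ.∣ i ∣ × 1#)
    sign-abs (+ n)      = refl
    sign-abs -[1+ n ]   = refl

    signed-* : ∀ s t x y → signed (s Sign.* t) (x * y) ≈ signed s x * signed t y
    signed-* Sign.+ Sign.+ x y = refl
    signed-* Sign.+ Sign.- x y = -‿distribʳ-* x y
    signed-* Sign.- Sign.+ x y = -‿distribˡ-* x y
    signed-* Sign.- Sign.- x y = trans (sym (-‿involutive _)) (trans (-‿cong (-‿distribˡ-* x y)) (-‿distribʳ-* (- x) y))

    *-homo : ∀ i j → ⟦ i ℤ.* j ⟧ ≈ ⟦ i ⟧ * ⟦ j ⟧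
    *-homo i j = begin
      ⟦ s ℤ.◃ (ℤ.∣ i ∣ ℕ.* ℤ.∣ j ∣) ⟧                     ≈⟨ ◃-homo s (ℤ.∣ i ∣ ℕ.* ℤ.∣ j ∣) ⟩
      signed s ((ℤ.∣ i ∣ ℕ.* ℤ.∣ j ∣) × 1#)                ≈⟨ signed-cong s (×1-homo-* ℤ.∣ i ∣ ℤ.∣ j ∣) ⟩
      signed s (ℤ.∣ i ∣ × 1# * ℤ.∣ j ∣ × 1#)                ≈⟨ signed-* (ℤ.sign i) (ℤ.sign j) _ _ ⟩
      signed (ℤ.sign i) (ℤ.∣ i ∣ × 1#) * signed (ℤ.sign j) (ℤ.∣ j ∣ × 1#) ≈⟨ sym (*-cong (sign-abs i) (sign-abs j)) ⟩
      ⟦ i ⟧ * ⟦ j ⟧                                        ∎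
      where s = ℤ.sign i Sign.* ℤ.sign j

    -‿homo : ∀ i → ⟦ ℤ.- i ⟧ ≈ - ⟦ i ⟧
    -‿homo (+ zero)  = sym -0#≈0#
    -‿homo (+ suc n) = refl
    -‿homo -[1+ n ]  = sym (-‿involutive _)

    morphism : ℤ.+-*-rawRing -Raw-AlmostCommutative⟶ fromCommutativeRing R
    morphism = record
      { ⟦_⟧ = ⟦_⟧ ; +-homo = +-homo ; *-homo = *-homo ; -‿homo = -‿homo
      ; 0-homo = refl ; 1-homo = refl }

    equal? : ∀ i j → Maybe (⟦ i ⟧ ≈ ⟦ j ⟧)
    equal? i j with i ℤ.≟ j
    ... | yes ≡.refl = just refl
    ... | no _       = nothing

  open import Algebra.Solver.Ring ℤ.+-*-rawRing (fromCommutativeRing R) morphism equal? public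

module NumberTheory where
  open import Level using (Level)
  open import Data.Nat as ℕ using (ℕ; zero; suc; _<_; _≤_; s≤s; z≤n; _+_; _*_; _∸_; NonZero)
  import Data.Nat.Properties as ℕ
  open import Data.Nat.DivMod using (_%_; _/_; m≡m%n+[m/n]*n; m%n<n)
  open import Data.Nat.Divisibility using (_∣_; divides; ∣⇒≤; m%n≡0⇒n∣m; ∣-trans; m∣m*n; n∣m*n)
  open import Data.Nat.Primality using (Prime; prime; euclidsLemma; prime⇒nonZero; prime⇒nonTrivial; composite)
  open import Data.Nat.Primality.Factorisation using (factorise)
  open import Data.Nat.ListAction using (product)
  open import Data.Nat.Coprimality using (coprime-Bézout; prime⇒coprime)
  open import Data.Nat.GCD using (module Bézout)
  open import Data.List using (List; []; _∷_; _++_; length; applyUpTo)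
  open import Data.List.Relation.Unary.All using (All; []; _∷_)
  open import Data.List.Relation.Unary.Any using (here; there)
  open import Data.List.Membership.Propositional using (_∈_)
  open import Data.List.Membership.Propositional.Properties using (∈-∃++; ∈-++⁻; ∈-++⁺ˡ; ∈-++⁺ʳ; ∈-applyUpTo⁺; ∈-applyUpTo⁻)
  open import Data.List.Relation.Unary.All.Properties using (All¬⇒¬Any)
  open import Data.List.Relation.Unary.Unique.Propositional using (Unique; _∷_)
  open import Data.List.Relation.Unary.Unique.Propositional.Properties using (applyUpTo⁺₁)
  open import Data.List.Relation.Binary.Permutation.Propositional using (_↭_; ↭-refl; ↭-trans; ↭-sym; ↭-prep)
  open import Data.List.Relation.Binary.Permutation.Propositional.Properties using (shift)
  import Data.List.Properties as List
  open import Data.Product using (Σ; _,_; proj₂; _×_)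
  open import Data.Sum using (_⊎_; inj₁; inj₂)
  open import Relation.Nullary using (¬_; yes; no; contradiction)
  open import Relation.Binary.PropositionalEquality using (_≡_; _≢_; refl; sym; trans; cong; cong₂; subst; module ≡-Reasoning)
  open import Function using (_∘_)

  private variable
    p : Level

  -- By Bézout, 1 + y d = x q or 1 + x q = y d.
  prime-generated : (P : ℕ → Set p) → (∀ a b → P a → P b → P (a + b)) → (∀ a b → P (a + b) → P b → P a) →
                    ∀ {q d} → Prime q → 0 < d → d < q → P q → P d → P 1
  prime-generated P P-+ P-∸ {q} {d} q-prime 0<d d<q Pq Pd =
    from-bézout (coprime-Bézout (prime⇒coprime q-prime {{ℕ.>-nonZero 0<d}} d<q))
    where
    multiples : ∀ {a} k → P a → P (k * a)
    multiples {a} zero    Pa = P-∸ 0 a Pa Pa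
    multiples {a} (suc k) Pa = P-+ a (k * a) Pa (multiples k Pa)

    from-bézout : Bézout.Identity 1 q d → P 1
    from-bézout (Bézout.+- x y 1+yd≡xq) = P-∸ 1 (y * d) (subst P (sym 1+yd≡xq) (multiples x Pq)) (multiples y Pd)
    from-bézout (Bézout.-+ x y 1+xq≡yd) = P-∸ 1 (x * q) (subst P (sym 1+xq≡yd) (multiples y Pd)) (multiples x Pq)

  parity : ∀ n → (Σ ℕ λ k → n ≡ 2 * k) ⊎ (Σ ℕ λ k → n ≡ suc (2 * k))
  parity zero = inj₁ (0 , refl)
  parity (suc n) with parity n
  ... | inj₁ (k , n≡2k)   = inj₂ (k , cong suc n≡2k)
  ... | inj₂ (k , n≡1+2k) = inj₁ (suc k , trans (cong suc n≡1+2k) (cong suc (sym (ℕ.+-suc k (k + 0)))))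

  odd-prime : ∀ {p} → Prime p → p ≢ 2 → Σ ℕ λ m → p ≡ suc (2 * m)
  odd-prime {p} p-prime p≢2 with parity p
  ... | inj₂ odd        = odd
  ... | inj₁ (k , p≡2k) = contradiction (composite {d = 2} 2<p (divides k (trans p≡2k (ℕ.*-comm 2 k))))
                                        (Prime.notComposite p-prime)
    where
    instance
      2-nonTrivial : ℕ.NonTrivial 2
      2-nonTrivial = ℕ.nonTrivial
    2<p : 2 < p
    2<p = ℕ.≤∧≢⇒< (ℕ.nonTrivial⇒n>1 p {{prime⇒nonTrivial p-prime}}) (p≢2 ∘ sym)

  powers-of-two : ∀ ps → All Prime ps → (Σ ℕ λ p → Prime p × p ≢ 2 × p ∣ product ps) ⊎ product ps ≡ 2 ℕ.^ length ps
  powers-of-two []       []                 = inj₂ refl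
  powers-of-two (p ∷ ps) (p-prime ∷ ps-prime) with p ℕ.≟ 2
  ... | no p≢2  = inj₁ (p , p-prime , p≢2 , m∣m*n (product ps))
  ... | yes refl with powers-of-two ps ps-prime
  ...   | inj₁ (p′ , p′-prime , p′≢2 , p′∣) = inj₁ (p′ , p′-prime , p′≢2 , ∣-trans p′∣ (n∣m*n 2))
  ...   | inj₂ ∏≡2^k                       = inj₂ (cong (2 *_) ∏≡2^k)

  four-or-odd-prime-divides : ∀ n → 2 < n →
    (Σ ℕ λ s → n ≡ 4 * s) ⊎ (Σ ℕ λ m → Σ ℕ λ s → Prime (suc (2 * m)) × n ≡ suc (2 * m) * s)
  four-or-odd-prime-divides n 2<n with factorise n {{ℕ.>-nonZero (ℕ.<-trans (s≤s z≤n) 2<n)}}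
  ... | record { factors = ps ; isFactorisation = n≡∏ps ; factorsPrime = ps-prime } with powers-of-two ps ps-prime
  ...   | inj₁ (p , p-prime , p≢2 , divides s ∏ps≡sp) with odd-prime p-prime p≢2
  ...     | m , refl = inj₂ (m , s , p-prime , trans n≡∏ps (trans ∏ps≡sp (ℕ.*-comm s (suc (2 * m)))))
  four-or-odd-prime-divides n 2<n | record { factors = ps ; isFactorisation = n≡∏ps } | inj₂ ∏ps≡2^k =
    four (length ps) (trans n≡∏ps ∏ps≡2^k)
    where
    four : ∀ k → n ≡ 2 ℕ.^ k → (Σ ℕ λ s → n ≡ 4 * s) ⊎ (Σ ℕ λ m → Σ ℕ λ s → Prime (suc (2 * m)) × n ≡ suc (2 * m) * s)
    four zero          refl = contradiction 2<n λ { (s≤s ()) }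
    four (suc zero)    refl = contradiction 2<n (ℕ.<-irrefl refl)
    four (suc (suc k)) refl = inj₁ (2 ℕ.^ k , sym (ℕ.*-assoc 2 2 (2 ℕ.^ k)))

  unique-⊆⇒↭ : ∀ (xs ys : List ℕ) → Unique xs → (∀ {z} → z ∈ xs → z ∈ ys) → length xs ≡ length ys → xs ↭ ys
  unique-⊆⇒↭ []       []       _              _  _   = ↭-refl
  unique-⊆⇒↭ []       (y ∷ ys) _              _  ()
  unique-⊆⇒↭ (x ∷ xs) ys       (x∉xs ∷ uniq) xs⊆ len with ∈-∃++ (xs⊆ (here refl))
  ... | as , bs , refl = ↭-trans (↭-prep x (unique-⊆⇒↭ xs (as ++ bs) uniq xs⊆as++bs len′)) (↭-sym (shift x as bs))
    where
    xs⊆as++bs : ∀ {z} → z ∈ xs → z ∈ as ++ bs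
    xs⊆as++bs {z} z∈xs with ∈-++⁻ as (xs⊆ (there z∈xs))
    ... | inj₁ z∈as         = ∈-++⁺ˡ z∈as
    ... | inj₂ (here z≡x)   = contradiction (subst (_∈ xs) z≡x z∈xs) (All¬⇒¬Any x∉xs)
    ... | inj₂ (there z∈bs) = ∈-++⁺ʳ as z∈bs
    len′ : length xs ≡ length (as ++ bs)
    len′ = ℕ.suc-injective (trans len (trans (List.length-++ as) (trans (ℕ.+-suc (length as) (length bs)) (cong suc (sym (List.length-++ as))))))

  module UnitsModulo (q : ℕ) (q-prime : Prime q) where
    instance
      q-nonZero : NonZero q
      q-nonZero = prime⇒nonZero q-prime

    units : List ℕ
    units = applyUpTo suc (q ∸ 1)

    ∈-units⁻ : ∀ {x} → x ∈ units → 0 < x × x < q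
    ∈-units⁻ x∈ with ∈-applyUpTo⁻ suc x∈
    ... | i , i<q-1 , refl = s≤s z≤n , subst (suc i <_) (ℕ.m+[n∸m]≡n (ℕ.>-nonZero⁻¹ q)) (s≤s i<q-1)

    ∈-units⁺ : ∀ {x} → 0 < x → x < q → x ∈ units
    ∈-units⁺ {suc x} _ x<q = ∈-applyUpTo⁺ suc (ℕ.+-cancelˡ-< 1 x (q ∸ 1) (subst (suc x <_) (sym (ℕ.m+[n∸m]≡n (ℕ.>-nonZero⁻¹ q))) x<q))

    _·ₘ_ : ℕ → ℕ → ℕ
    c ·ₘ b = (c * b) % q

    ∤-unit : ∀ {c} → 0 < c → c < q → ¬ q ∣ c
    ∤-unit {suc c} _ c<q q∣c = ℕ.<-irrefl refl (ℕ.<-≤-trans c<q (∣⇒≤ q∣c))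

    %≡⇒∣∸ : ∀ a b → b ≤ a → a % q ≡ b % q → q ∣ a ∸ b
    %≡⇒∣∸ a b b≤a a%q≡b%q = divides (a / q ∸ b / q) (begin
      a ∸ b                                    ≡⟨ cong₂ _∸_ (m≡m%n+[m/n]*n a q) (m≡m%n+[m/n]*n b q) ⟩
      (a % q + a / q * q) ∸ (b % q + b / q * q) ≡⟨ cong (λ t → (t + a / q * q) ∸ (b % q + b / q * q)) a%q≡b%q ⟩
      (b % q + a / q * q) ∸ (b % q + b / q * q) ≡⟨ ℕ.[m+n]∸[m+o]≡n∸o (b % q) (a / q * q) (b / q * q) ⟩
      a / q * q ∸ b / q * q                    ≡⟨ sym (ℕ.*-distribʳ-∸ q (a / q) (b / q)) ⟩
      (a / q ∸ b / q) * q                      ∎)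
      where open ≡-Reasoning

    ·ₘ-injective-≤ : ∀ {c b b′} → 0 < c → c < q → b < q → b′ ≤ b → c ·ₘ b ≡ c ·ₘ b′ → b ≡ b′
    ·ₘ-injective-≤ {c} {b} {b′} 0<c c<q b<q b′≤b cb≡cb′
      with euclidsLemma c (b ∸ b′) q-prime (subst (q ∣_) (sym (ℕ.*-distribˡ-∸ c b b′)) (%≡⇒∣∸ (c * b) (c * b′) (ℕ.*-monoʳ-≤ c b′≤b) cb≡cb′))
    ... | inj₁ q∣c = contradiction q∣c (∤-unit 0<c c<q)
    ... | inj₂ q∣b-b′ with b ∸ b′ ℕ.≟ 0
    ...   | yes b-b′≡0 = ℕ.≤-antisym (ℕ.m∸n≡0⇒m≤n b-b′≡0) b′≤b
    ...   | no  b-b′≢0 = contradiction q∣b-b′ (∤-unit (ℕ.n≢0⇒n>0 b-b′≢0) (ℕ.≤-<-trans (ℕ.m∸n≤m b b′) b<q))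

    ·ₘ-injective : ∀ {c b b′} → 0 < c → c < q → b < q → b′ < q → c ·ₘ b ≡ c ·ₘ b′ → b ≡ b′
    ·ₘ-injective {b = b} {b′} 0<c c<q b<q b′<q eq with ℕ.≤-total b′ b
    ... | inj₁ b′≤b = ·ₘ-injective-≤ 0<c c<q b<q b′≤b eq
    ... | inj₂ b≤b′ = sym (·ₘ-injective-≤ 0<c c<q b′<q b≤b′ (sym eq))

    ·ₘ-unit : ∀ {c b} → 0 < c → c < q → 0 < b → b < q → 0 < c ·ₘ b × c ·ₘ b < q
    ·ₘ-unit {c} {b} 0<c c<q 0<b b<q = nonzero , m%n<n (c * b) q
      where
      nonzero : 0 < c ·ₘ b
      nonzero with c ·ₘ b ℕ.≟ 0
      ... | no  cb≢0 = ℕ.n≢0⇒n>0 cb≢0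
      ... | yes cb≡0 with euclidsLemma c b q-prime (m%n≡0⇒n∣m (c * b) q cb≡0)
      ...   | inj₁ q∣c = contradiction q∣c (∤-unit 0<c c<q)
      ...   | inj₂ q∣b = contradiction q∣b (∤-unit 0<b b<q)

    scaled-units : ℕ → List ℕ
    scaled-units c = applyUpTo (λ i → c ·ₘ suc i) (q ∸ 1)

    scaled-units↭units : ∀ {c} → 0 < c → c < q → scaled-units c ↭ units
    scaled-units↭units {c} 0<c c<q = unique-⊆⇒↭ (scaled-units c) units
      (applyUpTo⁺₁ _ (q ∸ 1) λ {i} {j} i<j j<q-1 eq → ℕ.<-irrefl (ℕ.suc-injective (·ₘ-injective 0<c c<q (below i (ℕ.<-trans i<j j<q-1)) (below j j<q-1) eq)) i<j)
      ⊆units (trans (List.length-applyUpTo _ (q ∸ 1)) (sym (List.length-applyUpTo suc (q ∸ 1))))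
      where
      below : ∀ i → i < q ∸ 1 → suc i < q
      below i i<q-1 = proj₂ (∈-units⁻ (∈-applyUpTo⁺ suc i<q-1))
      ⊆units : ∀ {z} → z ∈ scaled-units c → z ∈ units
      ⊆units z∈ with ∈-applyUpTo⁻ (λ i → c ·ₘ suc i) z∈
      ... | i , i<q-1 , refl = let (0<cb , cb<q) = ·ₘ-unit 0<c c<q (s≤s z≤n) (below i i<q-1) in ∈-units⁺ 0<cb cb<q

module Polynomials {c ℓ} (R : CommutativeRing c ℓ) where
  open import Level using (_⊔_)
  open import Data.Nat as ℕ using (ℕ; zero; suc; _≤_; _<_; s≤s; z≤n)
  import Data.Nat.Properties as ℕ
  import Relation.Binary.PropositionalEquality as ≡
  open import Relation.Binary.PropositionalEquality using (_≢_)
  open import Data.List using (List; []; _∷_)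
  open import Data.Product using (Σ; _,_; proj₁; proj₂; _×_)
  open import Data.Sum using (_⊎_; inj₁; inj₂)
  open import Relation.Nullary using (¬_; yes; no; contradiction)
  open import Relation.Nullary.Decidable using (¬¬-excluded-middle)
  open import Data.Integer using (+_)
  open DoubleNegation

  open CommutativeRing R
  open import Algebra.Properties.Ring ring using (-0#≈0#; -‿anti-homo-+; -‿distribʳ-*)
  open import Algebra.Properties.CommutativeSemiring.Exp commutativeSemiring using (_^_; ^-congˡ; ^-distrib-*)
  open import Algebra.Properties.CommutativeSemigroup *-commutativeSemigroup using (x∙yz≈y∙xz)
  open import Algebra.Properties.Semiring.Mult semiring using () renaming (_×_ to _⨯_)
  open import Function using (_∘_)
  open import Algebra.Properties.CommutativeSemigroup +-commutativeSemigroup using (interchange)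
  open import Relation.Binary.Reasoning.Setoid setoid

  -- Coefficient lists, constant term first; trailing zeros are allowed, so
  -- polynomials are compared coefficientwise.
  Poly : Set c
  Poly = List Carrier

  coeff : Poly → ℕ → Carrier
  coeff []      _       = 0#
  coeff (a ∷ p) zero    = a
  coeff (a ∷ p) (suc i) = coeff p i

  infix 4 _≋_
  record _≋_ (p q : Poly) : Set ℓ where
    constructor mk≋
    field at : ∀ i → coeff p i ≈ coeff q i
  open _≋_ public

  infixl 6 _⊞_
  infixl 7 _⊠_ _·_
  infix  8 ⊝_

  _⊞_ : Poly → Poly → Poly
  []      ⊞ q       = q
  (a ∷ p) ⊞ []      = a ∷ p
  (a ∷ p) ⊞ (b ∷ q) = (a + b) ∷ (p ⊞ q)

  ⊝_ : Poly → Poly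
  ⊝ []      = []
  ⊝ (a ∷ p) = (- a) ∷ (⊝ p)

  _·_ : Carrier → Poly → Poly
  a · []      = []
  a · (b ∷ p) = (a * b) ∷ (a · p)

  shift : Poly → Poly
  shift p = 0# ∷ p

  _⊠_ : Poly → Poly → Poly
  []      ⊠ q = []
  (a ∷ p) ⊠ q = a · q ⊞ shift (p ⊠ q)

  constₚ : Carrier → Poly
  constₚ a = a ∷ []

  1ₚ : Poly
  1ₚ = constₚ 1#

  ≋-refl : ∀ {p} → p ≋ p
  ≋-refl = mk≋ λ i → refl

  ≋-sym : ∀ {p q} → p ≋ q → q ≋ p
  ≋-sym e = mk≋ λ i → sym (at e i)

  ≋-trans : ∀ {p q r} → p ≋ q → q ≋ r → p ≋ r
  ≋-trans e f = mk≋ λ i → trans (at e i) (at f i)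

  ≡⇒≋ : ∀ {p q} → p ≡.≡ q → p ≋ q
  ≡⇒≋ ≡.refl = ≋-refl

  ≋-tail : ∀ {a b p q} → (a ∷ p) ≋ (b ∷ q) → p ≋ q
  ≋-tail e = mk≋ λ i → at e (suc i)

  ≋-tail-[] : ∀ {a p} → (a ∷ p) ≋ [] → p ≋ []
  ≋-tail-[] e = mk≋ λ i → at e (suc i)

  ∷-cong : ∀ {a b p q} → a ≈ b → p ≋ q → (a ∷ p) ≋ (b ∷ q)
  ∷-cong e f = mk≋ λ { zero → e ; (suc i) → at f i }

  shift-cong : ∀ {p q} → p ≋ q → shift p ≋ shift q
  shift-cong = ∷-cong refl

  coeff-⊞ : ∀ p q i → coeff (p ⊞ q) i ≈ coeff p i + coeff q i
  coeff-⊞ []      q       i       = sym (+-identityˡ _)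
  coeff-⊞ (a ∷ p) []      zero    = sym (+-identityʳ _)
  coeff-⊞ (a ∷ p) []      (suc i) = sym (+-identityʳ _)
  coeff-⊞ (a ∷ p) (b ∷ q) zero    = refl
  coeff-⊞ (a ∷ p) (b ∷ q) (suc i) = coeff-⊞ p q i

  coeff-⊝ : ∀ p i → coeff (⊝ p) i ≈ - coeff p i
  coeff-⊝ []      i       = sym -0#≈0#
  coeff-⊝ (a ∷ p) zero    = refl
  coeff-⊝ (a ∷ p) (suc i) = coeff-⊝ p i

  coeff-· : ∀ a p i → coeff (a · p) i ≈ a * coeff p i
  coeff-· a []      i       = sym (zeroʳ a)
  coeff-· a (b ∷ p) zero    = refl
  coeff-· a (b ∷ p) (suc i) = coeff-· a p i

  ⊞-cong : ∀ {p p' q q'} → p ≋ p' → q ≋ q' → p ⊞ q ≋ p' ⊞ q'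
  ⊞-cong {p} {p'} {q} {q'} e f =
    mk≋ λ i → trans (coeff-⊞ p q i) (trans (+-cong (at e i) (at f i)) (sym (coeff-⊞ p' q' i)))

  ⊝-cong : ∀ {p p'} → p ≋ p' → ⊝ p ≋ ⊝ p'
  ⊝-cong {p} {p'} e = mk≋ λ i → trans (coeff-⊝ p i) (trans (-‿cong (at e i)) (sym (coeff-⊝ p' i)))

  ·-cong : ∀ {a b p p'} → a ≈ b → p ≋ p' → a · p ≋ b · p'
  ·-cong {a} {b} {p} {p'} e f = mk≋ λ i → trans (coeff-· a p i) (trans (*-cong e (at f i)) (sym (coeff-· b p' i)))

  ∷≋constₚ⊞shift : ∀ a p → (a ∷ p) ≋ constₚ a ⊞ shift p
  ∷≋constₚ⊞shift a p = mk≋ λ { zero → sym (+-identityʳ a) ; (suc i) → refl }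

  ⊞-assoc : ∀ p q r → (p ⊞ q) ⊞ r ≋ p ⊞ (q ⊞ r)
  ⊞-assoc p q r = mk≋ λ i → begin
    coeff ((p ⊞ q) ⊞ r) i                  ≈⟨ trans (coeff-⊞ (p ⊞ q) r i) (+-congʳ (coeff-⊞ p q i)) ⟩
    (coeff p i + coeff q i) + coeff r i    ≈⟨ +-assoc _ _ _ ⟩
    coeff p i + (coeff q i + coeff r i)    ≈⟨ sym (trans (coeff-⊞ p (q ⊞ r) i) (+-congˡ (coeff-⊞ q r i))) ⟩
    coeff (p ⊞ (q ⊞ r)) i                  ∎

  ⊞-comm : ∀ p q → p ⊞ q ≋ q ⊞ p
  ⊞-comm p q = mk≋ λ i → trans (coeff-⊞ p q i) (trans (+-comm _ _) (sym (coeff-⊞ q p i)))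

  ⊞-identityʳ : ∀ p → p ⊞ [] ≋ p
  ⊞-identityʳ p = mk≋ λ i → trans (coeff-⊞ p [] i) (+-identityʳ _)

  ⊞-inverseʳ : ∀ p → p ⊞ ⊝ p ≋ []
  ⊞-inverseʳ p = mk≋ λ i → trans (coeff-⊞ p (⊝ p) i) (trans (+-congˡ (coeff-⊝ p i)) (-‿inverseʳ _))

  ⊞-interchange : ∀ p q r s → (p ⊞ q) ⊞ (r ⊞ s) ≋ (p ⊞ r) ⊞ (q ⊞ s)
  ⊞-interchange p q r s = mk≋ λ i → begin
    coeff ((p ⊞ q) ⊞ (r ⊞ s)) i
      ≈⟨ trans (coeff-⊞ (p ⊞ q) (r ⊞ s) i) (+-cong (coeff-⊞ p q i) (coeff-⊞ r s i)) ⟩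
    (coeff p i + coeff q i) + (coeff r i + coeff s i)
      ≈⟨ interchange _ _ _ _ ⟩
    (coeff p i + coeff r i) + (coeff q i + coeff s i)
      ≈⟨ sym (trans (coeff-⊞ (p ⊞ r) (q ⊞ s) i) (+-cong (coeff-⊞ p r i) (coeff-⊞ q s i))) ⟩
    coeff ((p ⊞ r) ⊞ (q ⊞ s)) i ∎

  shift-⊞ : ∀ p q → shift (p ⊞ q) ≋ shift p ⊞ shift q
  shift-⊞ p q = mk≋ λ { zero → sym (+-identityʳ _) ; (suc i) → refl }

  ·-⊞ : ∀ a p q → a · (p ⊞ q) ≋ a · p ⊞ a · q
  ·-⊞ a p q = mk≋ λ i → begin
    coeff (a · (p ⊞ q)) i                  ≈⟨ trans (coeff-· a (p ⊞ q) i) (*-congˡ (coeff-⊞ p q i)) ⟩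
    a * (coeff p i + coeff q i)            ≈⟨ distribˡ _ _ _ ⟩
    a * coeff p i + a * coeff q i          ≈⟨ sym (trans (coeff-⊞ (a · p) (a · q) i) (+-cong (coeff-· a p i) (coeff-· a q i))) ⟩
    coeff (a · p ⊞ a · q) i                ∎

  +-· : ∀ a b p → (a + b) · p ≋ a · p ⊞ b · p
  +-· a b p = mk≋ λ i → begin
    coeff ((a + b) · p) i                  ≈⟨ trans (coeff-· (a + b) p i) (distribʳ _ _ _) ⟩
    a * coeff p i + b * coeff p i          ≈⟨ sym (trans (coeff-⊞ (a · p) (b · p) i) (+-cong (coeff-· a p i) (coeff-· b p i))) ⟩
    coeff (a · p ⊞ b · p) i                ∎

  ·-assoc : ∀ a b p → a · (b · p) ≋ (a * b) · p
  ·-assoc a b p = mk≋ λ i →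
    trans (coeff-· a (b · p) i) (trans (*-congˡ (coeff-· b p i)) (trans (sym (*-assoc _ _ _)) (sym (coeff-· (a * b) p i))))

  0· : ∀ p → 0# · p ≋ []
  0· p = mk≋ λ i → trans (coeff-· 0# p i) (zeroˡ _)

  1· : ∀ p → 1# · p ≋ p
  1· p = mk≋ λ i → trans (coeff-· 1# p i) (*-identityˡ _)

  ·-shift : ∀ a p → a · shift p ≋ shift (a · p)
  ·-shift a p = mk≋ λ { zero → zeroʳ a ; (suc i) → refl }

  ⊠-zeroˡ : ∀ p q → p ≋ [] → p ⊠ q ≋ []
  ⊠-zeroˡ []      q e = ≋-refl
  ⊠-zeroˡ (a ∷ p) q e = ≋-trans (⊞-cong (≋-trans (·-cong (at e 0) ≋-refl) (0· q)) (shift-cong (⊠-zeroˡ p q (≋-tail-[] e))))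
                                 (mk≋ λ { zero → refl ; (suc i) → refl })

  ⊠-zeroʳ : ∀ p → p ⊠ [] ≋ []
  ⊠-zeroʳ []      = ≋-refl
  ⊠-zeroʳ (a ∷ p) = mk≋ λ { zero → refl ; (suc i) → at (⊠-zeroʳ p) i }

  ⊠-congʳ : ∀ p {q q'} → q ≋ q' → p ⊠ q ≋ p ⊠ q'
  ⊠-congʳ []      e = ≋-refl
  ⊠-congʳ (a ∷ p) e = ⊞-cong (·-cong refl e) (shift-cong (⊠-congʳ p e))

  ⊠-congˡ : ∀ {p p'} q → p ≋ p' → p ⊠ q ≋ p' ⊠ q
  ⊠-congˡ {[]}    {[]}     q e = ≋-refl
  ⊠-congˡ {[]}    {b ∷ p'} q e = ≋-sym (⊠-zeroˡ (b ∷ p') q (≋-sym e))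
  ⊠-congˡ {a ∷ p} {[]}     q e = ⊠-zeroˡ (a ∷ p) q e
  ⊠-congˡ {a ∷ p} {b ∷ p'} q e = ⊞-cong (·-cong (at e 0) ≋-refl) (shift-cong (⊠-congˡ q (≋-tail e)))

  ⊠-cong : ∀ {p p' q q'} → p ≋ p' → q ≋ q' → p ⊠ q ≋ p' ⊠ q'
  ⊠-cong {p} {p'} {q} e f = ≋-trans (⊠-congˡ q e) (⊠-congʳ p' f)

  ⊠-distribʳ : ∀ p p' q → (p ⊞ p') ⊠ q ≋ p ⊠ q ⊞ p' ⊠ q
  ⊠-distribʳ []      p'       q = ≋-refl
  ⊠-distribʳ (a ∷ p) []       q = ≋-sym (⊞-identityʳ _)
  ⊠-distribʳ (a ∷ p) (b ∷ p') q =
    ≋-trans (⊞-cong (+-· a b q) (≋-trans (shift-cong (⊠-distribʳ p p' q)) (shift-⊞ (p ⊠ q) (p' ⊠ q))))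
            (⊞-interchange (a · q) (b · q) (shift (p ⊠ q)) (shift (p' ⊠ q)))

  ⊠-distribˡ : ∀ p q q' → p ⊠ (q ⊞ q') ≋ p ⊠ q ⊞ p ⊠ q'
  ⊠-distribˡ []      q q' = ≋-refl
  ⊠-distribˡ (a ∷ p) q q' =
    ≋-trans (⊞-cong (·-⊞ a q q') (≋-trans (shift-cong (⊠-distribˡ p q q')) (shift-⊞ (p ⊠ q) (p ⊠ q'))))
            (⊞-interchange (a · q) (a · q') (shift (p ⊠ q)) (shift (p ⊠ q')))

  ·-⊠ : ∀ a p q → (a · p) ⊠ q ≋ a · (p ⊠ q)
  ·-⊠ a []      q = ≋-refl
  ·-⊠ a (b ∷ p) q =
    ≋-trans (⊞-cong (≋-sym (·-assoc a b q)) (≋-trans (shift-cong (·-⊠ a p q)) (≋-sym (·-shift a (p ⊠ q)))))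
            (≋-sym (·-⊞ a (b · q) (shift (p ⊠ q))))

  shift-⊠ : ∀ p q → shift p ⊠ q ≋ shift (p ⊠ q)
  shift-⊠ p q = ⊞-cong (0· q) ≋-refl

  ⊠-shift : ∀ p q → p ⊠ shift q ≋ shift (p ⊠ q)
  ⊠-shift []      q = mk≋ λ { zero → refl ; (suc i) → refl }
  ⊠-shift (a ∷ p) q = ≋-trans (⊞-cong (·-shift a q) (shift-cong (⊠-shift p q))) (≋-sym (shift-⊞ (a · q) (shift (p ⊠ q))))

  ⊠-constₚ : ∀ p a → p ⊠ constₚ a ≋ a · p
  ⊠-constₚ []      a = ≋-refl
  ⊠-constₚ (b ∷ p) a = mk≋ λ { zero → trans (+-identityʳ _) (*-comm b a) ; (suc i) → at (⊠-constₚ p a) i }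

  constₚ-⊠ : ∀ a p → constₚ a ⊠ p ≋ a · p
  constₚ-⊠ a p = ≋-trans (⊞-cong (≋-refl {a · p}) (mk≋ λ { zero → refl ; (suc i) → refl })) (⊞-identityʳ (a · p))

  ⊠-comm : ∀ p q → p ⊠ q ≋ q ⊠ p
  ⊠-comm []      q = ≋-sym (⊠-zeroʳ q)
  ⊠-comm (a ∷ p) q = begin≋
    where
    begin≋ : (a ∷ p) ⊠ q ≋ q ⊠ (a ∷ p)
    begin≋ = ≋-trans (⊞-cong ≋-refl (shift-cong (⊠-comm p q)))
      (≋-sym (≋-trans (⊠-congʳ q (∷≋constₚ⊞shift a p))
               (≋-trans (⊠-distribˡ q (constₚ a) (shift p)) (⊞-cong (⊠-constₚ q a) (⊠-shift q p)))))

  ⊠-assoc : ∀ p q r → (p ⊠ q) ⊠ r ≋ p ⊠ (q ⊠ r)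
  ⊠-assoc []      q r = ≋-refl
  ⊠-assoc (a ∷ p) q r = ≋-trans (⊠-distribʳ (a · q) (shift (p ⊠ q)) r)
    (⊞-cong (·-⊠ a q r) (≋-trans (shift-⊠ (p ⊠ q) r) (shift-cong (⊠-assoc p q r))))

  ⊠-identityˡ : ∀ p → 1ₚ ⊠ p ≋ p
  ⊠-identityˡ p = ≋-trans (constₚ-⊠ 1# p) (1· p)

  ⊠-identityʳ : ∀ p → p ⊠ 1ₚ ≋ p
  ⊠-identityʳ p = ≋-trans (⊠-comm p 1ₚ) (⊠-identityˡ p)

  polynomialRing : CommutativeRing c ℓ
  polynomialRing = record
    { Carrier = Poly ; _≈_ = _≋_ ; _+_ = _⊞_ ; _*_ = _⊠_ ; -_ = ⊝_ ; 0# = [] ; 1# = 1ₚ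
    ; isCommutativeRing = record
      { isRing = record
        { +-isAbelianGroup = record
          { isGroup = record
            { isMonoid = record
              { isSemigroup = record
                { isMagma = record
                  { isEquivalence = record { refl = ≋-refl ; sym = ≋-sym ; trans = ≋-trans }
                  ; ∙-cong = ⊞-cong }
                ; assoc = ⊞-assoc }
              ; identity = (λ p → ≋-refl) , ⊞-identityʳ }
            ; inverse = (λ p → ≋-trans (⊞-comm (⊝ p) p) (⊞-inverseʳ p)) , ⊞-inverseʳ
            ; ⁻¹-cong = ⊝-cong }
          ; comm = ⊞-comm }
        ; *-cong = ⊠-cong
        ; *-assoc = ⊠-assoc
        ; *-identity = ⊠-identityˡ , ⊠-identityʳ
        ; distrib = ⊠-distribˡ , (λ p q q' → ⊠-distribʳ q q' p) }
      ; *-comm = ⊠-comm } }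

  open IntegerCoefficientSolver polynomialRing public using () renaming
    (solve to ⊞⊠-solve; _:+_ to _:⊞_; _:*_ to _:⊠_; :-_ to :⊝_; _:-_ to _:⊟_; _:=_ to _:≋_; con to :c)

  Deg< : ℕ → Poly → Set ℓ
  Deg< d p = ∀ i → d ≤ i → coeff p i ≈ 0#

  record Monic (d : ℕ) (f : Poly) : Set ℓ where
    constructor monic
    field
      leading : coeff f d ≈ 1#
      above   : Deg< (suc d) f

  Degree : ℕ → Poly → Set ℓ
  Degree d p = ¬ coeff p d ≈ 0# × Deg< (suc d) p

  ¬¬-≋[]-or-Degree : ∀ p → ¬ ¬ (p ≋ [] ⊎ Σ ℕ λ d → Degree d p)
  ¬¬-≋[]-or-Degree []      = pure (inj₁ ≋-refl)
  ¬¬-≋[]-or-Degree (a ∷ p) = ¬¬-≋[]-or-Degree p >>= λ where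
    (inj₂ (d , p≉0 , p<)) → pure (inj₂ (suc d , p≉0 , λ { (suc i) (s≤s le) → p< i le }))
    (inj₁ p≋[]) → ¬¬-excluded-middle >>= λ where
      (yes a≈0) → pure (inj₁ (mk≋ λ { zero → a≈0 ; (suc i) → at p≋[] i }))
      (no a≉0)  → pure (inj₂ (0 , a≉0 , λ { (suc i) _ → at p≋[] i }))

  ⊠-leading : ∀ k e g d → Deg< (suc e) k → Deg< (suc d) g →
              coeff (k ⊠ g) (e ℕ.+ d) ≈ coeff k e * coeff g d × Deg< (suc (e ℕ.+ d)) (k ⊠ g)
  ⊠-leading []      e       g d k< g< = sym (zeroˡ _) , λ i _ → refl
  ⊠-leading (a ∷ k) zero    g d k< g< = leading , lower
    where
    shift-k⊠g≈0 : ∀ i → coeff (shift (k ⊠ g)) i ≈ 0#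
    shift-k⊠g≈0 zero    = refl
    shift-k⊠g≈0 (suc i) = at (⊠-zeroˡ k g (mk≋ λ i → k< (suc i) (s≤s z≤n))) i
    leading : coeff (a · g ⊞ shift (k ⊠ g)) d ≈ a * coeff g d
    leading = trans (coeff-⊞ (a · g) _ d) (trans (+-cong (coeff-· a g d) (shift-k⊠g≈0 d)) (+-identityʳ _))
    lower : Deg< (suc d) (a · g ⊞ shift (k ⊠ g))
    lower i le = trans (coeff-⊞ (a · g) _ i)
      (trans (+-cong (trans (coeff-· a g i) (trans (*-congˡ (g< i le)) (zeroʳ a))) (shift-k⊠g≈0 i)) (+-identityʳ _))
  ⊠-leading (a ∷ k) (suc e) g d k< g< = leading , lower
    where
    IH = ⊠-leading k e g d (λ i le → k< (suc i) (s≤s le)) g<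
    a·g≈0 : ∀ i → suc d ≤ i → coeff (a · g) i ≈ 0#
    a·g≈0 i le = trans (coeff-· a g i) (trans (*-congˡ (g< i le)) (zeroʳ a))
    leading : coeff (a · g ⊞ shift (k ⊠ g)) (suc (e ℕ.+ d)) ≈ coeff k e * coeff g d
    leading = trans (coeff-⊞ (a · g) _ (suc (e ℕ.+ d)))
      (trans (+-cong (a·g≈0 _ (s≤s (ℕ.m≤n+m d e))) (proj₁ IH)) (+-identityˡ _))
    lower : Deg< (suc (suc e ℕ.+ d)) (a · g ⊞ shift (k ⊠ g))
    lower (suc i) (s≤s le) = trans (coeff-⊞ (a · g) _ (suc i))
      (trans (+-cong (a·g≈0 _ (s≤s (ℕ.≤-trans (ℕ.m≤n+m d e) (ℕ.≤-trans (ℕ.n≤1+n _) le)))) (proj₂ IH i le)) (+-identityˡ _))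

  infix 4 _∣_
  _∣_ : Poly → Poly → Set (c ⊔ ℓ)
  g ∣ h = Σ Poly λ k → h ≋ k ⊠ g

  ∣-respʳ : ∀ {g h h'} → h ≋ h' → g ∣ h → g ∣ h'
  ∣-respʳ e (k , h≋) = k , ≋-trans (≋-sym e) h≋

  ∣-refl : ∀ g → g ∣ g
  ∣-refl g = 1ₚ , ≋-sym (⊠-identityˡ g)

  ∣-trans : ∀ {f g h} → f ∣ g → g ∣ h → f ∣ h
  ∣-trans {f} (k , g≋) (k' , h≋) = k' ⊠ k , ≋-trans h≋ (≋-trans (⊠-congʳ k' g≋) (≋-sym (⊠-assoc k' k f)))

  ∣-multiple : ∀ g k → g ∣ k ⊠ g
  ∣-multiple g k = k , ≋-refl

  ≋[]⇒∣ : ∀ {g h} → h ≋ [] → g ∣ h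
  ≋[]⇒∣ e = [] , e

  ∣-⊞ : ∀ {g h h'} → g ∣ h → g ∣ h' → g ∣ h ⊞ h'
  ∣-⊞ {g} (k , h≋) (k' , h'≋) = k ⊞ k' , ≋-trans (⊞-cong h≋ h'≋) (≋-sym (⊠-distribʳ k k' g))

  ∣-⊠ : ∀ {g h} w → g ∣ h → g ∣ w ⊠ h
  ∣-⊠ {g} w (k , h≋) = w ⊠ k , ≋-trans (⊠-congʳ w h≋) (≋-sym (⊠-assoc w k g))

  ∣-⊝ : ∀ {g h} → g ∣ h → g ∣ ⊝ h
  ∣-⊝ {g} (k , h≋) = ⊝ k , ≋-trans (⊝-cong h≋) (⊞⊠-solve 2 (λ k g → :⊝ (k :⊠ g) :≋ (:⊝ k) :⊠ g) ≋-refl k g)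

  Deg<∧∣⇒≋[] : ∀ {d g h} → Monic d g → Deg< d h → g ∣ h → ¬ ¬ h ≋ []
  Deg<∧∣⇒≋[] {d} {g} {h} (monic g₁ g<) h< (k , h≋) = ¬¬-≋[]-or-Degree k >>= λ where
    (inj₁ k≋[])           → pure (≋-trans h≋ (⊠-zeroˡ k g k≋[]))
    (inj₂ (j , k≉0 , k<)) → λ _ → k≉0 (begin
      coeff k j                ≈⟨ sym (*-identityʳ _) ⟩
      coeff k j * 1#           ≈⟨ *-congˡ (sym g₁) ⟩
      coeff k j * coeff g d    ≈⟨ sym (proj₁ (⊠-leading k j g d k< g<)) ⟩
      coeff (k ⊠ g) (j ℕ.+ d)  ≈⟨ sym (at h≋ (j ℕ.+ d)) ⟩
      coeff h (j ℕ.+ d)        ≈⟨ h< _ (ℕ.m≤n+m d j) ⟩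
      0#                       ∎)

  Monic⇒∤const : ∀ {d g a} → Monic d g → 0 < d → ¬ a ≈ 0# → ¬ g ∣ constₚ a
  Monic⇒∤const {suc d} g-monic _ a≉0 g∣a =
    Deg<∧∣⇒≋[] g-monic (λ { zero () ; (suc i) _ → refl }) g∣a λ a≋[] → a≉0 (at a≋[] 0)

  infix 4 _≋_mod_
  record _≋_mod_ (p q f : Poly) : Set (c ⊔ ℓ) where
    constructor by-∣
    field ∣-difference : f ∣ p ⊞ ⊝ q
  open _≋_mod_ public

  module Division {d f} (f-monic : Monic d f) where
    private
      divMod : Poly → Poly × Poly
      divMod []      = [] , []
      divMod (a ∷ h) = let (q , r) = divMod h ; t = coeff (a ∷ r) d in
        shift q ⊞ constₚ t , (a ∷ r) ⊞ ⊝ (t · f)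

    quot rem : Poly → Poly
    quot h = proj₁ (divMod h)
    rem  h = proj₂ (divMod h)

    division : ∀ h → h ≋ quot h ⊠ f ⊞ rem h
    division []      = ≋-refl
    division (a ∷ h) = ≋-trans (∷≋constₚ⊞shift a h)
      (≋-trans (⊞-cong (≋-refl {constₚ a}) (≋-trans (shift-cong (division h)) (shift-⊞ (quot h ⊠ f) (rem h))))
      (≋-trans (⊞⊠-solve 4 (λ a qf tf r → a :⊞ (qf :⊞ r) :≋ (qf :⊞ tf) :⊞ ((a :⊞ r) :⊟ tf)) ≋-refl
                 (constₚ a) (shift (quot h ⊠ f)) (t · f) (shift (rem h)))
      (≋-sym (⊞-cong (≋-trans (⊠-distribʳ (shift (quot h)) (constₚ t) f) (⊞-cong (shift-⊠ (quot h) f) (constₚ-⊠ t f)))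
                     (⊞-cong (∷≋constₚ⊞shift a (rem h)) (≋-refl {⊝ (t · f)}))))))
      where t = coeff (a ∷ rem h) d

    rem-Deg< : ∀ h → Deg< d (rem h)
    rem-Deg< []      i _ = refl
    rem-Deg< (a ∷ h) i d≤i with ℕ.m≤n⇒m<n∨m≡n d≤i
    ... | inj₂ ≡.refl = begin
      coeff ((a ∷ rem h) ⊞ ⊝ (t · f)) d   ≈⟨ coeff-⊞ (a ∷ rem h) (⊝ (t · f)) d ⟩
      t + coeff (⊝ (t · f)) d             ≈⟨ +-congˡ (trans (coeff-⊝ (t · f) d) (-‿cong (trans (coeff-· t f d) (trans (*-congˡ (Monic.leading f-monic)) (*-identityʳ t))))) ⟩
      t - t                               ≈⟨ -‿inverseʳ t ⟩
      0#                                  ∎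
      where t = coeff (a ∷ rem h) d
    rem-Deg< (a ∷ h) (suc j) d≤i | inj₁ (s≤s d≤j) = begin
      coeff ((a ∷ rem h) ⊞ ⊝ (t · f)) (suc j)   ≈⟨ coeff-⊞ (a ∷ rem h) (⊝ (t · f)) (suc j) ⟩
      coeff (rem h) j + coeff (⊝ (t · f)) (suc j)
        ≈⟨ +-cong (rem-Deg< h j d≤j) (trans (coeff-⊝ (t · f) (suc j)) (-‿cong (trans (coeff-· t f (suc j)) (trans (*-congˡ (Monic.above f-monic (suc j) (s≤s d≤j))) (zeroʳ t))))) ⟩
      0# - 0#                                   ≈⟨ -‿inverseʳ 0# ⟩
      0#                                        ∎
      where t = coeff (a ∷ rem h) d

    rem≋ : ∀ h → rem h ≋ h ⊞ ⊝ (quot h ⊠ f)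
    rem≋ h = ≋-trans (⊞⊠-solve 2 (λ r qf → r :≋ (qf :⊞ r) :⊟ qf) ≋-refl (rem h) (quot h ⊠ f))
                     (⊞-cong (≋-sym (division h)) ≋-refl)

    rem≈ : ∀ h → rem h ≋ h mod f
    rem≈ h = by-∣ (⊝ quot h , ≋-trans (⊞-cong (rem≋ h) ≋-refl)
      (⊞⊠-solve 3 (λ h q f → (h :⊟ q :⊠ f) :⊟ h :≋ (:⊝ q) :⊠ f) ≋-refl h (quot h) f))

    rem≋[]⇒∣ : ∀ {h} → rem h ≋ [] → f ∣ h
    rem≋[]⇒∣ {h} r≋[] = quot h , ≋-trans (division h) (≋-trans (⊞-cong ≋-refl r≋[]) (⊞-identityʳ _))

    ∣⇒rem≋[] : ∀ {h} → f ∣ h → ¬ ¬ rem h ≋ []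
    ∣⇒rem≋[] {h} (k , h≋) = Deg<∧∣⇒≋[] f-monic (rem-Deg< h) (k ⊞ ⊝ quot h ,
      ≋-trans (rem≋ h) (≋-trans (⊞-cong h≋ ≋-refl)
        (⊞⊠-solve 3 (λ k q f → k :⊠ f :⊟ q :⊠ f :≋ (k :⊟ q) :⊠ f) ≋-refl k (quot h) f)))

  deriv : Poly → Poly
  deriv []      = []
  deriv (a ∷ p) = p ⊞ shift (deriv p)

  deriv-≋[] : ∀ p → p ≋ [] → deriv p ≋ []
  deriv-≋[] []      e = ≋-refl
  deriv-≋[] (a ∷ p) e = ≋-trans (⊞-cong (≋-tail-[] e) (shift-cong (deriv-≋[] p (≋-tail-[] e))))
                                 (mk≋ λ { zero → refl ; (suc i) → refl })

  deriv-cong : ∀ {p q} → p ≋ q → deriv p ≋ deriv q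
  deriv-cong {[]}    {[]}    e = ≋-refl
  deriv-cong {[]}    {b ∷ q} e = ≋-sym (deriv-≋[] (b ∷ q) (≋-sym e))
  deriv-cong {a ∷ p} {[]}    e = deriv-≋[] (a ∷ p) e
  deriv-cong {a ∷ p} {b ∷ q} e = ⊞-cong (≋-tail e) (shift-cong (deriv-cong (≋-tail e)))

  deriv-⊞ : ∀ p q → deriv (p ⊞ q) ≋ deriv p ⊞ deriv q
  deriv-⊞ []      q       = ≋-refl
  deriv-⊞ (a ∷ p) []      = ≋-sym (⊞-identityʳ _)
  deriv-⊞ (a ∷ p) (b ∷ q) = ≋-trans (⊞-cong ≋-refl (≋-trans (shift-cong (deriv-⊞ p q)) (shift-⊞ (deriv p) (deriv q))))
                                    (⊞-interchange p q (shift (deriv p)) (shift (deriv q)))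

  deriv-⊝ : ∀ p → deriv (⊝ p) ≋ ⊝ deriv p
  deriv-⊝ p = inverseˡ-unique (deriv (⊝ p)) (deriv p)
    (≋-trans (≋-sym (deriv-⊞ (⊝ p) p)) (deriv-≋[] (⊝ p ⊞ p) (≋-trans (⊞-comm (⊝ p) p) (⊞-inverseʳ p))))
    where open import Algebra.Properties.Group (CommutativeRing.+-group polynomialRing) using (inverseˡ-unique)

  deriv-· : ∀ a p → deriv (a · p) ≋ a · deriv p
  deriv-· a []      = ≋-refl
  deriv-· a (b ∷ p) = ≋-trans (⊞-cong ≋-refl (≋-trans (shift-cong (deriv-· a p)) (≋-sym (·-shift a (deriv p)))))
                              (≋-sym (·-⊞ a p (shift (deriv p))))

  deriv-⊠ : ∀ p q → deriv (p ⊠ q) ≋ deriv p ⊠ q ⊞ p ⊠ deriv q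
  deriv-⊠ []      q = ≋-refl
  deriv-⊠ (a ∷ p) q = ≋-trans (deriv-⊞ (a · q) (shift (p ⊠ q)))
    (≋-trans (⊞-cong (deriv-· a q) (⊞-cong (≋-refl {p ⊠ q}) (≋-trans (shift-cong (deriv-⊠ p q)) (shift-⊞ (deriv p ⊠ q) (p ⊠ deriv q)))))
    (≋-trans (⊞⊠-solve 4 (λ a pq d₁ d₂ → a :⊞ (pq :⊞ (d₁ :⊞ d₂)) :≋ (pq :⊞ d₁) :⊞ (a :⊞ d₂)) ≋-refl
               (a · deriv q) (p ⊠ q) (shift (deriv p ⊠ q)) (shift (p ⊠ deriv q)))
    (≋-sym (⊞-cong (≋-trans (⊠-distribʳ p (shift (deriv p)) q) (⊞-cong (≋-refl {p ⊠ q}) (shift-⊠ (deriv p) q)))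
                   (≋-refl {a · deriv q ⊞ shift (p ⊠ deriv q)})))))

  X : Poly
  X = shift 1ₚ

  X^_ : ℕ → Poly
  X^ zero  = 1ₚ
  X^ suc n = shift (X^ n)

  X⊠ : ∀ p → X ⊠ p ≋ shift p
  X⊠ p = ≋-trans (shift-⊠ 1ₚ p) (shift-cong (⊠-identityˡ p))

  coeff-X^-n : ∀ n → coeff (X^ n) n ≈ 1#
  coeff-X^-n zero    = refl
  coeff-X^-n (suc n) = coeff-X^-n n

  coeff-X^-≢ : ∀ n i → i ≢ n → coeff (X^ n) i ≈ 0#
  coeff-X^-≢ zero    zero    i≢n = contradiction ≡.refl i≢n
  coeff-X^-≢ zero    (suc i) _   = refl
  coeff-X^-≢ (suc n) zero    _   = refl
  coeff-X^-≢ (suc n) (suc i) i≢n = coeff-X^-≢ n i (i≢n ∘ ≡.cong suc)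

  X^-+ : ∀ m n → X^ (m ℕ.+ n) ≋ X^ m ⊠ X^ n
  X^-+ zero    n = ≋-sym (⊠-identityˡ (X^ n))
  X^-+ (suc m) n = ≋-trans (shift-cong (X^-+ m n)) (≋-sym (shift-⊠ (X^ m) (X^ n)))

  X⊠deriv-X^ : ∀ n → X ⊠ deriv (X^ n) ≋ (n ⨯ 1#) · X^ n
  X⊠deriv-X^ zero    = ≋-trans (⊠-congʳ X {deriv (X^ 0)} {[]} (mk≋ λ { zero → refl ; (suc i) → refl }))
                                 (≋-trans (⊠-zeroʳ X) (≋-sym (0· 1ₚ)))
  X⊠deriv-X^ (suc n) = ≋-trans (⊠-distribˡ X (X^ n) (shift (deriv (X^ n))))
    (≋-trans (⊞-cong (X⊠ (X^ n)) (≋-trans (⊠-shift X (deriv (X^ n))) (shift-cong (X⊠deriv-X^ n))))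
    (≋-trans (⊞-cong (≋-sym (1· (shift (X^ n)))) (≋-sym (·-shift (n ⨯ 1#) (X^ n))))
             (≋-sym (+-· 1# (n ⨯ 1#) (shift (X^ n))))))

  dilate : Carrier → Poly → Poly
  dilate a []      = []
  dilate a (b ∷ p) = b ∷ a · dilate a p

  coeff-dilate : ∀ a p i → coeff (dilate a p) i ≈ a ^ i * coeff p i
  coeff-dilate a []      i       = sym (zeroʳ _)
  coeff-dilate a (b ∷ p) zero    = sym (*-identityˡ b)
  coeff-dilate a (b ∷ p) (suc i) =
    trans (coeff-· a (dilate a p) i) (trans (*-congˡ (coeff-dilate a p i)) (sym (*-assoc _ _ _)))

  dilate-cong : ∀ {a b p q} → a ≈ b → p ≋ q → dilate a p ≋ dilate b q
  dilate-cong {a} {b} {p} {q} a≈b e = mk≋ λ i →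
    trans (coeff-dilate a p i) (trans (*-cong (^-congˡ i a≈b) (at e i)) (sym (coeff-dilate b q i)))

  dilate-⊞ : ∀ a p q → dilate a (p ⊞ q) ≋ dilate a p ⊞ dilate a q
  dilate-⊞ a p q = mk≋ λ i → trans (coeff-dilate a (p ⊞ q) i) (trans (*-congˡ (coeff-⊞ p q i))
    (trans (distribˡ _ _ _) (sym (trans (coeff-⊞ (dilate a p) (dilate a q) i) (+-cong (coeff-dilate a p i) (coeff-dilate a q i))))))

  dilate-⊝ : ∀ a p → dilate a (⊝ p) ≋ ⊝ dilate a p
  dilate-⊝ a p = mk≋ λ i → trans (coeff-dilate a (⊝ p) i) (trans (*-congˡ (coeff-⊝ p i))
    (trans (sym (-‿distribʳ-* _ _)) (sym (trans (coeff-⊝ (dilate a p) i) (-‿cong (coeff-dilate a p i))))))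

  dilate-⊠ : ∀ a p q → dilate a (p ⊠ q) ≋ dilate a p ⊠ dilate a q
  dilate-⊠ a []      q = ≋-refl
  dilate-⊠ a (b ∷ p) q = ≋-trans (dilate-⊞ a (b · q) (shift (p ⊠ q)))
    (⊞-cong dilate-· (shift-cong (≋-trans (·-cong refl (dilate-⊠ a p q)) (≋-sym (·-⊠ a (dilate a p) (dilate a q))))))
    where
    dilate-· : dilate a (b · q) ≋ b · dilate a q
    dilate-· = mk≋ λ i → trans (coeff-dilate a (b · q) i) (trans (*-congˡ (coeff-· b q i))
      (trans (x∙yz≈y∙xz _ b _) (sym (trans (coeff-· b (dilate a q) i) (*-congˡ (coeff-dilate a q i))))))

  dilate-dilate : ∀ a b p → dilate a (dilate b p) ≋ dilate (a * b) p
  dilate-dilate a b p = mk≋ λ i → trans (coeff-dilate a (dilate b p) i) (trans (*-congˡ (coeff-dilate b p i))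
    (trans (sym (*-assoc _ _ _)) (trans (*-congʳ (sym (^-distrib-* a b i))) (sym (coeff-dilate (a * b) p i)))))

  dilate-1 : ∀ p → dilate 1# p ≋ p
  dilate-1 p = mk≋ λ i → trans (coeff-dilate 1# p i) (trans (*-congʳ (1^n≈1 i)) (*-identityˡ _))
    where
    1^n≈1 : ∀ n → 1# ^ n ≈ 1#
    1^n≈1 zero    = refl
    1^n≈1 (suc n) = trans (*-identityˡ _) (1^n≈1 n)

  infixl 9 _∘ₚ_
  _∘ₚ_ : Poly → Poly → Poly
  []      ∘ₚ t = []
  (a ∷ p) ∘ₚ t = constₚ a ⊞ t ⊠ (p ∘ₚ t)

  ∘ₚ-≋[] : ∀ p t → p ≋ [] → p ∘ₚ t ≋ []
  ∘ₚ-≋[] []      t e = ≋-refl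
  ∘ₚ-≋[] (a ∷ p) t e = ≋-trans (⊞-cong (∷-cong (at e 0) ≋-refl) (≋-trans (⊠-congʳ t (∘ₚ-≋[] p t (≋-tail-[] e))) (⊠-zeroʳ t)))
                               (mk≋ λ { zero → refl ; (suc i) → refl })

  ∘ₚ-cong : ∀ {p q} t → p ≋ q → p ∘ₚ t ≋ q ∘ₚ t
  ∘ₚ-cong {[]}    {[]}    t e = ≋-refl
  ∘ₚ-cong {[]}    {b ∷ q} t e = ≋-sym (∘ₚ-≋[] (b ∷ q) t (≋-sym e))
  ∘ₚ-cong {a ∷ p} {[]}    t e = ∘ₚ-≋[] (a ∷ p) t e
  ∘ₚ-cong {a ∷ p} {b ∷ q} t e = ⊞-cong (∷-cong (at e 0) ≋-refl) (⊠-congʳ t (∘ₚ-cong t (≋-tail e)))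

  ∘ₚ-congʳ : ∀ p {t t'} → t ≋ t' → p ∘ₚ t ≋ p ∘ₚ t'
  ∘ₚ-congʳ []      e = ≋-refl
  ∘ₚ-congʳ (a ∷ p) e = ⊞-cong ≋-refl (⊠-cong e (∘ₚ-congʳ p e))

  constₚ-∘ₚ : ∀ a t → constₚ a ∘ₚ t ≋ constₚ a
  constₚ-∘ₚ a t = ≋-trans (⊞-cong (≋-refl {constₚ a}) (⊠-zeroʳ t)) (⊞-identityʳ (constₚ a))

  ∘ₚ-⊞ : ∀ p q t → (p ⊞ q) ∘ₚ t ≋ p ∘ₚ t ⊞ q ∘ₚ t
  ∘ₚ-⊞ []      q       t = ≋-refl
  ∘ₚ-⊞ (a ∷ p) []      t = ≋-sym (⊞-identityʳ _)
  ∘ₚ-⊞ (a ∷ p) (b ∷ q) t = ≋-trans (⊞-cong (≋-refl {constₚ (a + b)}) (⊠-congʳ t (∘ₚ-⊞ p q t)))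
    (⊞⊠-solve 5 (λ a b t p q → (a :⊞ b) :⊞ t :⊠ (p :⊞ q) :≋ (a :⊞ t :⊠ p) :⊞ (b :⊞ t :⊠ q)) ≋-refl
      (constₚ a) (constₚ b) t (p ∘ₚ t) (q ∘ₚ t))

  ∘ₚ-⊠ : ∀ p q t → (p ⊠ q) ∘ₚ t ≋ p ∘ₚ t ⊠ q ∘ₚ t
  ∘ₚ-⊠ []      q t = ≋-refl
  ∘ₚ-⊠ (a ∷ p) q t = ≋-trans (∘ₚ-⊞ (a · q) (shift (p ⊠ q)) t)
    (≋-trans (⊞-cong (≋-trans (∘ₚ-cong t (≋-sym (constₚ-⊠ a q))) (∘ₚ-· q))
                      (≋-trans (⊞-cong (mk≋ λ { zero → refl ; (suc i) → refl }) (⊠-congʳ t (∘ₚ-⊠ p q t))) (⊞-identityˡ _)))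
    (⊞⊠-solve 4 (λ a q t p → a :⊠ q :⊞ t :⊠ (p :⊠ q) :≋ (a :⊞ t :⊠ p) :⊠ q) ≋-refl (constₚ a) (q ∘ₚ t) t (p ∘ₚ t)))
    where
    ⊞-identityˡ : ∀ p → [] ⊞ p ≋ p
    ⊞-identityˡ p = ≋-refl
    ∘ₚ-· : ∀ q → (constₚ a ⊠ q) ∘ₚ t ≋ constₚ a ⊠ q ∘ₚ t
    ∘ₚ-· q = ≋-trans (∘ₚ-cong t (constₚ-⊠ a q)) (≋-trans (go q) (≋-sym (constₚ-⊠ a (q ∘ₚ t))))
      where
      go : ∀ q → (a · q) ∘ₚ t ≋ a · (q ∘ₚ t)
      go []      = ≋-refl
      go (b ∷ q) = ≋-trans (⊞-cong (≋-refl {constₚ (a * b)}) (≋-trans (⊠-congʳ t (go q))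
                     (≋-trans (⊠-comm t (a · (q ∘ₚ t))) (≋-trans (·-⊠ a (q ∘ₚ t) t) (·-cong refl (⊠-comm (q ∘ₚ t) t))))))
                     (≋-sym (·-⊞ a (constₚ b) (t ⊠ (q ∘ₚ t))))

  ∘ₚ-⊝ : ∀ p t → (⊝ p) ∘ₚ t ≋ ⊝ (p ∘ₚ t)
  ∘ₚ-⊝ []      t = ≋-refl
  ∘ₚ-⊝ (a ∷ p) t = ≋-trans (⊞-cong (≋-refl {constₚ (- a)}) (⊠-congʳ t (∘ₚ-⊝ p t)))
    (⊞⊠-solve 3 (λ a t p → :⊝ a :⊞ t :⊠ (:⊝ p) :≋ :⊝ (a :⊞ t :⊠ p)) ≋-refl (constₚ a) t (p ∘ₚ t))

  ∘ₚ-X : ∀ p → p ∘ₚ X ≋ p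
  ∘ₚ-X []      = ≋-refl
  ∘ₚ-X (a ∷ p) = ≋-trans (⊞-cong (≋-refl {constₚ a}) (≋-trans (⊠-congʳ X (∘ₚ-X p)) (X⊠ p))) (≋-sym (∷≋constₚ⊞shift a p))

  ∘ₚ-assoc : ∀ p r t → (p ∘ₚ r) ∘ₚ t ≋ p ∘ₚ (r ∘ₚ t)
  ∘ₚ-assoc []      r t = ≋-refl
  ∘ₚ-assoc (a ∷ p) r t = ≋-trans (∘ₚ-⊞ (constₚ a) (r ⊠ (p ∘ₚ r)) t)
    (⊞-cong (constₚ-∘ₚ a t) (≋-trans (∘ₚ-⊠ r (p ∘ₚ r) t) (⊠-congʳ (r ∘ₚ t) (∘ₚ-assoc p r t))))

  ∣⇒≋[]mod : ∀ {f p} → f ∣ p → p ≋ [] mod f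
  ∣⇒≋[]mod f∣p = by-∣ (∣-respʳ (≋-sym (⊞-identityʳ _)) f∣p)

  ≋[]mod⇒∣ : ∀ {f p} → p ≋ [] mod f → f ∣ p
  ≋[]mod⇒∣ (by-∣ f∣p) = ∣-respʳ (⊞-identityʳ _) f∣p

  ≋⇒≋mod : ∀ {f p q} → p ≋ q → p ≋ q mod f
  ≋⇒≋mod {q = q} e = by-∣ (≋[]⇒∣ (≋-trans (⊞-cong e (≋-refl {⊝ q})) (⊞-inverseʳ q)))

  ≋mod-sym : ∀ {f p q} → p ≋ q mod f → q ≋ p mod f
  ≋mod-sym {p = p} {q} (by-∣ d) = by-∣ (∣-respʳ (⊞⊠-solve 2 (λ p q → :⊝ (p :⊟ q) :≋ q :⊟ p) ≋-refl p q) (∣-⊝ d))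

  ≋mod-trans : ∀ {f p q r} → p ≋ q mod f → q ≋ r mod f → p ≋ r mod f
  ≋mod-trans {p = p} {q} {r} (by-∣ d) (by-∣ d') =
    by-∣ (∣-respʳ (⊞⊠-solve 3 (λ p q r → (p :⊟ q) :⊞ (q :⊟ r) :≋ p :⊟ r) ≋-refl p q r) (∣-⊞ d d'))

  ≋mod-resp : ∀ {f p p' q q'} → p ≋ p' → q ≋ q' → p ≋ q mod f → p' ≋ q' mod f
  ≋mod-resp p≋p' q≋q' d = ≋mod-trans (≋⇒≋mod (≋-sym p≋p')) (≋mod-trans d (≋⇒≋mod q≋q'))

  ≋mod-⊝ : ∀ {f p q} → p ≋ q mod f → ⊝ p ≋ ⊝ q mod f
  ≋mod-⊝ {p = p} {q} (by-∣ d) = by-∣ (∣-respʳ (⊞⊠-solve 2 (λ p q → :⊝ (p :⊟ q) :≋ (:⊝ p) :⊟ (:⊝ q)) ≋-refl p q) (∣-⊝ d))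

  ≋mod-⊞ : ∀ {f p p' q q'} → p ≋ p' mod f → q ≋ q' mod f → p ⊞ q ≋ p' ⊞ q' mod f
  ≋mod-⊞ {p = p} {p'} {q} {q'} (by-∣ d) (by-∣ d') = by-∣
    (∣-respʳ (⊞⊠-solve 4 (λ p p' q q' → (p :⊟ p') :⊞ (q :⊟ q') :≋ (p :⊞ q) :⊟ (p' :⊞ q')) ≋-refl p p' q q') (∣-⊞ d d'))

  ≋mod-⊠ : ∀ {f p p' q q'} → p ≋ p' mod f → q ≋ q' mod f → p ⊠ q ≋ p' ⊠ q' mod f
  ≋mod-⊠ {p = p} {p'} {q} {q'} (by-∣ d) (by-∣ d') = by-∣
    (∣-respʳ (⊞⊠-solve 4 (λ p p' q q' → q :⊠ (p :⊟ p') :⊞ p' :⊠ (q :⊟ q') :≋ p :⊠ q :⊟ p' :⊠ q') ≋-refl p p' q q')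
             (∣-⊞ (∣-⊠ q d) (∣-⊠ p' d')))

  Φ : ℕ → Poly
  Φ zero    = []
  Φ (suc n) = Φ n ⊞ X^ n

  ΣΦ : ℕ → Poly
  ΣΦ zero    = []
  ΣΦ (suc n) = ΣΦ n ⊞ Φ n

  X-1 : Poly
  X-1 = X ⊞ ⊝ 1ₚ

  X^≋[X-1]⊠Φ⊞1 : ∀ n → X^ n ≋ X-1 ⊠ Φ n ⊞ 1ₚ
  X^≋[X-1]⊠Φ⊞1 zero    = ≋-sym (⊞-cong (⊠-zeroʳ X-1) (≋-refl {1ₚ}))
  X^≋[X-1]⊠Φ⊞1 (suc n) = ≋-trans (≋-sym (X⊠ (X^ n))) (≋-trans (⊠-congʳ X (X^≋[X-1]⊠Φ⊞1 n))
    (≋-trans (⊞⊠-solve 2 (λ x φ → x :⊠ ((x :⊟ :c (+ 1)) :⊠ φ :⊞ :c (+ 1))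
                                 :≋ (x :⊟ :c (+ 1)) :⊠ (φ :⊞ ((x :⊟ :c (+ 1)) :⊠ φ :⊞ :c (+ 1))) :⊞ :c (+ 1)) ≋-refl X (Φ n))
             (⊞-cong (⊠-congʳ X-1 (⊞-cong (≋-refl {Φ n}) (≋-sym (X^≋[X-1]⊠Φ⊞1 n)))) (≋-refl {1ₚ}))))

  Φ≋[X-1]⊠ΣΦ⊞n : ∀ n → Φ n ≋ X-1 ⊠ ΣΦ n ⊞ constₚ (n ⨯ 1#)
  Φ≋[X-1]⊠ΣΦ⊞n zero    = ≋-sym (≋-trans (⊞-cong (⊠-zeroʳ X-1) (≋-refl {constₚ 0#})) (mk≋ λ { zero → refl ; (suc i) → refl }))
  Φ≋[X-1]⊠ΣΦ⊞n (suc n) = ≋-trans (⊞-cong (Φ≋[X-1]⊠ΣΦ⊞n n) (X^≋[X-1]⊠Φ⊞1 n))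
    (≋-trans (⊞⊠-solve 4 (λ w t c φ → (w :⊠ t :⊞ c) :⊞ (w :⊠ φ :⊞ :c (+ 1)) :≋ w :⊠ (t :⊞ φ) :⊞ (:c (+ 1) :⊞ c)) ≋-refl
               X-1 (ΣΦ n) (constₚ (n ⨯ 1#)) (Φ n))
             (⊞-cong (≋-refl {X-1 ⊠ (ΣΦ n ⊞ Φ n)}) (mk≋ {1ₚ ⊞ constₚ (n ⨯ 1#)} {constₚ (suc n ⨯ 1#)} λ { zero → refl ; (suc i) → refl })))

  coeff-Φ-≥ : ∀ n i → n ≤ i → coeff (Φ n) i ≈ 0#
  coeff-Φ-≥ zero    i _  = refl
  coeff-Φ-≥ (suc n) i le = trans (coeff-⊞ (Φ n) (X^ n) i)
    (trans (+-cong (coeff-Φ-≥ n i (ℕ.≤-trans (ℕ.n≤1+n n) le)) (coeff-X^-≢ n i (λ i≡n → ℕ.<-irrefl (≡.sym i≡n) le))) (+-identityʳ _))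

  coeff-Φ-< : ∀ n i → i < n → coeff (Φ n) i ≈ 1#
  coeff-Φ-< (suc n) i i<1+n with ℕ.m≤n⇒m<n∨m≡n (ℕ.≤-pred i<1+n)
  ... | inj₁ i<n    = trans (coeff-⊞ (Φ n) (X^ n) i)
    (trans (+-cong (coeff-Φ-< n i i<n) (coeff-X^-≢ n i (λ i≡n → ℕ.<-irrefl i≡n i<n))) (+-identityʳ _))
  ... | inj₂ ≡.refl = trans (coeff-⊞ (Φ n) (X^ n) i) (trans (+-cong (coeff-Φ-≥ n i ℕ.≤-refl) (coeff-X^-n i)) (+-identityˡ _))

  Φ-monic : ∀ n → Monic n (Φ (suc n))
  Φ-monic n = monic (coeff-Φ-< (suc n) n ℕ.≤-refl) (coeff-Φ-≥ (suc n))

  pairing : (ℕ → Carrier) → Poly → Carrier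
  pairing χ []      = 0#
  pairing χ (a ∷ p) = χ 0 * a + pairing (χ ∘ suc) p

  pairing-≋[] : ∀ χ p → p ≋ [] → pairing χ p ≈ 0#
  pairing-≋[] χ []      e = refl
  pairing-≋[] χ (a ∷ p) e = trans (+-cong (trans (*-congˡ (at e 0)) (zeroʳ _)) (pairing-≋[] _ p (≋-tail-[] e))) (+-identityʳ 0#)

  pairing-cong : ∀ χ {p q} → p ≋ q → pairing χ p ≈ pairing χ q
  pairing-cong χ {[]}    {[]}    e = refl
  pairing-cong χ {[]}    {b ∷ q} e = sym (pairing-≋[] χ (b ∷ q) (≋-sym e))
  pairing-cong χ {a ∷ p} {[]}    e = pairing-≋[] χ (a ∷ p) e
  pairing-cong χ {a ∷ p} {b ∷ q} e = +-cong (*-congˡ (at e 0)) (pairing-cong _ (≋-tail e))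

  pairing-congˡ : ∀ {χ χ′} p → (∀ i → χ i ≈ χ′ i) → pairing χ p ≈ pairing χ′ p
  pairing-congˡ []      χ≈χ′ = refl
  pairing-congˡ (a ∷ p) χ≈χ′ = +-cong (*-congʳ (χ≈χ′ 0)) (pairing-congˡ p (χ≈χ′ ∘ suc))

  pairing-⊞ : ∀ χ p q → pairing χ (p ⊞ q) ≈ pairing χ p + pairing χ q
  pairing-⊞ χ []      q       = sym (+-identityˡ _)
  pairing-⊞ χ (a ∷ p) []      = sym (+-identityʳ _)
  pairing-⊞ χ (a ∷ p) (b ∷ q) = trans (+-cong (distribˡ _ _ _) (pairing-⊞ _ p q)) (interchange _ _ _ _)

  pairing-⊝ : ∀ χ p → pairing χ (⊝ p) ≈ - pairing χ p
  pairing-⊝ χ []      = sym -0#≈0#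
  pairing-⊝ χ (a ∷ p) = trans (+-cong (sym (-‿distribʳ-* _ _)) (pairing-⊝ _ p)) (sym (trans (-‿anti-homo-+ _ _) (+-comm _ _)))

  pairing-shift : ∀ χ p → pairing χ (shift p) ≈ pairing (χ ∘ suc) p
  pairing-shift χ p = trans (+-congʳ (zeroʳ _)) (+-identityˡ _)

  pairing-X^⊠ : ∀ χ n g → pairing χ (X^ n ⊠ g) ≈ pairing (λ i → χ (n ℕ.+ i)) g
  pairing-X^⊠ χ zero    g = pairing-cong χ (⊠-identityˡ g)
  pairing-X^⊠ χ (suc n) g = trans (pairing-cong χ (shift-⊠ (X^ n) g)) (trans (pairing-shift χ (X^ n ⊠ g)) (pairing-X^⊠ (χ ∘ suc) n g))

  pairing-single : ∀ p χ j → (∀ m → m ≢ j → χ m * coeff p m ≈ 0#) → pairing χ p ≈ χ j * coeff p j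
  pairing-single []      χ j       others = sym (zeroʳ _)
  pairing-single (a ∷ p) χ zero    others = trans (+-congˡ (all-zero p (χ ∘ suc) (λ m → others (suc m) λ ()))) (+-identityʳ _)
    where
    all-zero : ∀ p χ → (∀ m → χ m * coeff p m ≈ 0#) → pairing χ p ≈ 0#
    all-zero []      χ χp≈0 = refl
    all-zero (a ∷ p) χ χp≈0 = trans (+-cong (χp≈0 0) (all-zero p (χ ∘ suc) (χp≈0 ∘ suc))) (+-identityʳ 0#)
  pairing-single (a ∷ p) χ (suc j) others =
    trans (+-cong (others 0 λ ()) (pairing-single p (χ ∘ suc) j λ m m≢j → others (suc m) (m≢j ∘ ℕ.suc-injective))) (+-identityˡ _)

module FieldArithmetic {c ℓ} (K : DiffField c ℓ) where
  open import Data.Nat as ℕ using (ℕ; zero; suc; _<_; s≤s; z≤n)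
  import Data.Nat.Properties as ℕ
  open import Data.Product using (Σ; _,_; proj₁; proj₂; _×_)
  open import Data.Sum using (_⊎_; inj₁; inj₂)
  open import Data.Integer using (+_)
  open import Relation.Nullary using (¬_; yes; no)
  open import Relation.Nullary.Decidable using (¬¬-excluded-middle)
  import Relation.Binary.PropositionalEquality as ≡
  open DoubleNegation

  open DiffField K
  open IntegerCoefficientSolver commRing using (solve; _:=_; _:+_; _:*_; :-_; _:-_; con)
  open import Algebra.Properties.CommutativeSemiring.Exp commutativeSemiring public using (_^_; ^-congˡ; ^-homo-*; ^-assocʳ; ^-distrib-*)
  open import Relation.Binary.Reasoning.Setoid setoid
  open import Algebra.Properties.Ring ring using (-0#≈0#; -‿anti-homo-+)

  _⁻¹⟨_⟩ : ∀ x → ¬ x ≈ 0# → Carrier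
  x ⁻¹⟨ x≉0 ⟩ = proj₁ (inverse x x≉0)

  ⁻¹-inverseˡ : ∀ x x≉0 → x ⁻¹⟨ x≉0 ⟩ * x ≈ 1#
  ⁻¹-inverseˡ x x≉0 = trans (*-comm _ _) (proj₂ (inverse x x≉0))

  *-cancelˡ-≈0 : ∀ {a x} → ¬ a ≈ 0# → a * x ≈ 0# → x ≈ 0#
  *-cancelˡ-≈0 {a} {x} a≉0 ax≈0 = begin
    x                          ≈⟨ sym (*-identityˡ x) ⟩
    1# * x                     ≈⟨ *-congʳ (sym (⁻¹-inverseˡ a a≉0)) ⟩
    (a ⁻¹⟨ a≉0 ⟩ * a) * x       ≈⟨ *-assoc _ _ _ ⟩
    a ⁻¹⟨ a≉0 ⟩ * (a * x)       ≈⟨ *-congˡ ax≈0 ⟩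
    a ⁻¹⟨ a≉0 ⟩ * 0#            ≈⟨ zeroʳ _ ⟩
    0#                         ∎

  *-≉0 : ∀ {a b} → ¬ a ≈ 0# → ¬ b ≈ 0# → ¬ a * b ≈ 0#
  *-≉0 a≉0 b≉0 ab≈0 = b≉0 (*-cancelˡ-≈0 a≉0 ab≈0)

  -≈0⇒≈ : ∀ {x y} → x - y ≈ 0# → x ≈ y
  -≈0⇒≈ {x} {y} x-y≈0 = begin
    x              ≈⟨ solve 2 (λ x y → x := (x :- y) :+ y) refl x y ⟩
    (x - y) + y    ≈⟨ +-congʳ x-y≈0 ⟩
    0# + y         ≈⟨ +-identityˡ y ⟩
    y              ∎

  ≈⇒-≈0 : ∀ {x y} → x ≈ y → x - y ≈ 0#
  ≈⇒-≈0 {x} {y} x≈y = trans (+-congʳ x≈y) (-‿inverseʳ y)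

  *-cancelʳ : ∀ {a b z} → ¬ z ≈ 0# → a * z ≈ b * z → a ≈ b
  *-cancelʳ {a} {b} {z} z≉0 az≈bz =
    -≈0⇒≈ (*-cancelˡ-≈0 z≉0 (trans (solve 3 (λ z a b → z :* (a :- b) := a :* z :- b :* z) refl z a b) (≈⇒-≈0 az≈bz)))

  ¬¬-zero-product : ∀ {a b} → a * b ≈ 0# → ¬ ¬ (a ≈ 0# ⊎ b ≈ 0#)
  ¬¬-zero-product ab≈0 = ¬¬-excluded-middle >>= λ where
    (yes a≈0) → pure (inj₁ a≈0)
    (no a≉0)  → pure (inj₂ (*-cancelˡ-≈0 a≉0 ab≈0))

  ^-≉0 : ∀ {x} k → ¬ x ≈ 0# → ¬ x ^ k ≈ 0#
  ^-≉0 zero    x≉0 = 1≉0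
  ^-≉0 (suc k) x≉0 = *-≉0 x≉0 (^-≉0 k x≉0)

  0^suc : ∀ k → 0# ^ suc k ≈ 0#
  0^suc k = zeroˡ _

  1^k : ∀ k → 1# ^ k ≈ 1#
  1^k zero    = refl
  1^k (suc k) = trans (*-identityˡ _) (1^k k)

  ^-comm : ∀ x a b → (x ^ a) ^ b ≈ (x ^ b) ^ a
  ^-comm x a b = trans (^-assocʳ x a b) (trans (reflexive (≡.cong (x ^_) (ℕ.*-comm a b))) (sym (^-assocʳ x b a)))

  x^q≈1⇒x^kq≈1 : ∀ {x} q → x ^ q ≈ 1# → ∀ k → x ^ (k ℕ.* q) ≈ 1#
  x^q≈1⇒x^kq≈1 {x} q x^q≈1 k = trans (reflexive (≡.cong (x ^_) (ℕ.*-comm k q)))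
    (trans (sym (^-assocʳ x q k)) (trans (^-congˡ k x^q≈1) (1^k k)))

  ^≈1⇒^^≈1 : ∀ {x} q → x ^ q ≈ 1# → ∀ a → (x ^ a) ^ q ≈ 1#
  ^≈1⇒^^≈1 {x} q x^q≈1 a = trans (^-comm x a q) (trans (^-congˡ a x^q≈1) (1^k a))

  ∑ : ℕ → (ℕ → Carrier) → Carrier
  ∑ zero    f = 0#
  ∑ (suc n) f = ∑ n f + f n

  ∑-cong : ∀ n {f g} → (∀ i → i < n → f i ≈ g i) → ∑ n f ≈ ∑ n g
  ∑-cong zero    f≈g = refl
  ∑-cong (suc n) f≈g = +-cong (∑-cong n (λ i i<n → f≈g i (ℕ.m≤n⇒m≤1+n i<n))) (f≈g n ℕ.≤-refl)

  ∑-distrib-+ : ∀ n (f g : ℕ → Carrier) → ∑ n (λ i → f i + g i) ≈ ∑ n f + ∑ n g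
  ∑-distrib-+ zero    f g = sym (+-identityˡ _)
  ∑-distrib-+ (suc n) f g = trans (+-congʳ (∑-distrib-+ n f g))
    (solve 4 (λ a b x y → (a :+ b) :+ (x :+ y) := (a :+ x) :+ (b :+ y)) refl (∑ n f) (∑ n g) (f n) (g n))

  *-distribˡ-∑ : ∀ n a (f : ℕ → Carrier) → a * ∑ n f ≈ ∑ n (λ i → a * f i)
  *-distribˡ-∑ zero    a f = zeroʳ a
  *-distribˡ-∑ (suc n) a f = trans (distribˡ _ _ _) (+-congʳ (*-distribˡ-∑ n a f))

  ∑-zero : ∀ n (f : ℕ → Carrier) → (∀ i → i < n → f i ≈ 0#) → ∑ n f ≈ 0#
  ∑-zero zero    f f≈0 = refl
  ∑-zero (suc n) f f≈0 = trans (+-cong (∑-zero n f (λ i i<n → f≈0 i (ℕ.m≤n⇒m≤1+n i<n))) (f≈0 n ℕ.≤-refl)) (+-identityʳ 0#)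

  ∑-comm : ∀ n m (F : ℕ → ℕ → Carrier) → ∑ n (λ i → ∑ m (F i)) ≈ ∑ m (λ j → ∑ n (λ i → F i j))
  ∑-comm zero    m F = sym (∑-zero m _ (λ _ _ → refl))
  ∑-comm (suc n) m F = trans (+-congʳ (∑-comm n m F)) (sym (∑-distrib-+ m (λ j → ∑ n (λ i → F i j)) (F n)))

  ∑-first : ∀ n (f : ℕ → Carrier) → ∑ (suc n) f ≈ f 0 + ∑ n (λ i → f (suc i))
  ∑-first zero    f = trans (+-identityˡ _) (sym (+-identityʳ _))
  ∑-first (suc n) f = trans (+-congʳ (∑-first n f)) (+-assoc _ _ _)

  ∑-single : ∀ n (f : ℕ → Carrier) → (∀ i → 0 < i → i < suc n → f i ≈ 0#) → ∑ (suc n) f ≈ f 0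
  ∑-single n f f≈0 = trans (∑-first n f)
    (trans (+-congˡ (∑-zero n (λ i → f (suc i)) (λ i i<n → f≈0 (suc i) (s≤s z≤n) (s≤s i<n)))) (+-identityʳ _))

  ∑-telescope : ∀ n (g : ℕ → Carrier) → ∑ n (λ j → g (suc j) - g j) ≈ g n - g 0
  ∑-telescope zero    g = sym (-‿inverseʳ (g 0))
  ∑-telescope (suc n) g = trans (+-congʳ (∑-telescope n g))
    (solve 3 (λ a b c → (b :- a) :+ (c :- b) := c :- a) refl (g 0) (g n) (g (suc n)))

  ∑-rotate : ∀ n (g : ℕ → Carrier) → g n ≈ g 0 → ∑ n (λ j → g (suc j)) ≈ ∑ n g
  ∑-rotate n g gn≈g0 = -≈0⇒≈ (trans (sym (∑-telescope-sum)) (trans (∑-telescope n g) (≈⇒-≈0 gn≈g0)))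
    where
    ∑-telescope-sum : ∑ n (λ j → g (suc j) - g j) ≈ ∑ n (λ j → g (suc j)) - ∑ n g
    ∑-telescope-sum = trans (∑-distrib-+ n (λ j → g (suc j)) (λ j → - g j)) (+-congˡ (∑-neg n))
      where
      ∑-neg : ∀ n → ∑ n (λ j → - g j) ≈ - ∑ n g
      ∑-neg zero    = sym -0#≈0#
      ∑-neg (suc n) = trans (+-congʳ (∑-neg n)) (sym (trans (-‿anti-homo-+ _ _) (+-comm _ _)))

  ∑-geometric : ∀ n x → (x - 1#) * ∑ n (x ^_) ≈ x ^ n - 1#
  ∑-geometric n x = trans (*-distribˡ-∑ n (x - 1#) (x ^_))
    (trans (∑-cong n (λ i _ → solve 2 (λ x p → (x :- con (+ 1)) :* p := x :* p :- p) refl x (x ^ i))) (∑-telescope n (x ^_)))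

  ∑-const : ∀ n a → ∑ n (λ _ → a) ≈ natCast K n * a
  ∑-const zero    a = sym (zeroˡ a)
  ∑-const (suc n) a = trans (+-congʳ (∑-const n a))
    (solve 2 (λ n a → n :* a :+ a := (con (+ 1) :+ n) :* a) refl (natCast K n) a)

  module RootsOfUnity (ch0 : Char0 K) (q′ : ℕ) (ζ : Carrier) (ζ^q≈1 : ζ ^ suc q′ ≈ 1#)
                      (ζ-primitive : ∀ k → 0 < k → k < suc q′ → ¬ ζ ^ k ≈ 1#) where
    q = suc q′
    ω = ζ ^ q′

    ζω≈1 : ζ * ω ≈ 1#
    ζω≈1 = ζ^q≈1

    ζ^k*ω^k≈1 : ∀ k → ζ ^ k * ω ^ k ≈ 1#
    ζ^k*ω^k≈1 k = trans (sym (^-distrib-* ζ ω k)) (trans (^-congˡ k ζω≈1) (1^k k))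

    ω^q≈1 : ω ^ q ≈ 1#
    ω^q≈1 = ^≈1⇒^^≈1 q ζ^q≈1 q′

    ω-primitive : ∀ j → 0 < j → j < q → ¬ ω ^ j ≈ 1#
    ω-primitive j 0<j j<q ω^j≈1 = ζ-primitive j 0<j j<q
      (trans (sym (*-identityʳ _)) (trans (*-congˡ (sym ω^j≈1)) (ζ^k*ω^k≈1 j)))

    ∑-root≈0 : ∀ x → x ^ q ≈ 1# → ¬ x ≈ 1# → ∑ q (x ^_) ≈ 0#
    ∑-root≈0 x x^q≈1 x≉1 = *-cancelˡ-≈0 (λ x-1≈0 → x≉1 (-≈0⇒≈ x-1≈0)) (trans (∑-geometric q x) (≈⇒-≈0 x^q≈1))

    q≉0 : ¬ natCast K q ≈ 0#
    q≉0 = ch0 q′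

    orthogonality : ∀ (F : ℕ → Carrier) → ∑ q (λ k → ∑ q (λ j → (ω ^ j) ^ k * F j)) ≈ natCast K q * F 0
    orthogonality F = begin
      ∑ q (λ k → ∑ q (λ j → (ω ^ j) ^ k * F j))   ≈⟨ ∑-comm q q _ ⟩
      ∑ q (λ j → ∑ q (λ k → (ω ^ j) ^ k * F j))   ≈⟨ ∑-cong q (λ j _ → trans (∑-cong q (λ k _ → *-comm _ _)) (sym (*-distribˡ-∑ q (F j) ((ω ^ j) ^_)))) ⟩
      ∑ q (λ j → F j * ∑ q ((ω ^ j) ^_))          ≈⟨ ∑-single q′ _ (λ j 0<j j<q → trans (*-congˡ (∑-root≈0 (ω ^ j) (^≈1⇒^^≈1 q ω^q≈1 j) (ω-primitive j 0<j j<q))) (zeroʳ _)) ⟩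
      F 0 * ∑ q (1# ^_)                          ≈⟨ *-congˡ (trans (∑-cong q (λ k _ → 1^k k)) (trans (∑-const q 1#) (*-identityʳ _))) ⟩
      F 0 * natCast K q                          ≈⟨ *-comm _ _ ⟩
      natCast K q * F 0                          ∎

    ¬¬-power-of-ζ : ∀ u → u ^ q ≈ 1# → ¬ ¬ Σ ℕ λ k → k < q × u ≈ ζ ^ k
    ¬¬-power-of-ζ u u^q≈1 none = q≉0 (begin
      natCast K q                                  ≈⟨ sym (*-identityʳ _) ⟩
      natCast K q * u ^ 0                          ≈⟨ sym (orthogonality (u ^_)) ⟩
      ∑ q (λ k → ∑ q (λ j → (ω ^ j) ^ k * u ^ j))   ≈⟨ ∑-cong q (λ k k<q → trans (∑-cong q (λ j _ → reorder k j)) (∑-root≈0 (u * ω ^ k) (uω^k-root k) (uω^k≉1 k k<q))) ⟩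
      ∑ q (λ _ → 0#)                               ≈⟨ ∑-zero q _ (λ _ _ → refl) ⟩
      0#                                           ∎)
      where
      reorder : ∀ k j → (ω ^ j) ^ k * u ^ j ≈ (u * ω ^ k) ^ j
      reorder k j = trans (*-comm _ _) (trans (*-congˡ (^-comm ω j k)) (sym (^-distrib-* u (ω ^ k) j)))
      uω^k-root : ∀ k → (u * ω ^ k) ^ q ≈ 1#
      uω^k-root k = trans (^-distrib-* u (ω ^ k) q) (trans (*-cong u^q≈1 (^≈1⇒^^≈1 q ω^q≈1 k)) (*-identityˡ 1#))
      uω^k≉1 : ∀ k → k < q → ¬ u * ω ^ k ≈ 1#
      uω^k≉1 k k<q uω^k≈1 = none (k , k<q , (begin
        u                          ≈⟨ sym (*-identityʳ u) ⟩
        u * 1#                     ≈⟨ *-congˡ (sym (ζ^k*ω^k≈1 k)) ⟩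
        u * (ζ ^ k * ω ^ k)        ≈⟨ solve 3 (λ u a b → u :* (a :* b) := (u :* b) :* a) refl u (ζ ^ k) (ω ^ k) ⟩
        (u * ω ^ k) * ζ ^ k        ≈⟨ *-congʳ uω^k≈1 ⟩
        1# * ζ ^ k                 ≈⟨ *-identityˡ _ ⟩
        ζ ^ k                      ∎))


module FieldPolynomials {c ℓ} (K : DiffField c ℓ) where
  open import Level using (_⊔_)
  open import Data.Nat as ℕ using (ℕ; zero; suc; _≤_; _<_; s≤s; z≤n)
  import Data.Nat.Properties as ℕ
  open import Data.List using (List; []; _∷_)
  open import Data.Product using (Σ; _,_; proj₁; _×_)
  open import Data.Sum using (inj₁; inj₂)
  open import Data.Integer using (+_)
  open import Data.Empty using (⊥)
  open import Relation.Nullary using (¬_; yes; no; contradiction)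
  open import Relation.Nullary.Negation using (¬¬-map)
  import Relation.Binary.PropositionalEquality as ≡
  open DoubleNegation

  open DiffField K
  open FieldArithmetic K public
  open Polynomials commRing public
  open import Relation.Binary.Reasoning.Setoid setoid
  open import Algebra.Properties.Group +-group using (identityʳ-unique; inverseʳ-unique)

  -- The ideal (g, p) is generated by a monic element s̃ of least degree, which
  -- divides g and p; minimality of g then forces s̃ = 1.
  module Bezout {g d} (g-monic : Monic d g) (0<d : 0 < d)
                (g-minimal : ∀ {j g′} → 0 < j → j < d → Monic j g′ → g′ ∣ g → ⊥) where
    open Division g-monic using () renaming (rem to rem-g; rem-Deg< to rem-g-Deg<)

    BezoutIdentity : Poly → Set (c ⊔ ℓ)
    BezoutIdentity p = Σ Poly λ a → Σ Poly λ b → a ⊠ g ⊞ b ⊠ p ≋ 1ₚ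

    module Ideal (p : Poly) where
      InIdeal : Poly → Set (c ⊔ ℓ)
      InIdeal ρ = Σ Poly λ α → Σ Poly λ β → ρ ≋ α ⊠ g ⊞ β ⊠ p

      DegreeInIdeal : ℕ → Set (c ⊔ ℓ)
      DegreeInIdeal j = Σ Poly λ ρ → InIdeal ρ × Degree j ρ

      rem-in-ideal : ∀ {d′ s} (s-monic : Monic d′ s) → InIdeal s → ∀ {y} → InIdeal y →
                     InIdeal (Division.rem s-monic y)
      rem-in-ideal {s = s} s-monic (α , β , s≋) {y} (α′ , β′ , y≋) = α′ ⊞ ⊝ (q ⊠ α) , β′ ⊞ ⊝ (q ⊠ β) ,
        ≋-trans (Division.rem≋ s-monic y) (≋-trans (⊞-cong y≋ (⊝-cong (⊠-congʳ q s≋)))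
          (⊞⊠-solve 7 (λ α′ g β′ p q α β → α′ :⊠ g :⊞ β′ :⊠ p :⊟ q :⊠ (α :⊠ g :⊞ β :⊠ p)
                                        :≋ (α′ :⊟ q :⊠ α) :⊠ g :⊞ (β′ :⊟ q :⊠ β) :⊠ p) ≋-refl α′ g β′ p q α β))
        where q = Division.quot s-monic y

      g-in-ideal : InIdeal g
      g-in-ideal = 1ₚ , [] , ≋-sym (≋-trans (⊞-cong (⊠-identityˡ g) (⊠-zeroˡ [] p ≋-refl)) (⊞-identityʳ g))

      p-in-ideal : InIdeal p
      p-in-ideal = [] , 1ₚ , ≋-sym (⊠-identityˡ p)

      nonzero-element : ¬ g ∣ p → ¬ ¬ Σ ℕ DegreeInIdeal
      nonzero-element g∤p = ¬¬-≋[]-or-Degree (rem-g p) >>= λ where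
        (inj₁ r≋[])        → contradiction (Division.rem≋[]⇒∣ g-monic r≋[]) g∤p
        (inj₂ (j , r-deg)) → pure (j , rem-g p , rem-in-ideal g-monic g-in-ideal p-in-ideal , r-deg)

      module LeastElement {j₀ s} (a b : Poly) (s≋ : s ≋ a ⊠ g ⊞ b ⊠ p) (lc≉0 : ¬ coeff s j₀ ≈ 0#) (s< : Deg< (suc j₀) s)
                          (none-smaller : ∀ k → k < j₀ → ¬ DegreeInIdeal k) where
        lc⁻¹ = coeff s j₀ ⁻¹⟨ lc≉0 ⟩
        s̃ = lc⁻¹ · s

        s̃-monic : Monic j₀ s̃
        s̃-monic = monic (trans (coeff-· lc⁻¹ s j₀) (⁻¹-inverseˡ _ lc≉0))
                  λ i le → trans (coeff-· lc⁻¹ s i) (trans (*-congˡ (s< i le)) (zeroʳ _))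

        s̃≋ : s̃ ≋ (lc⁻¹ · a) ⊠ g ⊞ (lc⁻¹ · b) ⊠ p
        s̃≋ = ≋-trans (≋-sym (constₚ-⊠ lc⁻¹ s)) (≋-trans (⊠-congʳ (constₚ lc⁻¹) s≋)
               (≋-trans (⊞⊠-solve 5 (λ l a g b p → l :⊠ (a :⊠ g :⊞ b :⊠ p) :≋ (l :⊠ a) :⊠ g :⊞ (l :⊠ b) :⊠ p) ≋-refl
                           (constₚ lc⁻¹) a g b p)
                        (⊞-cong (⊠-congˡ g (constₚ-⊠ lc⁻¹ a)) (⊠-congˡ p (constₚ-⊠ lc⁻¹ b)))))

        s̃-in-ideal : InIdeal s̃
        s̃-in-ideal = lc⁻¹ · a , lc⁻¹ · b , s̃≋

        small⇒≋[] : ∀ {ρ δ} → InIdeal ρ → Deg< δ ρ → δ ≤ j₀ → ¬ ¬ ρ ≋ []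
        small⇒≋[] {ρ} {δ} ρ∈I ρ< δ≤j₀ = ¬¬-≋[]-or-Degree ρ >>= λ
          { (inj₁ ρ≋[])           → pure ρ≋[]
          ; (inj₂ (j , ρ≉0 , ρ<′)) → λ _ → degree-below j ρ≉0 ρ<′ }
          where
          degree-below : ∀ j → ¬ coeff ρ j ≈ 0# → Deg< (suc j) ρ → ⊥
          degree-below j ρ≉0 ρ<′ with δ ℕ.≤? j
          ... | yes δ≤j = ρ≉0 (ρ< j δ≤j)
          ... | no  δ≰j = none-smaller j (ℕ.<-≤-trans (ℕ.≰⇒> δ≰j) δ≤j₀) (ρ , ρ∈I , ρ≉0 , ρ<′)

        s̃-divides : ∀ {y} → InIdeal y → ¬ ¬ s̃ ∣ y
        s̃-divides {y} y∈I = ¬¬-map (Division.rem≋[]⇒∣ s̃-monic)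
          (small⇒≋[] (rem-in-ideal s̃-monic s̃-in-ideal y∈I) (Division.rem-Deg< s̃-monic y) ℕ.≤-refl)

        g-divides-s̃ : d ≤ j₀ → ¬ ¬ g ∣ s̃
        g-divides-s̃ d≤j₀ = ¬¬-map (Division.rem≋[]⇒∣ g-monic)
          (small⇒≋[] (rem-in-ideal g-monic g-in-ideal s̃-in-ideal) (rem-g-Deg< s̃) d≤j₀)

        s̃∣g⇒d≤j₀ : 0 < j₀ → s̃ ∣ g → d ≤ j₀
        s̃∣g⇒d≤j₀ 0<j₀ s̃∣g with j₀ ℕ.<? d
        ... | yes j₀<d = contradiction s̃∣g (g-minimal 0<j₀ j₀<d s̃-monic)
        ... | no  j₀≮d = ℕ.≮⇒≥ j₀≮d

        bezout-identity : ¬ g ∣ p → ¬ ¬ BezoutIdentity p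
        bezout-identity g∤p = by-degree j₀ ≡.refl
          where
          by-degree : ∀ j → j ≡.≡ j₀ → ¬ ¬ BezoutIdentity p
          by-degree zero    ≡.refl = pure (lc⁻¹ · a , lc⁻¹ · b , ≋-trans (≋-sym s̃≋)
            (mk≋ λ { zero → Monic.leading s̃-monic ; (suc i) → Monic.above s̃-monic (suc i) (s≤s z≤n) }))
          by-degree (suc _) ≡.refl = s̃-divides g-in-ideal >>= λ s̃∣g → s̃-divides p-in-ideal >>= λ s̃∣p → λ _ →
            g-divides-s̃ (s̃∣g⇒d≤j₀ (s≤s z≤n) s̃∣g) λ g∣s̃ → g∤p (∣-trans g∣s̃ s̃∣p)

    bezout : ∀ p → ¬ g ∣ p → ¬ ¬ BezoutIdentity p
    bezout p g∤p = nonzero-element g∤p >>= λ (j , j-deg) → ¬¬-least DegreeInIdeal j j-deg >>=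
      λ (j₀ , (s , (a , b , s≋) , lc≉0 , s<) , none-smaller) → LeastElement.bezout-identity a b s≋ lc≉0 s< none-smaller g∤p
      where open Ideal p

  drop-≋1ₚ-term : ∀ {B z A} x → B ≋ 1ₚ → z ≋ A ⊞ x ⊠ (B ⊞ ⊝ 1ₚ) → z ≋ A
  drop-≋1ₚ-term {B} {A = A} x B≋1 z≋ = ≋-trans z≋ (≋-trans (⊞-cong ≋-refl
    (≋-trans (⊠-congʳ x (≋-trans (⊞-cong B≋1 ≋-refl) (⊞-inverseʳ 1ₚ))) (⊠-zeroʳ x))) (⊞-identityʳ A))

  Monic⇒∤1ₚ : ∀ {d g} → Monic d g → 0 < d → ¬ g ∣ 1ₚ
  Monic⇒∤1ₚ g-monic 0<d = Monic⇒∤const g-monic 0<d 1≉0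

  -- e is 1 modulo an irreducible factor g of h and 0 modulo f / g, so
  -- multiplication by e projects K[X]/(f) onto the field K[X]/(g).
  record Component (f h : Poly) : Set (c ⊔ ℓ) where
    field
      e           : Poly
      idempotent  : e ⊠ e ≋ e mod f
      nontrivial  : ¬ f ∣ e
      invertible  : ∀ x → ¬ f ∣ e ⊠ x → ¬ ¬ Σ Poly λ w → e ⊠ x ⊠ w ≋ e mod f
      coprime-≉0  : ∀ {w} a b → a ⊠ w ⊞ b ⊠ h ≋ 1ₚ → ¬ f ∣ e ⊠ w

  separable⇒squarefree : ∀ {f a b κ} → a ⊠ f ⊞ b ⊠ deriv f ≋ constₚ κ → ¬ κ ≈ 0# →
                         ∀ {m g k} → Monic m g → 0 < m → f ≋ k ⊠ g → ¬ g ∣ k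
  separable⇒squarefree {f} {a} {b} separable κ≉0 {g = g} {k} g-monic 0<m f≋kg (j , k≋jg) =
    Monic⇒∤const g-monic 0<m κ≉0 (∣-respʳ separable (∣-⊞ (∣-⊠ a (k , f≋kg)) (∣-⊠ b g∣f′)))
    where
    g∣f′ : g ∣ deriv f
    g∣f′ = ∣-respʳ (≋-sym (≋-trans (deriv-cong (≋-trans f≋kg (⊠-congˡ g k≋jg))) (deriv-⊠ (j ⊠ g) g)))
      (∣-⊞ (∣-multiple g (deriv (j ⊠ g)))
           (j ⊠ deriv g , ⊞⊠-solve 3 (λ j g d → (j :⊠ g) :⊠ d :≋ (j :⊠ d) :⊠ g) ≋-refl j g (deriv g)))

  module ComponentFromBezout {f h m g k u v} (g-monic : Monic m g) (0<m : 0 < m) (g∣h : g ∣ h) (f≋kg : f ≋ k ⊠ g)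
    (bezout : ∀ p → ¬ g ∣ p → ¬ ¬ Σ Poly λ α → Σ Poly λ β → α ⊠ g ⊞ β ⊠ p ≋ 1ₚ)
    (ug+vk≋1 : u ⊠ g ⊞ v ⊠ k ≋ 1ₚ) where
    e = v ⊠ k

    f∣_⊠k⊠g : ∀ x → f ∣ x ⊠ (k ⊠ g)
    f∣ x ⊠k⊠g = x , ⊠-congʳ x (≋-sym f≋kg)

    g∣f : g ∣ f
    g∣f = k , f≋kg

    1ₚ≋e⊞ug : 1ₚ ≋ e ⊞ u ⊠ g
    1ₚ≋e⊞ug = ≋-trans (≋-sym ug+vk≋1) (⊞-comm (u ⊠ g) e)

    g∣e⊠_⇒g∣ : ∀ {x} → g ∣ e ⊠ x → g ∣ x
    g∣e⊠_⇒g∣ {x} g∣ex = ∣-respʳ (≋-sym (≋-trans (≋-sym (⊠-identityˡ x)) (≋-trans (⊠-congˡ x 1ₚ≋e⊞ug)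
      (≋-trans (⊠-distribʳ e (u ⊠ g) x) (⊞-cong ≋-refl (⊞⊠-solve 3 (λ u g x → u :⊠ g :⊠ x :≋ (u :⊠ x) :⊠ g) ≋-refl u g x))))))
      (∣-⊞ g∣ex (∣-multiple g (u ⊠ x)))

    idempotent : e ⊠ e ≋ e mod f
    idempotent = by-∣ (∣-respʳ (≋-sym (drop-≋1ₚ-term e ug+vk≋1 (⊞⊠-solve 4 (λ u v k g →
        (v :⊠ k) :⊠ (v :⊠ k) :⊟ v :⊠ k :≋ (:⊝ (u :⊠ v)) :⊠ (k :⊠ g) :⊞ (v :⊠ k) :⊠ ((u :⊠ g :⊞ v :⊠ k) :⊟ :c (+ 1))) ≋-refl u v k g)))
      (f∣ ⊝ (u ⊠ v) ⊠k⊠g))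

    nontrivial : ¬ f ∣ e
    nontrivial f∣e = Monic⇒∤1ₚ g-monic 0<m (∣-respʳ (≋-sym 1ₚ≋e⊞ug) (∣-⊞ (∣-trans g∣f f∣e) (∣-multiple g u)))

    invertible : ∀ x → ¬ f ∣ e ⊠ x → ¬ ¬ Σ Poly λ w → e ⊠ x ⊠ w ≋ e mod f
    invertible x f∤ex = bezout x g∤x >>= λ (α , β , αg+βx≋1) → pure (β , by-∣ (
      ∣-respʳ (≋-sym (drop-≋1ₚ-term e αg+βx≋1 (⊞⊠-solve 6 (λ v k x β α g →
        (v :⊠ k) :⊠ x :⊠ β :⊟ v :⊠ k :≋ (:⊝ (v :⊠ α)) :⊠ (k :⊠ g) :⊞ (v :⊠ k) :⊠ ((α :⊠ g :⊞ β :⊠ x) :⊟ :c (+ 1))) ≋-refl v k x β α g)))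
        (f∣ ⊝ (v ⊠ α) ⊠k⊠g)))
      where
      g∤x : ¬ g ∣ x
      g∤x (x′ , x≋) = f∤ex (v ⊠ x′ , ≋-trans (⊠-congʳ e x≋)
        (≋-trans (⊞⊠-solve 4 (λ v k x′ g → (v :⊠ k) :⊠ (x′ :⊠ g) :≋ (v :⊠ x′) :⊠ (k :⊠ g)) ≋-refl v k x′ g)
                 (⊠-congʳ (v ⊠ x′) (≋-sym f≋kg))))

    coprime-≉0 : ∀ {w} a b → a ⊠ w ⊞ b ⊠ h ≋ 1ₚ → ¬ f ∣ e ⊠ w
    coprime-≉0 {w} a b coprime f∣ew = Monic⇒∤1ₚ g-monic 0<m
      (∣-respʳ coprime (∣-⊞ (∣-⊠ a (g∣e⊠_⇒g∣ (∣-trans g∣f f∣ew))) (∣-⊠ b g∣h)))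

    component : Component f h
    component = record { e = e ; idempotent = idempotent ; nontrivial = nontrivial ; invertible = invertible ; coprime-≉0 = coprime-≉0 }

  ¬¬-component : ∀ {f h d} → Monic d h → 0 < d → h ∣ f →
                 ∀ a b {κ} → a ⊠ f ⊞ b ⊠ deriv f ≋ constₚ κ → ¬ κ ≈ 0# → ¬ ¬ Component f h
  ¬¬-component {f} {h} {d} h-monic 0<d h∣f a b separable κ≉0 =
    ¬¬-least MonicFactor d (h , h-monic , 0<d , ∣-refl h) >>= λ (m , (g , g-monic , 0<m , g∣h) , g-least) →
    let open Bezout g-monic 0<m (λ 0<j j<m g′-monic g′∣g → g-least _ j<m (_ , g′-monic , 0<j , ∣-trans g′∣g g∣h))
        (k , f≋kg) = ∣-trans g∣h h∣f in
    bezout k (separable⇒squarefree {a = a} {b} separable κ≉0 {k = k} g-monic 0<m f≋kg) >>= λ (u , v , ug+vk≋1) →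
    pure (ComponentFromBezout.component {k = k} {u} {v} g-monic 0<m g∣h f≋kg bezout ug+vk≋1)
    where
    MonicFactor : ℕ → Set (c ⊔ ℓ)
    MonicFactor j = Σ Poly λ g → Monic j g × 0 < j × g ∣ h

  ∂-0# : ∂ 0# ≈ 0#
  ∂-0# = identityʳ-unique (∂ 0#) (∂ 0#) (trans (sym (∂-+ 0# 0#)) (∂-cong (+-identityʳ 0#)))

  ∂-1# : ∂ 1# ≈ 0#
  ∂-1# = identityʳ-unique (∂ 1#) (∂ 1#)
    (trans (+-cong (sym (*-identityˡ _)) (sym (*-identityʳ _))) (trans (sym (∂-* 1# 1#)) (∂-cong (*-identityʳ 1#))))

  ∂-‿ : ∀ a → ∂ (- a) ≈ - ∂ a
  ∂-‿ a = inverseʳ-unique (∂ a) (∂ (- a)) (trans (sym (∂-+ a (- a))) (trans (∂-cong (-‿inverseʳ a)) ∂-0#))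

  ∂ᶜ : Poly → Poly
  ∂ᶜ []      = []
  ∂ᶜ (a ∷ p) = ∂ a ∷ ∂ᶜ p

  coeff-∂ᶜ : ∀ p i → coeff (∂ᶜ p) i ≈ ∂ (coeff p i)
  coeff-∂ᶜ []      i       = sym ∂-0#
  coeff-∂ᶜ (a ∷ p) zero    = refl
  coeff-∂ᶜ (a ∷ p) (suc i) = coeff-∂ᶜ p i

  ∂ᶜ-cong : ∀ {p q} → p ≋ q → ∂ᶜ p ≋ ∂ᶜ q
  ∂ᶜ-cong {p} {q} e = mk≋ λ i → trans (coeff-∂ᶜ p i) (trans (∂-cong (at e i)) (sym (coeff-∂ᶜ q i)))

  ∂ᶜ-⊞ : ∀ p q → ∂ᶜ (p ⊞ q) ≋ ∂ᶜ p ⊞ ∂ᶜ q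
  ∂ᶜ-⊞ p q = mk≋ λ i → trans (coeff-∂ᶜ (p ⊞ q) i) (trans (∂-cong (coeff-⊞ p q i))
    (trans (∂-+ _ _) (sym (trans (coeff-⊞ (∂ᶜ p) (∂ᶜ q) i) (+-cong (coeff-∂ᶜ p i) (coeff-∂ᶜ q i))))))

  ∂ᶜ-⊝ : ∀ p → ∂ᶜ (⊝ p) ≋ ⊝ ∂ᶜ p
  ∂ᶜ-⊝ p = mk≋ λ i → trans (coeff-∂ᶜ (⊝ p) i) (trans (∂-cong (coeff-⊝ p i))
    (trans (∂-‿ _) (sym (trans (coeff-⊝ (∂ᶜ p) i) (-‿cong (coeff-∂ᶜ p i))))))

  ∂ᶜ-· : ∀ a p → ∂ᶜ (a · p) ≋ ∂ a · p ⊞ a · ∂ᶜ p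
  ∂ᶜ-· a p = mk≋ λ i → begin
    coeff (∂ᶜ (a · p)) i                ≈⟨ trans (coeff-∂ᶜ (a · p) i) (∂-cong (coeff-· a p i)) ⟩
    ∂ (a * coeff p i)                   ≈⟨ trans (∂-* a (coeff p i)) (+-comm _ _) ⟩
    ∂ a * coeff p i + a * ∂ (coeff p i) ≈⟨ sym (trans (coeff-⊞ (∂ a · p) (a · ∂ᶜ p) i)
                                                (+-cong (coeff-· (∂ a) p i) (trans (coeff-· a (∂ᶜ p) i) (*-congˡ (coeff-∂ᶜ p i))))) ⟩
    coeff (∂ a · p ⊞ a · ∂ᶜ p) i        ∎

  ∂ᶜ-⊠ : ∀ p q → ∂ᶜ (p ⊠ q) ≋ ∂ᶜ p ⊠ q ⊞ p ⊠ ∂ᶜ q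
  ∂ᶜ-⊠ []      q = ≋-refl
  ∂ᶜ-⊠ (a ∷ p) q = ≋-trans (∂ᶜ-⊞ (a · q) (shift (p ⊠ q)))
    (≋-trans (⊞-cong (∂ᶜ-· a q) (≋-trans (∷-cong ∂-0# (∂ᶜ-⊠ p q)) (shift-⊞ (∂ᶜ p ⊠ q) (p ⊠ ∂ᶜ q))))
             (⊞-interchange (∂ a · q) (a · ∂ᶜ q) (shift (∂ᶜ p ⊠ q)) (shift (p ⊠ ∂ᶜ q))))

  module ExtendedDerivation (x′ : Poly) where
    ∂ₓ : Poly → Poly
    ∂ₓ p = ∂ᶜ p ⊞ deriv p ⊠ x′

    ∂ₓ-cong : ∀ {p q} → p ≋ q → ∂ₓ p ≋ ∂ₓ q
    ∂ₓ-cong p≋q = ⊞-cong (∂ᶜ-cong p≋q) (⊠-cong (deriv-cong p≋q) ≋-refl)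

    ∂ₓ-⊞ : ∀ p q → ∂ₓ (p ⊞ q) ≋ ∂ₓ p ⊞ ∂ₓ q
    ∂ₓ-⊞ p q = ≋-trans (⊞-cong (∂ᶜ-⊞ p q) (⊠-cong (deriv-⊞ p q) (≋-refl {x′})))
      (⊞⊠-solve 5 (λ a b c d x → (a :⊞ b) :⊞ (c :⊞ d) :⊠ x :≋ (a :⊞ c :⊠ x) :⊞ (b :⊞ d :⊠ x)) ≋-refl
        (∂ᶜ p) (∂ᶜ q) (deriv p) (deriv q) x′)

    ∂ₓ-⊝ : ∀ p → ∂ₓ (⊝ p) ≋ ⊝ ∂ₓ p
    ∂ₓ-⊝ p = ≋-trans (⊞-cong (∂ᶜ-⊝ p) (⊠-cong (deriv-⊝ p) (≋-refl {x′})))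
      (⊞⊠-solve 3 (λ a c x → (:⊝ a) :⊞ (:⊝ c) :⊠ x :≋ :⊝ (a :⊞ c :⊠ x)) ≋-refl (∂ᶜ p) (deriv p) x′)

    ∂ₓ-⊠ : ∀ p q → ∂ₓ (p ⊠ q) ≋ p ⊠ ∂ₓ q ⊞ ∂ₓ p ⊠ q
    ∂ₓ-⊠ p q = ≋-trans (⊞-cong (∂ᶜ-⊠ p q) (⊠-cong (deriv-⊠ p q) (≋-refl {x′})))
      (⊞⊠-solve 7 (λ a b c d x p q → (a :⊠ q :⊞ p :⊠ b) :⊞ (c :⊠ q :⊞ p :⊠ d) :⊠ x
                                    :≋ p :⊠ (b :⊞ d :⊠ x) :⊞ (a :⊞ c :⊠ x) :⊠ q) ≋-refl
        (∂ᶜ p) (∂ᶜ q) (deriv p) (deriv q) x′ p q)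

    ∂ₓ-constₚ : ∀ a → ∂ₓ (constₚ a) ≋ constₚ (∂ a)
    ∂ₓ-constₚ a = ≋-trans (⊞-cong (≋-refl {constₚ (∂ a)}) (⊠-zeroˡ (deriv (constₚ a)) x′ (mk≋ λ { zero → refl ; (suc i) → refl })))
                          (⊞-identityʳ _)

    ∂ₓ-∣ : ∀ {f h} → f ∣ ∂ₓ f → f ∣ h → f ∣ ∂ₓ h
    ∂ₓ-∣ {f} {h} f∣∂f (k , h≋kf) = ∣-respʳ (≋-sym (≋-trans (∂ₓ-cong h≋kf) (∂ₓ-⊠ k f)))
      (∣-⊞ (∣-⊠ k f∣∂f) (∣-multiple f (∂ₓ k)))

  -- e·K[X]/(f) for the idempotent e of a component: a field, which is a
  -- differential field once ∂ₓ preserves (f).  Inverses have to be given by an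
  -- explicit formula, p⁻¹ = M p / N p, supplied together with the norm identity.
  module QuotientField {f h d} (f-monic : Monic d f) (C : Component f h)
    (M : Poly → Poly) (N : Poly → Carrier)
    (norm : ∀ p → ¬ ¬ Component.e C ⊠ (p ⊠ M p) ≋ Component.e C ⊠ constₚ (N p) mod f)
    (M-unit : ∀ p {w} → p ⊠ w ≋ 1ₚ mod f → ¬ ¬ Σ Poly λ w′ → M p ⊠ w′ ≋ 1ₚ mod f)
    (x′ : Poly) (f∣∂ₓf : f ∣ ExtendedDerivation.∂ₓ x′ f)
    where
    open Component C
    open ExtendedDerivation x′
    open Division f-monic using (rem; rem≋[]⇒∣; ∣⇒rem≋[])

    infix 4 _≈ₑ_ _≈ₗ_
    _≈ₑ_ : Poly → Poly → Set (c ⊔ ℓ)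
    p ≈ₑ r = e ⊠ p ≋ e ⊠ r mod f

    -- Via the remainder rather than f ∣ _, whose witness would put the
    -- equality of the field in Set (c ⊔ ℓ) instead of Set ℓ.
    record _≈ₗ_ (p r : Poly) : Set ℓ where
      constructor from-rem
      field rem≋[] : ¬ ¬ rem (e ⊠ p ⊞ ⊝ (e ⊠ r)) ≋ []

    from≈ₑ : ∀ {p r} → ¬ ¬ p ≈ₑ r → p ≈ₗ r
    from≈ₑ p≈r = from-rem (p≈r >>= λ (by-∣ f∣) → ∣⇒rem≋[] f∣)

    to≈ₑ : ∀ {p r} → p ≈ₗ r → ¬ ¬ p ≈ₑ r
    to≈ₑ (from-rem r≋[]) = ¬¬-map (λ r≋[] → by-∣ (rem≋[]⇒∣ r≋[])) r≋[]

    lift₁ : ∀ {p r p′ r′} → (p ≈ₑ r → p′ ≈ₑ r′) → p ≈ₗ r → p′ ≈ₗ r′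
    lift₁ F p≈r = from≈ₑ (¬¬-map F (to≈ₑ p≈r))

    lift₂ : ∀ {p r p′ r′ p″ r″} → (p ≈ₑ r → p′ ≈ₑ r′ → p″ ≈ₑ r″) → p ≈ₗ r → p′ ≈ₗ r′ → p″ ≈ₗ r″
    lift₂ F p≈r p′≈r′ = from≈ₑ (to≈ₑ p≈r >>= λ d → ¬¬-map (F d) (to≈ₑ p′≈r′))

    ≋⇒≈ₗ : ∀ {p r} → p ≋ r → p ≈ₗ r
    ≋⇒≈ₗ p≋r = from≈ₑ (pure (≋⇒≋mod (⊠-congʳ e p≋r)))

    ∣⇒≈ₗ[] : ∀ {p} → f ∣ p → p ≈ₗ []
    ∣⇒≈ₗ[] {p} f∣p = from≈ₑ (pure (≋mod-resp ≋-refl (≋-sym (⊠-zeroʳ e)) (∣⇒≋[]mod (∣-⊠ e f∣p))))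

    ≈ₗ[]⇒¬¬∣ : ∀ {p} → p ≈ₗ [] → ¬ ¬ f ∣ e ⊠ p
    ≈ₗ[]⇒¬¬∣ p≈0 = ¬¬-map (λ d → ≋[]mod⇒∣ (≋mod-resp ≋-refl (⊠-zeroʳ e) d)) (to≈ₑ p≈0)

    ≈ₑ-⊞ : ∀ {p p′ q q′} → p ≈ₑ p′ → q ≈ₑ q′ → p ⊞ q ≈ₑ p′ ⊞ q′
    ≈ₑ-⊞ {p} {p′} {q} {q′} d d′ =
      ≋mod-resp (≋-sym (⊠-distribˡ e p q)) (≋-sym (⊠-distribˡ e p′ q′)) (≋mod-⊞ d d′)

    ≈ₑ-⊝ : ∀ {p p′} → p ≈ₑ p′ → ⊝ p ≈ₑ ⊝ p′
    ≈ₑ-⊝ {p} {p′} d = ≋mod-resp (⊞⊠-solve 2 (λ e p → :⊝ (e :⊠ p) :≋ e :⊠ (:⊝ p)) ≋-refl e p)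
                                (⊞⊠-solve 2 (λ e p → :⊝ (e :⊠ p) :≋ e :⊠ (:⊝ p)) ≋-refl e p′) (≋mod-⊝ d)

    ≈ₑ-⊠ : ∀ {p p′ q q′} → p ≈ₑ p′ → q ≈ₑ q′ → p ⊠ q ≈ₑ p′ ⊠ q′
    ≈ₑ-⊠ {p} {p′} {q} {q′} d d′ = ≋mod-trans
      (≋mod-resp (⊠-assoc e p q) (⊠-assoc e p′ q) (≋mod-⊠ d (≋⇒≋mod (≋-refl {q}))))
      (≋mod-resp (reorder p′ q) (reorder p′ q′) (≋mod-⊠ d′ (≋⇒≋mod (≋-refl {p′}))))
      where
      reorder : ∀ a b → (e ⊠ b) ⊠ a ≋ e ⊠ (a ⊠ b)
      reorder a b = ⊞⊠-solve 3 (λ e a b → (e :⊠ b) :⊠ a :≋ e :⊠ (a :⊠ b)) ≋-refl e a b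

    f∣∂ₓe : f ∣ ∂ₓ e
    f∣∂ₓe = ∣-respʳ (≋-sym ∂ₓe≋) (∣-⊞ (∣-⊠ (e ⊞ e ⊞ ⊝ 1ₚ) (∣-respʳ ∂ₓ-idempotent (∂ₓ-∣ f∣∂ₓf f∣e²-e)))
                                      (∣-⊝ (∣-⊠ (∂ₓ e ⊞ ∂ₓ e ⊞ ∂ₓ e ⊞ ∂ₓ e) f∣e²-e)))
      where
      f∣e²-e = ∣-difference idempotent
      ∂ₓ-idempotent : ∂ₓ (e ⊠ e ⊞ ⊝ e) ≋ (e ⊠ ∂ₓ e ⊞ ∂ₓ e ⊠ e) ⊞ ⊝ ∂ₓ e
      ∂ₓ-idempotent = ≋-trans (∂ₓ-⊞ (e ⊠ e) (⊝ e)) (⊞-cong (∂ₓ-⊠ e e) (∂ₓ-⊝ e))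
      ∂ₓe≋ : ∂ₓ e ≋ (e ⊞ e ⊞ ⊝ 1ₚ) ⊠ ((e ⊠ ∂ₓ e ⊞ ∂ₓ e ⊠ e) ⊞ ⊝ ∂ₓ e) ⊞ ⊝ ((∂ₓ e ⊞ ∂ₓ e ⊞ ∂ₓ e ⊞ ∂ₓ e) ⊠ (e ⊠ e ⊞ ⊝ e))
      ∂ₓe≋ = ⊞⊠-solve 2 (λ e d → d :≋ (e :⊞ e :⊟ :c (+ 1)) :⊠ ((e :⊠ d :⊞ d :⊠ e) :⊟ d)
                                     :⊟ ((d :⊞ d :⊞ d :⊞ d) :⊠ (e :⊠ e :⊟ e))) ≋-refl e (∂ₓ e)

    ≈ₑ-∂ₓ : ∀ {p r} → p ≈ₑ r → ∂ₓ p ≈ₑ ∂ₓ r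
    ≈ₑ-∂ₓ {p} {r} (by-∣ d) = by-∣ (∣-respʳ (≋-sym identity)
        (∣-⊞ (∣-respʳ ∂ₓ-e⊠ (∂ₓ-∣ f∣∂ₓf (∣-respʳ (⊞⊠-solve 3 (λ e p r → e :⊠ p :⊟ e :⊠ r :≋ e :⊠ (p :⊟ r)) ≋-refl e p r) d)))
             (∣-⊝ (∣-⊠ (p ⊞ ⊝ r) f∣∂ₓe))))
      where
      ∂ₓ-e⊠ : ∂ₓ (e ⊠ (p ⊞ ⊝ r)) ≋ e ⊠ (∂ₓ p ⊞ ⊝ ∂ₓ r) ⊞ ∂ₓ e ⊠ (p ⊞ ⊝ r)
      ∂ₓ-e⊠ = ≋-trans (∂ₓ-⊠ e (p ⊞ ⊝ r)) (⊞-cong (⊠-congʳ e (≋-trans (∂ₓ-⊞ p (⊝ r)) (⊞-cong ≋-refl (∂ₓ-⊝ r)))) ≋-refl)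
      identity : e ⊠ ∂ₓ p ⊞ ⊝ (e ⊠ ∂ₓ r) ≋ (e ⊠ (∂ₓ p ⊞ ⊝ ∂ₓ r) ⊞ ∂ₓ e ⊠ (p ⊞ ⊝ r)) ⊞ ⊝ ((p ⊞ ⊝ r) ⊠ ∂ₓ e)
      identity = ⊞⊠-solve 5 (λ e a b d x → e :⊠ a :⊟ e :⊠ b :≋ (e :⊠ (a :⊟ b) :⊞ d :⊠ x) :⊟ x :⊠ d) ≋-refl
                   e (∂ₓ p) (∂ₓ r) (∂ₓ e) (p ⊞ ⊝ r)

    ≉ₗ[]⇒f∤e⊠ : ∀ {x} → ¬ x ≈ₗ [] → ¬ f ∣ e ⊠ x
    ≉ₗ[]⇒f∤e⊠ x≉0 f∣ex = x≉0 (from≈ₑ (pure (≋mod-resp ≋-refl (≋-sym (⊠-zeroʳ e)) (∣⇒≋[]mod f∣ex))))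

    constₚ-⊠-constₚ : ∀ a b → constₚ a ⊠ constₚ b ≋ constₚ (a * b)
    constₚ-⊠-constₚ a b = mk≋ λ { zero → +-identityʳ _ ; (suc i) → refl }

    -- The unit of e·K[X]/(f) at x, padded by 1 − e to a unit of K[X]/(f).
    module Inverse (x : Poly) (x≉0 : ¬ x ≈ₗ []) where
      p = e ⊠ x ⊞ (1ₚ ⊞ ⊝ e)

      e⊠p≈e⊠x : e ⊠ p ≋ e ⊠ x mod f
      e⊠p≈e⊠x = by-∣ (∣-respʳ (⊞⊠-solve 2 (λ x e → (x :⊟ :c (+ 1)) :⊠ (e :⊠ e :⊟ e)
                                                   :≋ e :⊠ (e :⊠ x :⊞ (:c (+ 1) :⊟ e)) :⊟ e :⊠ x) ≋-refl x e)
                               (∣-⊠ (x ⊞ ⊝ 1ₚ) (∣-difference idempotent)))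

      p-unit : ∀ {w} → e ⊠ x ⊠ w ≋ e mod f → p ⊠ (e ⊠ w ⊞ (1ₚ ⊞ ⊝ e)) ≋ 1ₚ mod f
      p-unit {w} (by-∣ d) = by-∣ (∣-respʳ (≋-sym (⊞⊠-solve 3 (λ e x w →
          (e :⊠ x :⊞ (:c (+ 1) :⊟ e)) :⊠ (e :⊠ w :⊞ (:c (+ 1) :⊟ e)) :⊟ :c (+ 1)
          :≋ (e :⊠ x :⊠ w :⊟ e) :⊞ (x :⊠ w :⊟ x :⊟ w :⊞ :c (+ 1)) :⊠ (e :⊠ e :⊟ e)) ≋-refl e x w))
        (∣-⊞ d (∣-⊠ (x ⊠ w ⊞ ⊝ x ⊞ ⊝ w ⊞ 1ₚ) (∣-difference idempotent))))

      N≉0 : ¬ N p ≈ 0#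
      N≉0 N≈0 = invertible x (≉ₗ[]⇒f∤e⊠ x≉0) λ (w , exw≈e) → M-unit p (p-unit exw≈e) λ (w′ , Mw′≈1) →
        norm p λ e⊠pM≈e⊠N → nontrivial (≋[]mod⇒∣ (e≈0 (p-unit exw≈e) Mw′≈1 e⊠pM≈e⊠N))
        where
        e≈0 : ∀ {W w′} → p ⊠ W ≋ 1ₚ mod f → M p ⊠ w′ ≋ 1ₚ mod f →
              e ⊠ (p ⊠ M p) ≋ e ⊠ constₚ (N p) mod f → e ≋ [] mod f
        e≈0 {W} {w′} pW≈1 Mw′≈1 e⊠pM≈e⊠N = ≋mod-trans
          (≋mod-resp (≋-trans (⊠-congʳ e (⊠-identityˡ 1ₚ)) (⊠-identityʳ e)) ≋-refl (≋mod-sym (≋mod-⊠ (≋⇒≋mod (≋-refl {e})) (≋mod-⊠ pW≈1 Mw′≈1))))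
          (≋mod-resp (⊞⊠-solve 5 (λ e p W m w′ → e :⊠ (p :⊠ m) :⊠ (W :⊠ w′) :≋ e :⊠ (p :⊠ W :⊠ (m :⊠ w′))) ≋-refl e p W (M p) w′)
                     (⊠-zeroˡ (e ⊠ constₚ (N p)) (W ⊠ w′) (≋-trans (⊠-congʳ e (mk≋ λ { zero → N≈0 ; (suc i) → refl })) (⊠-zeroʳ e)))
                     (≋mod-⊠ e⊠pM≈e⊠N (≋⇒≋mod (≋-refl {W ⊠ w′}))))

      N⁻¹ = N p ⁻¹⟨ N≉0 ⟩

      right-inverse : Σ Poly λ y → x ⊠ y ≈ₗ 1ₚ
      right-inverse = M p ⊠ constₚ N⁻¹ , from≈ₑ (norm p >>= λ e⊠pM≈e⊠N → pure (≋mod-trans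
        (≋mod-resp (⊠-assoc e x (M p ⊠ constₚ N⁻¹))
                   (⊞⊠-solve 4 (λ e p m n → e :⊠ p :⊠ (m :⊠ n) :≋ e :⊠ (p :⊠ m) :⊠ n) ≋-refl e p (M p) (constₚ N⁻¹))
                   (≋mod-⊠ (≋mod-sym e⊠p≈e⊠x) (≋⇒≋mod (≋-refl {M p ⊠ constₚ N⁻¹}))))
        (≋mod-resp ≋-refl (≋-trans (⊠-assoc e _ _) (⊠-congʳ e (≋-trans (constₚ-⊠-constₚ (N p) N⁻¹)
                                     (∷-cong (trans (*-comm _ _) (⁻¹-inverseˡ (N p) N≉0)) ≋-refl))))
                   (≋mod-⊠ e⊠pM≈e⊠N (≋⇒≋mod (≋-refl {constₚ N⁻¹}))))))

    quotientRing : CommutativeRing c ℓ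
    quotientRing = record
      { Carrier = Poly ; _≈_ = _≈ₗ_ ; _+_ = _⊞_ ; _*_ = _⊠_ ; -_ = ⊝_ ; 0# = [] ; 1# = 1ₚ
      ; isCommutativeRing = record
        { isRing = record
          { +-isAbelianGroup = record
            { isGroup = record
              { isMonoid = record
                { isSemigroup = record
                  { isMagma = record
                    { isEquivalence = record { refl = ≋⇒≈ₗ ≋-refl ; sym = lift₁ ≋mod-sym ; trans = lift₂ ≋mod-trans }
                    ; ∙-cong = lift₂ ≈ₑ-⊞ }
                  ; assoc = λ p q r → ≋⇒≈ₗ (⊞-assoc p q r) }
                ; identity = (λ p → ≋⇒≈ₗ ≋-refl) , (λ p → ≋⇒≈ₗ (⊞-identityʳ p)) }
              ; inverse = (λ p → ≋⇒≈ₗ (≋-trans (⊞-comm (⊝ p) p) (⊞-inverseʳ p))) , (λ p → ≋⇒≈ₗ (⊞-inverseʳ p))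
              ; ⁻¹-cong = lift₁ ≈ₑ-⊝ }
            ; comm = λ p q → ≋⇒≈ₗ (⊞-comm p q) }
          ; *-cong = lift₂ ≈ₑ-⊠
          ; *-assoc = λ p q r → ≋⇒≈ₗ (⊠-assoc p q r)
          ; *-identity = (λ p → ≋⇒≈ₗ (⊠-identityˡ p)) , (λ p → ≋⇒≈ₗ (⊠-identityʳ p))
          ; distrib = (λ p q r → ≋⇒≈ₗ (⊠-distribˡ p q r)) , (λ p q r → ≋⇒≈ₗ (⊠-distribʳ q r p)) }
        ; *-comm = λ p q → ≋⇒≈ₗ (⊠-comm p q) } }

    quotientField : DiffField c ℓ
    quotientField = record
      { commRing = quotientRing
      ; 1≉0 = λ 1≈0 → ≈ₗ[]⇒¬¬∣ 1≈0 λ f∣e1 → nontrivial (∣-respʳ (⊠-identityʳ e) f∣e1)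
      ; inverse = Inverse.right-inverse
      ; ∂ = ∂ₓ ; ∂-cong = lift₁ ≈ₑ-∂ₓ
      ; ∂-+ = λ p q → ≋⇒≈ₗ (∂ₓ-⊞ p q) ; ∂-* = λ p q → ≋⇒≈ₗ (∂ₓ-⊠ p q) }

    constₚ-hom : IsDiffHom K quotientField constₚ
    constₚ-hom = record
      { cong = λ a≈b → ≋⇒≈ₗ (∷-cong a≈b ≋-refl)
      ; hom+ = λ a b → ≋⇒≈ₗ ≋-refl
      ; hom* = λ a b → ≋⇒≈ₗ (≋-sym (constₚ-⊠-constₚ a b))
      ; hom1 = ≋⇒≈ₗ ≋-refl
      ; hom∂ = λ a → ≋⇒≈ₗ (≋-sym (∂ₓ-constₚ a)) }

module Automorphisms {c ℓ} (K : DiffField c ℓ) where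
  open import Data.Nat as ℕ using (ℕ; zero; suc; _<_; s≤s; z≤n)
  import Data.Nat.Properties as ℕ
  open import Data.Nat.Primality using (Prime)
  open import Data.Fin as Fin using (Fin)
  import Data.Fin.Properties as Fin
  open import Data.Integer using (+_)
  open import Data.Product using (Σ; _,_; _×_)
  open import Data.Sum using (_⊎_; inj₁; inj₂; [_,_])
  open import Data.Empty using (⊥)
  open import Function using (_∘_)
  open import Relation.Nullary using (¬_)
  open import Relation.Nullary.Negation using (¬¬-map)
  import Relation.Binary.PropositionalEquality as ≡
  open import Algebra.Morphism.Structures using (module RingMorphisms)
  import Algebra.Morphism.Construct.Composition as Composition
  import Algebra.Morphism.Construct.Identity as Identity
  open DoubleNegation
  open NumberTheory using (prime-generated)

  open DiffField K
  open FieldArithmetic K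
  open RingMorphisms rawRing rawRing public using (IsRingMonomorphism)
  open IntegerCoefficientSolver commRing using (solve; _:=_; _:*_; _:+_; _:-_; :-_; con)
  open import Algebra.Properties.Group +-group using (identityʳ-unique; inverseʳ-unique)
  open import Algebra.Properties.Ring ring using (-0#≈0#; -‿involutive; -‿distribˡ-*)
  open import Relation.Binary.Reasoning.Setoid setoid

  iterate-+ : ∀ (f : Carrier → Carrier) a b x → iterate f (a ℕ.+ b) x ≡.≡ iterate f a (iterate f b x)
  iterate-+ f zero    b x = ≡.refl
  iterate-+ f (suc a) b x = ≡.cong f (iterate-+ f a b x)

  iterate-* : ∀ (f : Carrier → Carrier) a b x → iterate f (a ℕ.* b) x ≡.≡ iterate (iterate f b) a x
  iterate-* f zero    b x = ≡.refl
  iterate-* f (suc a) b x = ≡.trans (iterate-+ f b (a ℕ.* b) x) (≡.cong (iterate f b) (iterate-* f a b x))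

  iterate-comm : ∀ (f : Carrier → Carrier) j x → iterate f j (f x) ≡.≡ f (iterate f j x)
  iterate-comm f zero    x = ≡.refl
  iterate-comm f (suc j) x = ≡.cong f (iterate-comm f j x)

  iterate-mono : ∀ {τ} → IsRingMonomorphism τ → ∀ k → IsRingMonomorphism (iterate τ k)
  iterate-mono τ-mono zero    = Identity.isRingMonomorphism rawRing refl
  iterate-mono τ-mono (suc k) = Composition.isRingMonomorphism trans (iterate-mono τ-mono k) τ-mono

  IsDiffAut⇒IsRingMonomorphism : ∀ {σ} → IsDiffAut K σ → IsRingMonomorphism σ
  IsDiffAut⇒IsRingMonomorphism {σ} σ-aut = record
    { isRingHomomorphism = record
      { isSemiringHomomorphism = record
        { isNearSemiringHomomorphism = record
          { +-isMonoidHomomorphism = record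
            { isMagmaHomomorphism = record { isRelHomomorphism = record { cong = cong } ; homo = hom+ }
            ; ε-homo = 0#-homo }
          ; *-homo = hom* }
        ; 1#-homo = hom1 }
      ; -‿homo = λ x → inverseʳ-unique (σ x) (σ (- x)) (trans (sym (hom+ x (- x))) (trans (cong (-‿inverseʳ x)) 0#-homo)) }
    ; injective = injective _ _ }
    where
    open IsDiffAut σ-aut using (isHom; injective)
    open IsDiffHom isHom
    0#-homo : σ 0# ≈ 0#
    0#-homo = identityʳ-unique (σ 0#) (σ 0#) (trans (sym (hom+ 0# 0#)) (cong (+-identityʳ 0#)))

  iterate-order : ∀ {σ} k s → HasOrder K σ (k ℕ.* s) → HasOrder K (iterate σ s) k
  iterate-order {σ} k s (0<ks , σᵏˢ≈id , σʲ≉id) =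
    ℕ.>-nonZero⁻¹ k {{ℕ.m*n≢0⇒m≢0 k}} ,
    (λ x → trans (reflexive (≡.sym (iterate-* σ k s x))) (σᵏˢ≈id x)) ,
    λ j 0<j j<k τʲ≈id → σʲ≉id (j ℕ.* s) (ℕ.*-monoˡ-< s 0<j) (ℕ.*-monoˡ-< s j<k) λ x → trans (reflexive (iterate-* σ j s x)) (τʲ≈id x)
    where
    instance
      ks-nonZero : ℕ.NonZero (k ℕ.* s)
      ks-nonZero = ℕ.>-nonZero 0<ks
      s-nonZero : ℕ.NonZero s
      s-nonZero = ℕ.m*n≢0⇒n≢0 k

  module Monomorphism {τ} (τ-mono : IsRingMonomorphism τ) where
    open IsRingMonomorphism τ-mono public

    τ-^ : ∀ x k → τ (x ^ k) ≈ τ x ^ k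
    τ-^ x zero    = 1#-homo
    τ-^ x (suc k) = trans (*-homo x (x ^ k)) (*-congˡ (τ-^ x k))

    τ-∑ : ∀ n f → τ (∑ n f) ≈ ∑ n (λ i → τ (f i))
    τ-∑ zero    f = 0#-homo
    τ-∑ (suc n) f = trans (+-homo _ _) (+-congʳ (τ-∑ n f))

    τ-‿ : ∀ x y → τ (x - y) ≈ τ x - τ y
    τ-‿ x y = trans (+-homo x (- y)) (+-congˡ (-‿homo y))

    τ-fixes-^ : ∀ {x} → τ x ≈ x → ∀ k → τ (x ^ k) ≈ x ^ k
    τ-fixes-^ τx≈x k = trans (τ-^ _ k) (^-congˡ k τx≈x)

    module Ratio (z : Carrier) (z≉0 : ¬ z ≈ 0#) where
      w = τ z * z ⁻¹⟨ z≉0 ⟩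

      τz≈wz : τ z ≈ w * z
      τz≈wz = sym (trans (*-assoc _ _ _) (trans (*-congˡ (⁻¹-inverseˡ z z≉0)) (*-identityʳ _)))

      w^q*z^q≈τz^q : ∀ q → w ^ q * z ^ q ≈ τ (z ^ q)
      w^q*z^q≈τz^q q = trans (sym (^-distrib-* w z q)) (trans (^-congˡ q (sym τz≈wz)) (sym (τ-^ z q)))

      w^q≈ : ∀ q {a} → τ (z ^ q) ≈ a * z ^ q → w ^ q ≈ a
      w^q≈ q τz^q≈az^q = *-cancelʳ (^-≉0 q z≉0) (trans (w^q*z^q≈τz^q q) τz^q≈az^q)

  triangle : ℕ → ℕ
  triangle zero    = 0
  triangle (suc l) = triangle l ℕ.+ l

  triangle-odd : ∀ m → triangle (suc (2 ℕ.* m)) ≡.≡ suc (2 ℕ.* m) ℕ.* m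
  triangle-odd zero    = ≡.refl
  triangle-odd (suc m) = begin≡
    where
    open import Data.Nat.Tactic.RingSolver using (solve-∀)
    step : ∀ m → suc (2 ℕ.* m) ℕ.* m ℕ.+ suc (2 ℕ.* m) ℕ.+ suc (suc (2 ℕ.* m)) ≡.≡ suc (suc (suc (2 ℕ.* m))) ℕ.* suc m
    step = solve-∀
    begin≡ : triangle (suc (2 ℕ.* suc m)) ≡.≡ suc (2 ℕ.* suc m) ℕ.* suc m
    begin≡ rewrite ℕ.*-suc 2 m | ℕ.+-suc m (m ℕ.+ 0) =
      ≡.trans (≡.cong (λ t → t ℕ.+ suc (2 ℕ.* m) ℕ.+ suc (suc (2 ℕ.* m))) (triangle-odd m)) (step m)

  module OddPrimeOrder (stable : ∀ {a b} → ¬ ¬ a ≈ b → a ≈ b) (ch0 : Char0 K)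
                       (m : ℕ) (q-prime : Prime (suc (2 ℕ.* m)))
                       {τ} (τ-mono : IsRingMonomorphism τ) (τ^q≈id : ∀ x → iterate τ (suc (2 ℕ.* m)) x ≈ x) where
    q = suc (2 ℕ.* m)
    open Monomorphism τ-mono

    fixed-by-power⇒fixed : ∀ {x d} → 0 < d → d < q → iterate τ d x ≈ x → τ x ≈ x
    fixed-by-power⇒fixed {x} 0<d d<q = prime-generated (λ k → iterate τ k x ≈ x) +-closed ∸-closed q-prime 0<d d<q (τ^q≈id x)
      where
      τᵃ-cong : ∀ a {y z} → y ≈ z → iterate τ a y ≈ iterate τ a z
      τᵃ-cong a = IsRingMonomorphism.⟦⟧-cong (iterate-mono τ-mono a)
      +-closed : ∀ a b → iterate τ a x ≈ x → iterate τ b x ≈ x → iterate τ (a ℕ.+ b) x ≈ x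
      +-closed a b τᵃx≈x τᵇx≈x = trans (reflexive (iterate-+ τ a b x)) (trans (τᵃ-cong a τᵇx≈x) τᵃx≈x)
      ∸-closed : ∀ a b → iterate τ (a ℕ.+ b) x ≈ x → iterate τ b x ≈ x → iterate τ a x ≈ x
      ∸-closed a b τᵃ⁺ᵇx≈x τᵇx≈x = trans (τᵃ-cong a (sym τᵇx≈x)) (trans (reflexive (≡.sym (iterate-+ τ a b x))) τᵃ⁺ᵇx≈x)

    root≉1⇒primitive : ∀ {ζ} → ζ ^ q ≈ 1# → ¬ ζ ≈ 1# → ∀ k → 0 < k → k < q → ¬ ζ ^ k ≈ 1#
    root≉1⇒primitive {ζ} ζ^q≈1 ζ≉1 k 0<k k<q ζ^k≈1 =
      ζ≉1 (trans (sym (*-identityʳ ζ)) (prime-generated (λ k → ζ ^ k ≈ 1#) +-closed ∸-closed q-prime 0<k k<q ζ^q≈1 ζ^k≈1))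
      where
      +-closed : ∀ a b → ζ ^ a ≈ 1# → ζ ^ b ≈ 1# → ζ ^ (a ℕ.+ b) ≈ 1#
      +-closed a b ζ^a≈1 ζ^b≈1 = trans (^-homo-* ζ a b) (trans (*-cong ζ^a≈1 ζ^b≈1) (*-identityˡ 1#))
      ∸-closed : ∀ a b → ζ ^ (a ℕ.+ b) ≈ 1# → ζ ^ b ≈ 1# → ζ ^ a ≈ 1#
      ∸-closed a b ζ^a+b≈1 ζ^b≈1 = trans (sym (*-identityʳ _))
        (trans (*-congˡ (sym ζ^b≈1)) (trans (sym (^-homo-* ζ a b)) ζ^a+b≈1))

    module WithRootOfUnity (ζ : Carrier) (ζ^q≈1 : ζ ^ q ≈ 1#) (ζ≉1 : ¬ ζ ≈ 1#) where
      ζ-primitive = root≉1⇒primitive ζ^q≈1 ζ≉1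
      open RootsOfUnity ch0 (2 ℕ.* m) ζ ζ^q≈1 ζ-primitive public using (ω; ω^q≈1; ζ^k*ω^k≈1; orthogonality; q≉0; ¬¬-power-of-ζ)

      ζ≉0 : ¬ ζ ≈ 0#
      ζ≉0 ζ≈0 = 1≉0 (trans (sym ζ^q≈1) (trans (^-congˡ q ζ≈0) (0^suc (2 ℕ.* m))))

      -- The q conjugates τ^j ζ are among the q - 1 roots ζ^1, …, ζ^(q-1).
      τζ≈ζ : ¬ ¬ τ ζ ≈ ζ
      τζ≈ζ = ¬¬-finite-choice q Conjugate conjugate >>= λ (f , τʲζ≈) → pure (collision f τʲζ≈ (Fin.pigeonhole ℕ.≤-refl f))
        where
        Conjugate : Fin q → Fin (2 ℕ.* m) → Set ℓ
        Conjugate j i = iterate τ (Fin.toℕ j) ζ ≈ ζ ^ suc (Fin.toℕ i)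

        conjugate : ∀ j → ¬ ¬ Σ (Fin (2 ℕ.* m)) (Conjugate j)
        conjugate j = ¬¬-power-of-ζ (τʲ ζ) τʲζ^q≈1 >>= λ
          { (zero , _ , τʲζ≈1)           → λ _ → ζ≉1 (τʲ.injective (trans τʲζ≈1 (sym τʲ.1#-homo)))
          ; (suc k , s≤s k<2m , τʲζ≈ζ^k) → pure (Fin.fromℕ< k<2m ,
              trans τʲζ≈ζ^k (reflexive (≡.cong (λ i → ζ ^ suc i) (≡.sym (Fin.toℕ-fromℕ< k<2m))))) }
          where
          τʲ = iterate τ (Fin.toℕ j)
          module τʲ = Monomorphism (iterate-mono τ-mono (Fin.toℕ j))
          τʲζ^q≈1 : τʲ ζ ^ q ≈ 1#
          τʲζ^q≈1 = trans (sym (τʲ.τ-^ ζ q)) (trans (τʲ.⟦⟧-cong ζ^q≈1) τʲ.1#-homo)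

        collision : (f : Fin q → Fin (2 ℕ.* m)) → (∀ j → Conjugate j (f j)) →
                    (Σ (Fin q) λ i → Σ (Fin q) λ j → i Fin.< j × f i ≡.≡ f j) → τ ζ ≈ ζ
        collision f τʲζ≈ (i , j , i<j , fi≡fj) = fixed-by-power⇒fixed (ℕ.m<n⇒0<n∸m i<j)
          (ℕ.≤-<-trans (ℕ.m∸n≤m (Fin.toℕ j) (Fin.toℕ i)) (Fin.toℕ<n j))
          (τⁱ.injective (trans (reflexive (≡.trans (≡.sym (iterate-+ τ (Fin.toℕ i) d ζ))
                                                    (≡.cong (λ k → iterate τ k ζ) (ℕ.m+[n∸m]≡n (ℕ.<⇒≤ i<j)))))
                        (trans (τʲζ≈ j) (trans (reflexive (≡.cong (λ k → ζ ^ suc (Fin.toℕ k)) (≡.sym fi≡fj))) (sym (τʲζ≈ i))))))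
          where
          d = Fin.toℕ j ℕ.∸ Fin.toℕ i
          module τⁱ = Monomorphism (iterate-mono τ-mono (Fin.toℕ i))

      module FixedRoot (τζ≈ζ : τ ζ ≈ ζ) where
        τω^≈ω^ : ∀ k → τ (ω ^ k) ≈ ω ^ k
        τω^≈ω^ = τ-fixes-^ (τ-fixes-^ τζ≈ζ (2 ℕ.* m))

        resolvent : Carrier → ℕ → Carrier
        resolvent u k = ∑ q (λ j → ω ^ (k ℕ.* j) * iterate τ j u)

        τ-resolvent : ∀ u k → τ (resolvent u k) ≈ ζ ^ k * resolvent u k
        τ-resolvent u k = begin
          τ (∑ q g)                     ≈⟨ τ-∑ q g ⟩
          ∑ q (λ j → τ (g j))           ≈⟨ ∑-cong q (λ j _ → τ-g j) ⟩
          ∑ q (λ j → ζ ^ k * g (suc j)) ≈⟨ sym (*-distribˡ-∑ q (ζ ^ k) (λ j → g (suc j))) ⟩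
          ζ ^ k * ∑ q (λ j → g (suc j)) ≈⟨ *-congˡ (∑-rotate q g gq≈g0) ⟩
          ζ ^ k * ∑ q g                 ∎
          where
          g : ℕ → Carrier
          g j = ω ^ (k ℕ.* j) * iterate τ j u
          ζ^k*ω^k[j+1]≈ω^kj : ∀ j → ζ ^ k * ω ^ (k ℕ.* suc j) ≈ ω ^ (k ℕ.* j)
          ζ^k*ω^k[j+1]≈ω^kj j = begin
            ζ ^ k * ω ^ (k ℕ.* suc j)         ≈⟨ *-congˡ (trans (reflexive (≡.cong (ω ^_) (ℕ.*-suc k j))) (^-homo-* ω k (k ℕ.* j))) ⟩
            ζ ^ k * (ω ^ k * ω ^ (k ℕ.* j))   ≈⟨ sym (*-assoc _ _ _) ⟩
            (ζ ^ k * ω ^ k) * ω ^ (k ℕ.* j)   ≈⟨ *-congʳ (ζ^k*ω^k≈1 k) ⟩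
            1# * ω ^ (k ℕ.* j)                ≈⟨ *-identityˡ _ ⟩
            ω ^ (k ℕ.* j)                     ∎
          τ-g : ∀ j → τ (g j) ≈ ζ ^ k * g (suc j)
          τ-g j = trans (*-homo _ _) (trans (*-congʳ (trans (τω^≈ω^ (k ℕ.* j)) (sym (ζ^k*ω^k[j+1]≈ω^kj j)))) (*-assoc _ _ _))
          gq≈g0 : g q ≈ g 0
          gq≈g0 = *-cong (trans (x^q≈1⇒x^kq≈1 q ω^q≈1 k) (reflexive (≡.cong (ω ^_) (≡.sym (ℕ.*-zeroʳ k))))) (τ^q≈id u)

        ∑-resolvent : ∀ u → ∑ q (resolvent u) ≈ natCast K q * u
        ∑-resolvent u = trans (∑-cong q (λ k _ → ∑-cong q (λ j _ → *-congʳ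
          (trans (reflexive (≡.cong (ω ^_) (ℕ.*-comm k j))) (sym (^-assocʳ ω j k)))))) (orthogonality (λ j → iterate τ j u))

        resolvent-0 : ∀ x → resolvent (τ x - x) 0 ≈ 0#
        resolvent-0 x = begin
          ∑ q (λ j → 1# * iterate τ j (τ x - x))              ≈⟨ ∑-cong q (λ j _ → trans (*-identityˡ _) (τʲ-difference j)) ⟩
          ∑ q (λ j → iterate τ (suc j) x - iterate τ j x)     ≈⟨ ∑-telescope q (λ j → iterate τ j x) ⟩
          iterate τ q x - x                                   ≈⟨ ≈⇒-≈0 (τ^q≈id x) ⟩
          0#                                                  ∎
          where
          τʲ-difference : ∀ j → iterate τ j (τ x - x) ≈ iterate τ (suc j) x - iterate τ j x
          τʲ-difference j = trans (Monomorphism.τ-‿ (iterate-mono τ-mono j) (τ x) x)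
                                  (+-congʳ (reflexive (iterate-comm τ j x)))

        ¬¬-nonzero-resolvent : ∀ x → ¬ τ x ≈ x → ¬ ¬ Σ ℕ λ k → 0 < k × k < q × ¬ resolvent (τ x - x) k ≈ 0#
        ¬¬-nonzero-resolvent x τx≉x none = τx≉x (-≈0⇒≈ (*-cancelˡ-≈0 q≉0 (trans (sym (∑-resolvent u))
          (∑-zero q (resolvent u) λ { zero _ → resolvent-0 x ; (suc k) k<q → stable λ ≉0 → none (suc k , s≤s z≤n , k<q , ≉0) }))))
          where u = τ x - x

        -- z = y^(1/q), τ z = w z, τ w = v w with v a root of unity (so τ v = v);
        -- then τ^q z = w^q v^(q (q-1)/2) z = ζ^k z ≠ z.
        no-eigenvector : (∀ y → ¬ y ≈ 0# → ¬ ¬ Σ Carrier λ z → z ^ q ≈ y) →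
                         ∀ {k y} → 0 < k → k < q → ¬ y ≈ 0# → τ y ≈ ζ ^ k * y → ¬ ¬ ⊥
        no-eigenvector roots {k} {y} 0<k k<q y≉0 τy≈ζ^ky = roots y y≉0 >>= λ (z , z^q≈y) →
          let z≉0 : ¬ z ≈ 0#
              z≉0 z≈0 = y≉0 (trans (sym z^q≈y) (trans (^-congˡ q z≈0) (0^suc (2 ℕ.* m))))
              open Ratio z z≉0 using (w; τz≈wz) renaming (w^q≈ to w^q≈)
              w^q≈ζ^k : w ^ q ≈ ζ ^ k
              w^q≈ζ^k = w^q≈ q (trans (⟦⟧-cong z^q≈y) (trans τy≈ζ^ky (*-congˡ (sym z^q≈y))))
              w≉0 : ¬ w ≈ 0#
              w≉0 w≈0 = ^-≉0 k ζ≉0 (trans (sym w^q≈ζ^k) (trans (^-congˡ q w≈0) (0^suc (2 ℕ.* m))))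
              open Ratio w w≉0 using () renaming (w to v; τz≈wz to τw≈vw; w^q≈ to v^q≈)
              v^q≈1 : v ^ q ≈ 1#
              v^q≈1 = v^q≈ q (trans (⟦⟧-cong w^q≈ζ^k) (trans (τ-fixes-^ τζ≈ζ k) (trans (sym w^q≈ζ^k) (sym (*-identityˡ _)))))
          in ¬¬-power-of-ζ v v^q≈1 >>= λ (j , _ , v≈ζ^j) → λ _ →
             ζ-primitive k 0<k k<q (*-cancelʳ z≉0 (trans (sym (τ^q z w v τz≈wz τw≈vw (trans (⟦⟧-cong v≈ζ^j) (trans (τ-fixes-^ τζ≈ζ j) (sym v≈ζ^j))) w^q≈ζ^k v^q≈1))
                                                          (trans (τ^q≈id z) (sym (*-identityˡ z)))))
          where
          τ^q : ∀ z w v → τ z ≈ w * z → τ w ≈ v * w → τ v ≈ v → w ^ q ≈ ζ ^ k → v ^ q ≈ 1# → iterate τ q z ≈ ζ ^ k * z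
          τ^q z w v τz≈wz τw≈vw τv≈v w^q≈ζ^k v^q≈1 = trans (τˡ q) (*-cong w^q≈ζ^k (trans (*-congʳ v^T≈1) (*-identityˡ z)))
            where
            v^T≈1 : v ^ triangle q ≈ 1#
            v^T≈1 = trans (reflexive (≡.cong (v ^_) (≡.trans (triangle-odd m) (ℕ.*-comm q m)))) (x^q≈1⇒x^kq≈1 q v^q≈1 m)
            τˡ : ∀ l → iterate τ l z ≈ w ^ l * (v ^ triangle l * z)
            τˡ zero    = sym (trans (*-identityˡ _) (*-identityˡ _))
            τˡ (suc l) = begin
              τ (iterate τ l z)                                ≈⟨ ⟦⟧-cong (τˡ l) ⟩
              τ (w ^ l * (v ^ triangle l * z))                 ≈⟨ trans (*-homo _ _) (*-cong (τ-^ w l) (trans (*-homo _ _) (*-congʳ (τ-^ v (triangle l))))) ⟩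
              τ w ^ l * (τ v ^ triangle l * τ z)               ≈⟨ *-cong (trans (^-congˡ l τw≈vw) (^-distrib-* v w l)) (*-cong (^-congˡ (triangle l) τv≈v) τz≈wz) ⟩
              (v ^ l * w ^ l) * (v ^ triangle l * (w * z))     ≈⟨ solve 5 (λ a b c w z → (a :* b) :* (c :* (w :* z)) := (w :* b) :* ((c :* a) :* z)) refl
                                                                     (v ^ l) (w ^ l) (v ^ triangle l) w z ⟩
              (w * w ^ l) * ((v ^ triangle l * v ^ l) * z)     ≈⟨ *-congˡ (*-congʳ (sym (^-homo-* v (triangle l) l))) ⟩
              w ^ suc l * (v ^ triangle (suc l) * z)           ∎

    no-odd-prime-order : (∀ {ζ} → ζ ^ q ≈ 1# → (∀ k → 0 < k → k < q → ¬ ζ ^ k ≈ 1#) →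
                           ∀ y → ¬ y ≈ 0# → ¬ ¬ Σ Carrier λ z → z ^ q ≈ y) →
                         ¬ ¬ (Σ Carrier λ ζ → ζ ^ q ≈ 1# × ¬ ζ ≈ 1#) →
                         ¬ (∀ x → τ x ≈ x) → ⊥
    no-odd-prime-order roots ¬¬root τ≉id = run (¬¬root >>= λ (ζ , ζ^q≈1 , ζ≉1) →
      let open WithRootOfUnity ζ ζ^q≈1 ζ≉1 in τζ≈ζ >>= λ τζ≈ζ →
      let open FixedRoot τζ≈ζ in moved >>= λ (x , τx≉x) →
      ¬¬-nonzero-resolvent x τx≉x >>= λ (k , 0<k , k<q , r≉0) →
      no-eigenvector (roots ζ^q≈1 ζ-primitive) 0<k k<q r≉0 (τ-resolvent (τ x - x) k))
      where
      moved : ¬ ¬ Σ Carrier λ x → ¬ τ x ≈ x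
      moved none = τ≉id λ x → stable λ τx≉x → none (x , τx≉x)

  module OrderFour (stable : ∀ {a b} → ¬ ¬ a ≈ b → a ≈ b) (ch0 : Char0 K)
                   {τ} (τ-mono : IsRingMonomorphism τ) (τ⁴≈id : ∀ x → iterate τ 4 x ≈ x) where
    ρ = iterate τ 2
    open Monomorphism τ-mono using (⟦⟧-cong; -‿homo; τ-^; 1#-homo)
    module ρ = Monomorphism (iterate-mono τ-mono 2)

    ¬¬-± : ∀ {a b} → a ^ 2 ≈ b ^ 2 → ¬ ¬ (a ≈ b ⊎ a ≈ - b)
    ¬¬-± {a} {b} a²≈b² = ¬¬-map [ inj₁ ∘ -≈0⇒≈ , inj₂ ∘ -≈0⇒≈ ]
      (¬¬-zero-product (trans (solve 2 (λ a b → (a :- b) :* (a :- (:- b)) := a :* (a :* con (+ 1)) :- b :* (b :* con (+ 1))) refl a b)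
                              (≈⇒-≈0 a²≈b²)))

    ρ-fixes-± : ∀ {i a} → ρ i ≈ i → a ≈ i ⊎ a ≈ - i → ρ a ≈ a
    ρ-fixes-± ρi≈i (inj₁ a≈i)  = trans (ρ.⟦⟧-cong a≈i) (trans ρi≈i (sym a≈i))
    ρ-fixes-± ρi≈i (inj₂ a≈-i) = trans (ρ.⟦⟧-cong a≈-i) (trans (ρ.-‿homo _) (trans (-‿cong ρi≈i) (sym a≈-i)))

    ρi≈i : ∀ {i} → i ^ 2 ≈ - 1# → ¬ ¬ ρ i ≈ i
    ρi≈i {i} i²≈-1 = ¬¬-map τ-twice (¬¬-± (trans (sym (τ-^ i 2)) (trans (⟦⟧-cong i²≈-1) (trans (-‿homo 1#) (trans (-‿cong 1#-homo) (sym i²≈-1))))))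
      where
      τ-twice : τ i ≈ i ⊎ τ i ≈ - i → ρ i ≈ i
      τ-twice (inj₁ τi≈i)  = trans (⟦⟧-cong τi≈i) τi≈i
      τ-twice (inj₂ τi≈-i) = trans (⟦⟧-cong τi≈-i) (trans (-‿homo i) (trans (-‿cong τi≈-i) (-‿involutive i)))

    -- With ρ u = -u and z² = u, ρ z = w z has w² = -1, so ρ fixes w and
    -- z = ρ (ρ z) = w² z = -z.
    no-order-four : (∀ y → ¬ y ≈ 0# → ¬ ¬ Σ Carrier λ z → z ^ 2 ≈ y) → ¬ (∀ x → ρ x ≈ x) → ⊥
    no-order-four sqrt ρ≉id = run (sqrt (- 1#) -1≉0 >>= λ (i , i²≈-1) → ρi≈i i²≈-1 >>= λ ρi≈i →
      moved >>= λ (x , ρx≉x) → let u = ρ x - x ; u≉0 = λ u≈0 → ρx≉x (-≈0⇒≈ u≈0) in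
      sqrt u u≉0 >>= λ (z , z²≈u) →
      let z≉0 : ¬ z ≈ 0#
          z≉0 z≈0 = u≉0 (trans (sym z²≈u) (trans (^-congˡ 2 z≈0) (0^suc 1)))
          open ρ.Ratio z z≉0
          w²≈i² : w ^ 2 ≈ i ^ 2
          w²≈i² = trans (w^q≈ 2 (trans (ρ.⟦⟧-cong z²≈u) (trans (ρu≈-u x) (trans (-‿cong (sym z²≈u))
                    (trans (-‿cong (sym (*-identityˡ _))) (-‿distribˡ-* 1# (z ^ 2)))))))
                  (sym i²≈-1)
      in ¬¬-± w²≈i² >>= λ w≈±i → λ _ → 2≉0 (*-cancelʳ z≉0 (z+z≈0 (ρ-fixes-± ρi≈i w≈±i) τz≈wz w²≈i² i²≈-1)))
      where
      -1≉0 : ¬ - 1# ≈ 0#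
      -1≉0 -1≈0 = 1≉0 (trans (sym (-‿involutive 1#)) (trans (-‿cong -1≈0) -0#≈0#))
      2≉0 : ¬ (1# + 1#) ≈ 0#
      2≉0 2≈0 = ch0 1 (trans (+-congˡ (+-identityʳ 1#)) 2≈0)
      moved : ¬ ¬ Σ Carrier λ x → ¬ ρ x ≈ x
      moved none = ρ≉id λ x → stable λ ρx≉x → none (x , ρx≉x)
      ρu≈-u : ∀ x → ρ (ρ x - x) ≈ - (ρ x - x)
      ρu≈-u x = trans (ρ.τ-‿ (ρ x) x) (trans (+-congʳ (τ⁴≈id x)) (solve 2 (λ x y → x :- y := :- (y :- x)) refl x (ρ x)))
      z+z≈0 : ∀ {z w i} → ρ w ≈ w → ρ z ≈ w * z → w ^ 2 ≈ i ^ 2 → i ^ 2 ≈ - 1# → (1# + 1#) * z ≈ 0# * z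
      z+z≈0 {z} {w} {i} ρw≈w ρz≈wz w²≈i² i²≈-1 = begin
        (1# + 1#) * z      ≈⟨ solve 1 (λ z → (con (+ 1) :+ con (+ 1)) :* z := z :- (:- z)) refl z ⟩
        z - (- z)          ≈⟨ +-congʳ (sym (τ⁴≈id z)) ⟩
        ρ (ρ z) - (- z)    ≈⟨ +-congʳ (trans (ρ.⟦⟧-cong ρz≈wz) (trans (ρ.*-homo w z) (*-cong ρw≈w ρz≈wz))) ⟩
        w * (w * z) - (- z) ≈⟨ +-congʳ (trans (sym (*-assoc _ _ _)) (*-congʳ (trans (*-congˡ (sym (*-identityʳ w))) (trans w²≈i² i²≈-1)))) ⟩
        - 1# * z - (- z)   ≈⟨ solve 1 (λ z → (:- con (+ 1)) :* z :- (:- z) := con (+ 0) :* z) refl z ⟩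
        0# * z             ∎

module DifferentiallyClosed {c ℓ} (K : DiffField c ℓ) (dc : DiffClosed K) where
  open import Data.Nat as ℕ using (ℕ; zero; suc; _<_; s≤s; z≤n)
  import Data.Nat.Properties as ℕ
  open import Data.Nat.DivMod using (_%_; _/_; m≡m%n+[m/n]*n; m<n⇒m%n≡m; [m+n]%n≡m%n)
  open import Data.Nat.Primality using (Prime; prime)
  open import Data.Fin using (Fin)
  open import Data.Integer using (+_)
  open import Data.List using (List; []; _∷_; applyUpTo)
  open import Data.List.Relation.Unary.All using (All; []; _∷_)
  import Data.List.Relation.Binary.Permutation.Propositional as ↭
  open ↭ using (_↭_)
  open import Data.Product using (Σ; _,_; proj₂; _×_)
  open import Function using (id; _∘_)
  open import Relation.Nullary using (¬_; yes; no; contradiction)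
  open import Relation.Nullary.Negation using (¬¬-map)
  import Relation.Binary.PropositionalEquality as ≡
  open DoubleNegation

  open DiffField K
  open FieldPolynomials K
  open import Algebra.Properties.Ring ring using (-0#≈0#)
  open IntegerCoefficientSolver commRing using (solve; _:=_; _:*_; :-_; _:-_; con)
  open import Algebra.Properties.Semiring.Mult semiring using () renaming (_×_ to _⨯_)
  open import Relation.Binary.Reasoning.Setoid setoid

  -- K with ¬¬-equality is again a differential field; since it contains a
  -- solution of a - b = 0 whenever ¬ ¬ a ≈ b, so does K.
  ¬¬-stable : ∀ {a b} → ¬ ¬ a ≈ b → a ≈ b
  ¬¬-stable {a} {b} ¬¬a≈b with dc ¬¬K id id-hom 0 (const (a - b) ∷ []) [] ((λ ()) , (¬¬-map ≈⇒-≈0 ¬¬a≈b ∷ []) , [])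
    where
    ¬¬K : DiffField c ℓ
    ¬¬K = record
      { commRing = record
        { Carrier = Carrier ; _≈_ = λ a b → ¬ ¬ a ≈ b ; _+_ = _+_ ; _*_ = _*_ ; -_ = -_ ; 0# = 0# ; 1# = 1#
        ; isCommutativeRing = record
          { isRing = record
            { +-isAbelianGroup = record
              { isGroup = record
                { isMonoid = record
                  { isSemigroup = record
                    { isMagma = record
                      { isEquivalence = record { refl = pure refl ; sym = ¬¬-map sym ; trans = lift₂ trans }
                      ; ∙-cong = lift₂ +-cong }
                    ; assoc = λ x y z → pure (+-assoc x y z) }
                  ; identity = (λ x → pure (+-identityˡ x)) , (λ x → pure (+-identityʳ x)) }
                ; inverse = (λ x → pure (-‿inverseˡ x)) , (λ x → pure (-‿inverseʳ x))
                ; ⁻¹-cong = ¬¬-map -‿cong }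
              ; comm = λ x y → pure (+-comm x y) }
            ; *-cong = lift₂ *-cong
            ; *-assoc = λ x y z → pure (*-assoc x y z)
            ; *-identity = (λ x → pure (*-identityˡ x)) , (λ x → pure (*-identityʳ x))
            ; distrib = (λ x y z → pure (distribˡ x y z)) , (λ x y z → pure (distribʳ x y z)) }
          ; *-comm = λ x y → pure (*-comm x y) } }
      ; 1≉0 = λ ¬¬1≈0 → ¬¬1≈0 1≉0
      ; inverse = λ x x≉0 → let (y , xy≈1) = inverse x (λ x≈0 → x≉0 (pure x≈0)) in y , pure xy≈1
      ; ∂ = ∂ ; ∂-cong = ¬¬-map ∂-cong ; ∂-+ = λ x y → pure (∂-+ x y) ; ∂-* = λ x y → pure (∂-* x y) }
      where
      lift₂ : ∀ {x y u v w z} → (x ≈ y → u ≈ v → w ≈ z) → ¬ ¬ x ≈ y → ¬ ¬ u ≈ v → ¬ ¬ w ≈ z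
      lift₂ F ¬¬x≈y ¬¬u≈v = ¬¬x≈y >>= λ x≈y → ¬¬-map (F x≈y) ¬¬u≈v
    id-hom : IsDiffHom K ¬¬K id
    id-hom = record { cong = pure ; hom+ = λ _ _ → pure refl ; hom* = λ _ _ → pure refl ; hom1 = pure refl ; hom∂ = λ _ → pure refl }
  ... | _ , (a-b≈0 ∷ []) , [] = -≈0⇒≈ a-b≈0

  natCast≈⨯ : ∀ n → natCast K n ≈ n ⨯ 1#
  natCast≈⨯ zero    = refl
  natCast≈⨯ (suc n) = +-congˡ (natCast≈⨯ n)

  𝕩 : DPoly Carrier 1
  𝕩 = var Fin.zero 0

  infixr 30 _^ᵈ_
  _^ᵈ_ : DPoly Carrier 1 → ℕ → DPoly Carrier 1
  t ^ᵈ zero  = const 1#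
  t ^ᵈ suc k = t ⊗ t ^ᵈ k

  eval-𝕩^ : ∀ k (w : Fin 1 → Carrier) → evalD K id (𝕩 ^ᵈ k) w ≈ w Fin.zero ^ k
  eval-𝕩^ zero    w = refl
  eval-𝕩^ (suc k) w = *-congˡ (eval-𝕩^ k w)

  -- A root of x^q − a in the quotient field e·K[X]/(f) gives one in K.
  module Binomial (ch0 : Char0 K) (q′ : ℕ) (a : Carrier) (a≉0 : ¬ a ≈ 0#) where
    q = suc q′
    f = X^ q ⊞ constₚ (- a)

    equation : DPoly Carrier 1
    equation = 𝕩 ^ᵈ q ⊕ const (- a)

    coeff-f≈0 : ∀ i → i ≡.≢ q → i ≡.≢ 0 → coeff f i ≈ 0#
    coeff-f≈0 zero    _   i≢0 = contradiction ≡.refl i≢0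
    coeff-f≈0 (suc i) i≢q _   = trans (coeff-⊞ (X^ q) (constₚ (- a)) (suc i)) (trans (+-congʳ (coeff-X^-≢ q (suc i) i≢q)) (+-identityʳ 0#))

    f-monic : Monic q f
    f-monic = monic (trans (coeff-⊞ (X^ q) (constₚ (- a)) q) (trans (+-congʳ (coeff-X^-n q)) (+-identityʳ 1#)))
                    (λ i q<i → coeff-f≈0 i (λ i≡q → ℕ.<-irrefl (≡.sym i≡q) q<i) (λ { ≡.refl → contradiction q<i λ () }))

    deriv-f : deriv f ≋ deriv (X^ q)
    deriv-f = ≋-trans (deriv-⊞ (X^ q) (constₚ (- a)))
      (≋-trans (⊞-cong (≋-refl {deriv (X^ q)}) (mk≋ {deriv (constₚ (- a))} {[]} λ { zero → refl ; (suc i) → refl })) (⊞-identityʳ _))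

    separable : constₚ (- natCast K q) ⊠ f ⊞ X ⊠ deriv f ≋ constₚ (natCast K q * a)
    separable = ≋-trans (⊞-cong (≋-refl {constₚ (- natCast K q) ⊠ f})
                          (≋-trans (⊠-congʳ X deriv-f) (≋-trans (X⊠deriv-X^ q) (≋-trans (·-cong (sym (natCast≈⨯ q)) ≋-refl)
                                   (≋-sym (constₚ-⊠ (natCast K q) (X^ q)))))))
      (≋-trans (⊞⊠-solve 3 (λ n x a → (:⊝ n) :⊠ (x :⊟ a) :⊞ n :⊠ x :≋ n :⊠ a) ≋-refl (constₚ (natCast K q)) (X^ q) (constₚ a))
               (mk≋ λ { zero → +-identityʳ _ ; (suc i) → refl }))

    qa≉0 : ¬ natCast K q * a ≈ 0#
    qa≉0 = *-≉0 (ch0 q′) a≉0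

    eval-equation : ∀ w → evalD K id equation w ≈ 0# → w Fin.zero ^ q ≈ a
    eval-equation w eq≈0 = -≈0⇒≈ (trans (+-congʳ (sym (eval-𝕩^ q w))) eq≈0)

    module Root {h} (C : Component f h) (M : Poly → Poly) (N : Poly → Carrier)
      (norm : ∀ p → ¬ ¬ Component.e C ⊠ (p ⊠ M p) ≋ Component.e C ⊠ constₚ (N p) mod f)
      (M-unit : ∀ p {w} → p ⊠ w ≋ 1ₚ mod f → ¬ ¬ Σ Poly λ w′ → M p ⊠ w′ ≋ 1ₚ mod f)
      (x′ : Poly) (f∣∂ₓf : f ∣ ExtendedDerivation.∂ₓ x′ f) where
      open QuotientField f-monic C M N norm M-unit x′ f∣∂ₓf

      eval-𝕩^-X : ∀ k → evalD quotientField constₚ (𝕩 ^ᵈ k) (λ _ → X) ≋ X^ k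
      eval-𝕩^-X zero    = ≋-refl
      eval-𝕩^-X (suc k) = ≋-trans (⊠-congʳ X (eval-𝕩^-X k)) (X⊠ (X^ k))

      X-solves : evalD quotientField constₚ equation (λ _ → X) ≈ₗ []
      X-solves = lift₂ ≋mod-trans (≋⇒≈ₗ (⊞-cong (eval-𝕩^-X q) ≋-refl)) (∣⇒≈ₗ[] (∣-refl f))

      root : Σ Carrier λ z → z ^ q ≈ a
      root = root-in-K (dc quotientField constₚ constₚ-hom 1 (equation ∷ []) [] ((λ _ → X) , X-solves ∷ [] , []))
        where
        root-in-K : Σ (Fin 1 → Carrier) (Solves K id (equation ∷ []) []) → Σ Carrier λ z → z ^ q ≈ a
        root-in-K (w , (eq≈0 ∷ []) , []) = w Fin.zero , eval-equation w eq≈0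

      root≉1 : ¬ f ∣ Component.e C ⊠ X-1 → Σ Carrier λ z → z ^ q ≈ a × ¬ z ≈ 1#
      root≉1 f∤e⊠[X-1] = root-in-K (dc quotientField constₚ constₚ-hom 1 (equation ∷ []) (𝕩-1 ∷ []) ((λ _ → X) , X-solves ∷ [] , X≉1 ∷ []))
        where
        X≉1 : ¬ X-1 ≈ₗ []
        X≉1 X-1≈0 = ≈ₗ[]⇒¬¬∣ X-1≈0 f∤e⊠[X-1]
        𝕩-1 = 𝕩 ⊕ (⊖ const 1#)
        root-in-K : Σ (Fin 1 → Carrier) (Solves K id (equation ∷ []) (𝕩-1 ∷ [])) → Σ Carrier λ z → z ^ q ≈ a × ¬ z ≈ 1#
        root-in-K (w , (eq≈0 ∷ []) , (w≉1 ∷ [])) = w Fin.zero , eval-equation w eq≈0 , λ w≈1 → w≉1 (≈⇒-≈0 w≈1)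

  ∂ᶜ-X^ : ∀ n → ∂ᶜ (X^ n) ≋ []
  ∂ᶜ-X^ zero    = mk≋ λ { zero → ∂-1# ; (suc i) → refl }
  ∂ᶜ-X^ (suc n) = mk≋ λ { zero → ∂-0# ; (suc i) → at (∂ᶜ-X^ n) i }

  unit-⊠ : ∀ {f A B wA wB} → A ⊠ wA ≋ 1ₚ mod f → B ⊠ wB ≋ 1ₚ mod f → (A ⊠ B) ⊠ (wA ⊠ wB) ≋ 1ₚ mod f
  unit-⊠ {A = A} {B} {wA} {wB} A-unit B-unit = ≋mod-resp
    (⊞⊠-solve 4 (λ a b wa wb → (a :⊠ wa) :⊠ (b :⊠ wb) :≋ (a :⊠ b) :⊠ (wa :⊠ wb)) ≋-refl A B wA wB) (⊠-identityˡ 1ₚ)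
    (≋mod-⊠ A-unit B-unit)

  -- Adjoining a q-th root of y ≠ 0 when ζ is a primitive q-th root of unity in K:
  -- X ↦ ζ X permutes the roots of X^q − y, so p (X) ∏_{0<j<q} p (ζ^j X) is
  -- congruent to a constant, which gives inverses in K[X]/(f).
  module Kummer (ch0 : Char0 K) (q′ : ℕ) (ζ : Carrier) (ζ^q≈1 : ζ ^ suc q′ ≈ 1#)
                (ζ-primitive : ∀ k → 0 < k → k < suc q′ → ¬ ζ ^ k ≈ 1#)
                (y : Carrier) (y≉0 : ¬ y ≈ 0#) where
    open Binomial ch0 q′ y y≉0
    open Division f-monic using (quot; rem; rem≋; rem-Deg<)

    dilate-f : ∀ {b} → b ^ q ≈ 1# → dilate b f ≋ f
    dilate-f {b} b^q≈1 = mk≋ λ i → trans (coeff-dilate b f i) (fixed i)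
      where
      fixed : ∀ i → b ^ i * coeff f i ≈ coeff f i
      fixed i with i ℕ.≟ 0 | i ℕ.≟ q
      ... | yes ≡.refl | _          = *-identityˡ _
      ... | no _       | yes ≡.refl = trans (*-congʳ b^q≈1) (*-identityˡ _)
      ... | no i≢0     | no i≢q     = trans (*-congˡ (coeff-f≈0 i i≢q i≢0)) (trans (zeroʳ _) (sym (coeff-f≈0 i i≢q i≢0)))

    dilate-≋mod : ∀ {b p r} → b ^ q ≈ 1# → p ≋ r mod f → dilate b p ≋ dilate b r mod f
    dilate-≋mod {b} {p} {r} b^q≈1 (by-∣ (k , p-r≋kf)) = by-∣ (dilate b k ,
      ≋-trans (≋-sym (≋-trans (dilate-⊞ b p (⊝ r)) (⊞-cong ≋-refl (dilate-⊝ b r))))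
              (≋-trans (dilate-cong refl p-r≋kf) (≋-trans (dilate-⊠ b k f) (⊠-congʳ (dilate b k) (dilate-f b^q≈1)))))

    ζ^j^q≈1 : ∀ j → (ζ ^ j) ^ q ≈ 1#
    ζ^j^q≈1 = ^≈1⇒^^≈1 q ζ^q≈1

    dilations : ℕ → ℕ → Poly → Poly
    dilations s zero    p = 1ₚ
    dilations s (suc k) p = dilate (ζ ^ (s ℕ.+ k)) p ⊠ dilations s k p

    dilate-ζ-dilations : ∀ s k p → dilate ζ (dilations s k p) ≋ dilations (suc s) k p
    dilate-ζ-dilations s zero    p = ≋-refl
    dilate-ζ-dilations s (suc k) p = ≋-trans (dilate-⊠ ζ (dilate (ζ ^ (s ℕ.+ k)) p) (dilations s k p))
      (⊠-cong (dilate-dilate ζ (ζ ^ (s ℕ.+ k)) p) (dilate-ζ-dilations s k p))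

    dilations-suc : ∀ s k p → dilate (ζ ^ s) p ⊠ dilations (suc s) k p ≋ dilations s (suc k) p
    dilations-suc s zero    p = ⊠-congˡ 1ₚ (dilate-cong {p = p} (reflexive (≡.cong (ζ ^_) (≡.sym (ℕ.+-identityʳ s)))) ≋-refl)
    dilations-suc s (suc k) p = ≋-trans
      (⊞⊠-solve 3 (λ a b c → a :⊠ (b :⊠ c) :≋ b :⊠ (a :⊠ c)) ≋-refl (dilate (ζ ^ s) p) (dilate (ζ ^ (suc s ℕ.+ k)) p) (dilations (suc s) k p))
      (⊠-cong (dilate-cong {p = p} (reflexive (≡.cong (ζ ^_) (≡.sym (ℕ.+-suc s k)))) ≋-refl) (dilations-suc s k p))

    M : Poly → Poly
    M p = dilations 1 q′ p

    dilate-ζ-p⊠Mp : ∀ p → dilate ζ (p ⊠ M p) ≋ p ⊠ M p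
    dilate-ζ-p⊠Mp p = ≋-trans (dilate-⊠ ζ p (M p)) (≋-trans (⊠-cong (dilate-cong {p = p} (sym (*-identityʳ ζ)) ≋-refl) (dilate-ζ-dilations 1 q′ p))
      (≋-trans (dilations-suc 1 q′ p) (⊠-cong (≋-trans (dilate-cong {p = p} ζ^q≈1 ≋-refl) (dilate-1 p)) ≋-refl)))

    N : Poly → Carrier
    N p = coeff (rem (p ⊠ M p)) 0

    -- The remainder r of p M p is X ↦ ζ X invariant, so (ζ^i − 1) rᵢ = 0 for 0 < i < q.
    norm : ∀ p → ¬ ¬ f ∣ p ⊠ M p ⊞ ⊝ constₚ (N p)
    norm p = Deg<∧∣⇒≋[] f-monic D<q f∣D >>= λ D≋[] → pure (quot P ,
      ≋-trans (⊞-cong (Division.division f-monic P) ≋-refl) (≋-trans (⊞-assoc (quot P ⊠ f) r (⊝ constₚ (N p)))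
        (≋-trans (⊞-cong (≋-refl {quot P ⊠ f}) (r≋N D≋[])) (⊞-identityʳ _))))
      where
      P = p ⊠ M p
      r = rem P
      D = dilate ζ r ⊞ ⊝ r
      Q = quot P
      dilate-r : dilate ζ r ≋ P ⊞ ⊝ (dilate ζ Q ⊠ f)
      dilate-r = ≋-trans (dilate-cong refl (rem≋ P)) (≋-trans (dilate-⊞ ζ P (⊝ (Q ⊠ f)))
        (⊞-cong (dilate-ζ-p⊠Mp p) (≋-trans (dilate-⊝ ζ (Q ⊠ f)) (⊝-cong (≋-trans (dilate-⊠ ζ Q f) (⊠-congʳ (dilate ζ Q) (dilate-f ζ^q≈1)))))))
      f∣D : f ∣ D
      f∣D = Q ⊞ ⊝ dilate ζ Q , ≋-trans (⊞-cong dilate-r (⊝-cong (rem≋ P)))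
        (⊞⊠-solve 4 (λ P d f Q → (P :⊟ d :⊠ f) :⊟ (P :⊟ Q :⊠ f) :≋ (Q :⊟ d) :⊠ f) ≋-refl P (dilate ζ Q) f Q)
      D<q : Deg< q D
      D<q i q≤i = trans (coeff-⊞ (dilate ζ r) (⊝ r) i) (trans (+-cong (trans (coeff-dilate ζ r i) (trans (*-congˡ (rem-Deg< P i q≤i)) (zeroʳ _)))
                    (trans (coeff-⊝ r i) (-‿cong (rem-Deg< P i q≤i)))) (trans (+-identityˡ _) -0#≈0#))
      r≋N : D ≋ [] → r ⊞ ⊝ constₚ (N p) ≋ []
      r≋N D≋[] = mk≋ λ
        { zero    → trans (coeff-⊞ r (⊝ constₚ (N p)) 0) (-‿inverseʳ _)
        ; (suc i) → trans (coeff-⊞ r (⊝ constₚ (N p)) (suc i)) (trans (+-identityʳ _) (rᵢ≈0 (suc i) (s≤s z≤n))) }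
        where
        rᵢ≈0 : ∀ i → 0 < i → coeff r i ≈ 0#
        rᵢ≈0 i 0<i with i ℕ.<? q
        ... | no  i≮q = rem-Deg< P i (ℕ.≮⇒≥ i≮q)
        ... | yes i<q = *-cancelˡ-≈0 (λ ζ^i-1≈0 → ζ-primitive i 0<i i<q (-≈0⇒≈ ζ^i-1≈0))
          (trans (solve 2 (λ z r → (z :- con (+ 1)) :* r := z :* r :- r) refl (ζ ^ i) (coeff r i))
                 (trans (+-cong (sym (coeff-dilate ζ r i)) (sym (coeff-⊝ r i))) (trans (sym (coeff-⊞ (dilate ζ r) (⊝ r) i)) (at D≋[] i))))

    M-unit : ∀ p {w} → p ⊠ w ≋ 1ₚ mod f → Σ Poly λ w′ → M p ⊠ w′ ≋ 1ₚ mod f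
    M-unit p {w} p-unit = dilations 1 q′ w , units 1 q′
      where
      units : ∀ s k → dilations s k p ⊠ dilations s k w ≋ 1ₚ mod f
      units s zero    = ≋⇒≋mod (⊠-identityˡ 1ₚ)
      units s (suc k) = unit-⊠ {A = dilate (ζ ^ (s ℕ.+ k)) p} {wA = dilate (ζ ^ (s ℕ.+ k)) w} (≋mod-resp (dilate-⊠ (ζ ^ (s ℕ.+ k)) p w) dilate-1′ (dilate-≋mod (ζ^j^q≈1 (s ℕ.+ k)) p-unit))
                               (units s k)
        where
        dilate-1′ : dilate (ζ ^ (s ℕ.+ k)) 1ₚ ≋ 1ₚ
        dilate-1′ = mk≋ λ { zero → refl ; (suc i) → refl }

    c₀ = ∂ y * (natCast K q * y) ⁻¹⟨ qa≉0 ⟩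
    x′ = c₀ · X
    open ExtendedDerivation x′

    f∣∂ₓf : f ∣ ∂ₓ f
    f∣∂ₓf = constₚ (c₀ * natCast K q) , ≋-trans (⊞-cong ∂ᶜf≋ deriv⊠x′≋) (≋-sym (≋-trans (constₚ-⊠ (c₀ * natCast K q) f)
      (≋-trans (·-⊞ (c₀ * natCast K q) (X^ q) (constₚ (- y))) (⊞-comm ((c₀ * natCast K q) · X^ q) (constₚ ((c₀ * natCast K q) * - y))))))
      where
      ∂ᶜf≋ : ∂ᶜ f ≋ constₚ ((c₀ * natCast K q) * - y)
      ∂ᶜf≋ = ≋-trans (∂ᶜ-⊞ (X^ q) (constₚ (- y))) (≋-trans (⊞-cong (∂ᶜ-X^ q) ≋-refl) (mk≋ {∂ (- y) ∷ []} {constₚ ((c₀ * natCast K q) * - y)} λ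
        { zero → trans (∂-‿ y) (sym (begin
            c₀ * natCast K q * - y                        ≈⟨ solve 4 (λ d i n y → d :* i :* n :* (:- y) := :- (d :* (i :* (n :* y)))) refl (∂ y) ((natCast K q * y) ⁻¹⟨ qa≉0 ⟩) (natCast K q) y ⟩
            - (∂ y * ((natCast K q * y) ⁻¹⟨ qa≉0 ⟩ * (natCast K q * y)))  ≈⟨ -‿cong (*-congˡ (⁻¹-inverseˡ _ qa≉0)) ⟩
            - (∂ y * 1#)                                   ≈⟨ -‿cong (*-identityʳ _) ⟩
            - ∂ y                                          ∎))
        ; (suc i) → refl }))
      deriv⊠x′≋ : deriv f ⊠ x′ ≋ (c₀ * natCast K q) · X^ q
      deriv⊠x′≋ = ≋-trans (⊠-congˡ x′ deriv-f) (≋-trans (⊠-comm (deriv (X^ q)) x′) (≋-trans (·-⊠ c₀ X (deriv (X^ q)))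
        (≋-trans (·-cong refl (≋-trans (X⊠deriv-X^ q) (·-cong (sym (natCast≈⨯ q)) ≋-refl))) (·-assoc c₀ (natCast K q) (X^ q)))))

    root : ¬ ¬ Σ Carrier λ z → z ^ q ≈ y
    root = ¬¬-component f-monic (s≤s z≤n) (∣-refl f) (constₚ (- natCast K q)) X separable qa≉0 >>= λ C →
      pure (Root.root C M N (λ p → ¬¬-map (λ f∣ → ≋mod-⊠ (≋⇒≋mod (≋-refl {Component.e C})) (by-∣ f∣)) (norm p))
                        (λ p p-unit → pure (M-unit p p-unit)) x′ f∣∂ₓf)

  -- Adjoining a root ≠ 1 of X^q − 1 for a prime q: the substitutions X ↦ X^b
  -- (0 < b < q) permute the roots, p (X) ∏_{1<b<q} p (X^b) is invariant under
  -- all of them modulo X^q − 1, so its remainder r has r₁ = … = r_{q−1}, and it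
  -- is congruent to the constant r₀ − r₁ modulo Φ_q.
  module Cyclotomic (ch0 : Char0 K) (q″ : ℕ) (q-prime : Prime (suc (suc q″))) where
    open Binomial ch0 (suc q″) 1# 1≉0
    open NumberTheory.UnitsModulo q q-prime
    open Division f-monic using (quot; rem; rem≋; rem≈; rem-Deg<; division)
    open import Algebra.Properties.CommutativeSemiring.Exp (CommutativeRing.commutativeSemiring polynomialRing)
      using () renaming (_^_ to _^ₚ_)

    σ : ℕ → Poly → Poly
    σ b p = p ∘ₚ X^ b

    X^-∘ₚ : ∀ n t → X^ n ∘ₚ t ≋ t ^ₚ n
    X^-∘ₚ zero    t = constₚ-∘ₚ 1# t
    X^-∘ₚ (suc n) t = ≋-trans (⊞-cong (mk≋ {constₚ 0#} {[]} λ { zero → refl ; (suc i) → refl }) (⊠-congʳ t (X^-∘ₚ n t))) ≋-refl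

    X^^ₚ : ∀ b n → X^ b ^ₚ n ≋ X^ (n ℕ.* b)
    X^^ₚ b zero    = ≋-refl
    X^^ₚ b (suc n) = ≋-trans (⊠-congʳ (X^ b) (X^^ₚ b n)) (≋-sym (X^-+ b (n ℕ.* b)))

    σ-σ : ∀ b c p → σ c (σ b p) ≋ σ (c ℕ.* b) p
    σ-σ b c p = ≋-trans (∘ₚ-assoc p (X^ b) (X^ c))
      (∘ₚ-congʳ p (≋-trans (X^-∘ₚ b (X^ c)) (≋-trans (X^^ₚ c b) (≡⇒≋ (≡.cong X^_ (ℕ.*-comm b c))))))

    σ-1 : ∀ p → σ 1 p ≋ p
    σ-1 = ∘ₚ-X

    ∘ₚ-≋mod : ∀ p {t t′} → t ≋ t′ mod f → p ∘ₚ t ≋ p ∘ₚ t′ mod f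
    ∘ₚ-≋mod []      t≈t′ = ≋⇒≋mod ≋-refl
    ∘ₚ-≋mod (a ∷ p) t≈t′ = ≋mod-⊞ (≋⇒≋mod (≋-refl {constₚ a})) (≋mod-⊠ t≈t′ (∘ₚ-≋mod p t≈t′))

    X^q≈1 : X^ q ≋ 1ₚ mod f
    X^q≈1 = by-∣ (∣-refl f)

    X^kq≈1 : ∀ k → X^ (k ℕ.* q) ≋ 1ₚ mod f
    X^kq≈1 zero    = ≋⇒≋mod ≋-refl
    X^kq≈1 (suc k) = ≋mod-resp (≋-sym (X^-+ q (k ℕ.* q))) (⊠-identityˡ 1ₚ) (≋mod-⊠ X^q≈1 (X^kq≈1 k))

    X^≈X^% : ∀ m → X^ m ≋ X^ (m % q) mod f
    X^≈X^% m = ≋mod-resp (≋-trans (≋-sym (X^-+ (m % q) (m / q ℕ.* q))) (≡⇒≋ (≡.cong X^_ (≡.sym (m≡m%n+[m/n]*n m q))))) (⊠-identityʳ _)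
                         (≋mod-⊠ (≋⇒≋mod (≋-refl {X^ (m % q)})) (X^kq≈1 (m / q)))

    σ-f≈0 : ∀ b → σ b f ≋ [] mod f
    σ-f≈0 b = ≋mod-resp (≋-sym (≋-trans (∘ₚ-⊞ (X^ q) (constₚ (- 1#)) (X^ b)) (⊞-cong (≋-trans (X^-∘ₚ q (X^ b)) (X^^ₚ b q)) (constₚ-∘ₚ (- 1#) (X^ b)))))
      (⊞-inverseʳ 1ₚ) (≋mod-⊞ (≋mod-resp (≡⇒≋ (≡.cong X^_ (ℕ.*-comm b q))) ≋-refl (X^kq≈1 b)) (≋⇒≋mod (≋-refl {⊝ 1ₚ})))

    σ-≋mod : ∀ b {p r} → p ≋ r mod f → σ b p ≋ σ b r mod f
    σ-≋mod b {p} {r} (by-∣ (k , p-r≋kf)) = by-∣ (∣-respʳ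
      (≋-trans (≋-sym (∘ₚ-⊠ k f (X^ b))) (≋-trans (∘ₚ-cong (X^ b) (≋-sym p-r≋kf)) (≋-trans (∘ₚ-⊞ p (⊝ r) (X^ b)) (⊞-cong ≋-refl (∘ₚ-⊝ r (X^ b))))))
      (∣-⊠ (σ b k) (≋[]mod⇒∣ (σ-f≈0 b))))

    Π : List ℕ → Poly → Poly
    Π []       p = 1ₚ
    Π (b ∷ bs) p = σ b p ⊠ Π bs p

    Π-↭ : ∀ {bs cs} p → bs ↭ cs → Π bs p ≋ Π cs p
    Π-↭ p ↭.refl          = ≋-refl
    Π-↭ p (↭.prep b bs↭)  = ⊠-congʳ (σ b p) (Π-↭ p bs↭)
    Π-↭ p (↭.swap b c bs↭) = ≋-trans (⊞⊠-solve 3 (λ x y z → x :⊠ (y :⊠ z) :≋ y :⊠ (x :⊠ z)) ≋-refl (σ b p) (σ c p) _)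
                                     (⊠-congʳ (σ c p) (⊠-congʳ (σ b p) (Π-↭ p bs↭)))
    Π-↭ p (↭.trans bs↭ cs↭) = ≋-trans (Π-↭ p bs↭) (Π-↭ p cs↭)

    σ-Π : ∀ c g n p → σ c (Π (applyUpTo g n) p) ≋ Π (applyUpTo (λ i → c ℕ.* g i) n) p
    σ-Π c g zero    p = constₚ-∘ₚ 1# (X^ c)
    σ-Π c g (suc n) p = ≋-trans (∘ₚ-⊠ (σ (g 0) p) _ (X^ c)) (⊠-cong (σ-σ (g 0) c p) (σ-Π c (g ∘ suc) n p))

    Π-% : ∀ g n p → Π (applyUpTo g n) p ≋ Π (applyUpTo (λ i → g i % q) n) p mod f
    Π-% g zero    p = ≋⇒≋mod ≋-refl
    Π-% g (suc n) p = ≋mod-⊠ (∘ₚ-≋mod p (X^≈X^% (g 0))) (Π-% (g ∘ suc) n p)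

    Π-units-invariant : ∀ {c} p → 0 < c → c < q → σ c (Π units p) ≋ Π units p mod f
    Π-units-invariant {c} p 0<c c<q =
      ≋mod-resp (≋-sym (σ-Π c suc (suc q″) p)) (Π-↭ p (scaled-units↭units 0<c c<q)) (Π-% (λ i → c ℕ.* suc i) (suc q″) p)

    M : Poly → Poly
    M p = Π (applyUpTo (suc ∘ suc) q″) p

    p⊠Mp≋Π-units : ∀ p → p ⊠ M p ≋ Π units p
    p⊠Mp≋Π-units p = ⊠-congˡ (M p) (≋-sym (σ-1 p))

    pairing-σ : ∀ χ c p → pairing χ (σ c p) ≈ pairing (λ m → χ (c ℕ.* m)) p
    pairing-σ χ c []      = refl
    pairing-σ χ c (a ∷ p) = begin
      pairing χ (constₚ a ⊞ X^ c ⊠ σ c p)                       ≈⟨ pairing-⊞ χ (constₚ a) (X^ c ⊠ σ c p) ⟩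
      pairing χ (constₚ a) + pairing χ (X^ c ⊠ σ c p)           ≈⟨ +-cong (+-identityʳ _) (trans (pairing-X^⊠ χ c (σ c p)) (pairing-σ (λ i → χ (c ℕ.+ i)) c p)) ⟩
      χ 0 * a + pairing (λ m → χ (c ℕ.+ c ℕ.* m)) p             ≈⟨ +-cong (*-congʳ (reflexive (≡.cong χ (≡.sym (ℕ.*-zeroʳ c)))))
                                                                          (pairing-congˡ p (λ m → reflexive (≡.cong χ (≡.sym (ℕ.*-suc c m))))) ⟩
      χ (c ℕ.* 0) * a + pairing (λ m → χ (c ℕ.* suc m)) p       ∎

    pairing-∣ : ∀ χ → (∀ i → χ (q ℕ.+ i) ≈ χ i) → ∀ {h} → f ∣ h → pairing χ h ≈ 0#
    pairing-∣ χ periodic {h} (k , h≋kf) = begin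
      pairing χ h                                   ≈⟨ pairing-cong χ (≋-trans h≋kf (⊞⊠-solve 2 (λ k x → k :⊠ (x :⊟ :c (+ 1)) :≋ x :⊠ k :⊟ k) ≋-refl k (X^ q))) ⟩
      pairing χ (X^ q ⊠ k ⊞ ⊝ k)                    ≈⟨ trans (pairing-⊞ χ (X^ q ⊠ k) (⊝ k)) (+-cong (pairing-X^⊠ χ q k) (pairing-⊝ χ k)) ⟩
      pairing (λ i → χ (q ℕ.+ i)) k - pairing χ k   ≈⟨ +-congʳ (pairing-congˡ k periodic) ⟩
      pairing χ k - pairing χ k                     ≈⟨ -‿inverseʳ _ ⟩
      0#                                            ∎

    [_≡_]ᶜ : ℕ → ℕ → Carrier
    [ a ≡ b ]ᶜ with a ℕ.≟ b
    ... | yes _ = 1#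
    ... | no  _ = 0#

    [≡]ᶜ-yes : ∀ {a b} → a ≡.≡ b → [ a ≡ b ]ᶜ ≈ 1#
    [≡]ᶜ-yes {a} {b} a≡b with a ℕ.≟ b
    ... | yes _   = refl
    ... | no  a≢b = contradiction a≡b a≢b

    [≡]ᶜ-no : ∀ {a b} → a ≡.≢ b → [ a ≡ b ]ᶜ ≈ 0#
    [≡]ᶜ-no {a} {b} a≢b with a ℕ.≟ b
    ... | yes a≡b = contradiction a≡b a≢b
    ... | no  _   = refl

    -- Pairing with the indicator of the residue class of c reads off rᶜ.
    rem-coeff-const : ∀ p {c} → 0 < c → c < q → coeff (rem (p ⊠ M p)) 1 ≈ coeff (rem (p ⊠ M p)) c
    rem-coeff-const p {c} 0<c c<q = -≈0⇒≈ (begin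
      r₁ - rᶜ                                               ≈⟨ +-cong (sym pairing-σ-r) (-‿cong (sym pairing-r)) ⟩
      pairing χ (σ c r) - pairing χ r                        ≈⟨ +-congˡ (sym (pairing-⊝ χ r)) ⟩
      pairing χ (σ c r) + pairing χ (⊝ r)                    ≈⟨ sym (pairing-⊞ χ (σ c r) (⊝ r)) ⟩
      pairing χ (σ c r ⊞ ⊝ r)                                ≈⟨ pairing-∣ χ periodic (∣-difference σ-r≈r) ⟩
      0#                                                     ∎)
      where
      P = p ⊠ M p
      r = rem P
      r₁ = coeff r 1
      rᶜ = coeff r c
      χ : ℕ → Carrier
      χ i = [ i % q ≡ c ]ᶜ
      periodic : ∀ i → χ (q ℕ.+ i) ≈ χ i
      periodic i = reflexive (≡.cong (λ t → [ t ≡ c ]ᶜ) (≡.trans (≡.cong (_% q) (ℕ.+-comm q i)) ([m+n]%n≡m%n i q)))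
      r≈P : r ≋ P mod f
      r≈P = rem≈ P
      σ-r≈r : σ c r ≋ r mod f
      σ-r≈r = ≋mod-trans (σ-≋mod c r≈P) (≋mod-trans (≋mod-resp (≋-sym (∘ₚ-cong (X^ c) (p⊠Mp≋Π-units p))) (≋-sym (p⊠Mp≋Π-units p))
                (Π-units-invariant p 0<c c<q)) (≋mod-sym r≈P))
      pairing-r : pairing χ r ≈ rᶜ
      pairing-r = trans (pairing-single r χ c others) (trans (*-congʳ ([≡]ᶜ-yes (m<n⇒m%n≡m c<q))) (*-identityˡ _))
        where
        others : ∀ m → m ≡.≢ c → χ m * coeff r m ≈ 0#
        others m m≢c with m ℕ.<? q
        ... | yes m<q = trans (*-congʳ ([≡]ᶜ-no λ m%q≡c → m≢c (≡.trans (≡.sym (m<n⇒m%n≡m m<q)) m%q≡c))) (zeroˡ _)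
        ... | no  m≮q = trans (*-congˡ (rem-Deg< P m (ℕ.≮⇒≥ m≮q))) (zeroʳ _)
      pairing-σ-r : pairing χ (σ c r) ≈ r₁
      pairing-σ-r = trans (pairing-σ χ c r) (trans (pairing-single r _ 1 others) (trans (*-congʳ ([≡]ᶜ-yes c·1≡c)) (*-identityˡ _)))
        where
        c·1≡c : (c ℕ.* 1) % q ≡.≡ c
        c·1≡c = ≡.trans (≡.cong (_% q) (ℕ.*-identityʳ c)) (m<n⇒m%n≡m c<q)
        others : ∀ m → m ≡.≢ 1 → χ (c ℕ.* m) * coeff r m ≈ 0#
        others m m≢1 with m ℕ.<? q
        ... | yes m<q = trans (*-congʳ ([≡]ᶜ-no λ cm≡c → m≢1 (·ₘ-injective 0<c c<q m<q (s≤s (s≤s z≤n)) (≡.trans cm≡c (≡.sym c·1≡c))))) (zeroˡ _)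
        ... | no  m≮q = trans (*-congˡ (rem-Deg< P m (ℕ.≮⇒≥ m≮q))) (zeroʳ _)

    N : Poly → Carrier
    N p = coeff (rem (p ⊠ M p)) 0 - coeff (rem (p ⊠ M p)) 1

    rem-form : ∀ p → rem (p ⊠ M p) ≋ constₚ (coeff (rem (p ⊠ M p)) 0) ⊞ coeff (rem (p ⊠ M p)) 1 · (Φ q ⊞ ⊝ 1ₚ)
    rem-form p = mk≋ λ
      { zero    → sym (trans (coeff-⊞ (constₚ r₀) (r₁ · (Φ q ⊞ ⊝ 1ₚ)) 0) (trans (+-congˡ (trans (coeff-· r₁ (Φ q ⊞ ⊝ 1ₚ) 0)
                    (trans (*-congˡ (trans (coeff-⊞ (Φ q) (⊝ 1ₚ) 0) (trans (+-congʳ (coeff-Φ-< q 0 (s≤s z≤n))) (-‿inverseʳ 1#)))) (zeroʳ r₁))))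
                    (+-identityʳ r₀)))
      ; (suc j) → sym (trans (coeff-⊞ (constₚ r₀) (r₁ · (Φ q ⊞ ⊝ 1ₚ)) (suc j)) (trans (+-identityˡ _)
                    (trans (coeff-· r₁ (Φ q ⊞ ⊝ 1ₚ) (suc j)) (trans (*-congˡ (trans (coeff-⊞ (Φ q) (⊝ 1ₚ) (suc j)) (+-identityʳ _))) (higher j))))) }
      where
      r = rem (p ⊠ M p)
      r₀ = coeff r 0
      r₁ = coeff r 1
      higher : ∀ j → r₁ * coeff (Φ q) (suc j) ≈ coeff r (suc j)
      higher j with suc j ℕ.<? q
      ... | yes j<q = trans (*-congˡ (coeff-Φ-< q (suc j) j<q)) (trans (*-identityʳ r₁) (rem-coeff-const p (s≤s z≤n) j<q))
      ... | no  j≮q = trans (*-congˡ (coeff-Φ-≥ q (suc j) (ℕ.≮⇒≥ j≮q))) (trans (zeroʳ r₁) (sym (rem-Deg< (p ⊠ M p) (suc j) (ℕ.≮⇒≥ j≮q))))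

    norm : ∀ {e} p → e ⊠ Φ q ≋ [] mod f → e ⊠ (p ⊠ M p) ≋ e ⊠ constₚ (N p) mod f
    norm {e} p eΦ≈0 = by-∣ (∣-respʳ (≋-sym identity) (∣-⊞ (∣-multiple f (e ⊠ quot P)) (∣-⊠ (constₚ r₁) (≋[]mod⇒∣ eΦ≈0))))
      where
      P = p ⊠ M p
      r₀ = coeff (rem P) 0
      r₁ = coeff (rem P) 1
      identity : e ⊠ P ⊞ ⊝ (e ⊠ constₚ (N p)) ≋ (e ⊠ quot P) ⊠ f ⊞ constₚ r₁ ⊠ (e ⊠ Φ q)
      identity = ≋-trans (⊞-cong (⊠-congʳ e (≋-trans (division P) (⊞-cong (≋-refl {quot P ⊠ f}) (≋-trans (rem-form p) (⊞-cong (≋-refl {constₚ r₀}) (≋-sym (constₚ-⊠ r₁ (Φ q ⊞ ⊝ 1ₚ))))))))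
                                (⊝-cong (⊠-congʳ e (mk≋ {constₚ (N p)} {constₚ r₀ ⊞ ⊝ constₚ r₁} λ { zero → refl ; (suc i) → refl }))))
        (⊞⊠-solve 6 (λ e Q f c₀ c₁ φ → e :⊠ (Q :⊠ f :⊞ (c₀ :⊞ c₁ :⊠ (φ :⊟ :c (+ 1)))) :⊟ e :⊠ (c₀ :⊟ c₁)
                                      :≋ (e :⊠ Q) :⊠ f :⊞ c₁ :⊠ (e :⊠ φ)) ≋-refl e (quot P) f (constₚ r₀) (constₚ r₁) (Φ q))

    M-unit : ∀ p {w} → p ⊠ w ≋ 1ₚ mod f → Σ Poly λ w′ → M p ⊠ w′ ≋ 1ₚ mod f
    M-unit p {w} p-unit = Π (applyUpTo (suc ∘ suc) q″) w , Π-unit (applyUpTo (suc ∘ suc) q″)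
      where
      Π-unit : ∀ bs → Π bs p ⊠ Π bs w ≋ 1ₚ mod f
      Π-unit []       = ≋⇒≋mod (⊠-identityˡ 1ₚ)
      Π-unit (b ∷ bs) = unit-⊠ {A = σ b p} {wA = σ b w} (≋mod-resp (∘ₚ-⊠ p w (X^ b)) (constₚ-∘ₚ 1# (X^ b)) (σ-≋mod b p-unit)) (Π-unit bs)

    f∣∂ᶜf : f ∣ ExtendedDerivation.∂ₓ [] f
    f∣∂ᶜf = ≋[]⇒∣ (≋-trans (⊞-cong (≋-trans (∂ᶜ-⊞ (X^ q) (constₚ (- 1#))) (⊞-cong (∂ᶜ-X^ q) (mk≋ {∂ (- 1#) ∷ []} {[]} λ
      { zero → trans (∂-‿ 1#) (trans (-‿cong ∂-1#) -0#≈0#) ; (suc i) → refl }))) (⊠-zeroʳ (deriv f))) (mk≋ λ { zero → refl ; (suc i) → refl }))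

    f≋[X-1]⊠Φ : f ≋ X-1 ⊠ Φ q
    f≋[X-1]⊠Φ = ≋-trans (⊞-cong (X^≋[X-1]⊠Φ⊞1 q) (≋-refl {⊝ 1ₚ}))
      (⊞⊠-solve 2 (λ a b → (a :⊞ b) :⊟ b :≋ a) ≋-refl (X-1 ⊠ Φ q) 1ₚ)

    q⁻¹ = natCast K q ⁻¹⟨ ch0 (suc q″) ⟩

    X-1-coprime : ⊝ (constₚ q⁻¹ ⊠ ΣΦ q) ⊠ X-1 ⊞ constₚ q⁻¹ ⊠ Φ q ≋ 1ₚ
    X-1-coprime = ≋-trans (⊞-cong (≋-refl {⊝ (constₚ q⁻¹ ⊠ ΣΦ q) ⊠ X-1}) (⊠-congʳ (constₚ q⁻¹) (Φ≋[X-1]⊠ΣΦ⊞n q)))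
      (≋-trans (⊞⊠-solve 4 (λ i t w n → (:⊝ (i :⊠ t)) :⊠ w :⊞ i :⊠ (w :⊠ t :⊞ n) :≋ i :⊠ n) ≋-refl (constₚ q⁻¹) (ΣΦ q) X-1 (constₚ (q ⨯ 1#)))
               (mk≋ λ { zero → trans (+-identityʳ _) (trans (*-congˡ (sym (natCast≈⨯ q))) (trans (*-comm _ _) (proj₂ (inverse _ _)))) ; (suc i) → refl }))

    root : ¬ ¬ Σ Carrier λ z → z ^ q ≈ 1# × ¬ z ≈ 1#
    root = ¬¬-component (Φ-monic (suc q″)) (s≤s z≤n) (X-1 , f≋[X-1]⊠Φ) (constₚ (- natCast K q)) X separable qa≉0 >>= λ C →
      let open Component C
          f∤e⊠[X-1] = coprime-≉0 (⊝ (constₚ q⁻¹ ⊠ ΣΦ q)) (constₚ q⁻¹) X-1-coprime in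
      invertible X-1 f∤e⊠[X-1] >>= λ (w , e⊠X-1⊠w≈e) →
      pure (Root.root≉1 C M N (λ p → pure (norm {e} p (eΦ≈0 e⊠X-1⊠w≈e))) (λ p p-unit → pure (M-unit p p-unit)) [] f∣∂ᶜf f∤e⊠[X-1])
      where
      -- e Φ ≡ e (X − 1) w Φ = e w f ≡ 0
      eΦ≈0 : ∀ {e w} → e ⊠ X-1 ⊠ w ≋ e mod f → e ⊠ Φ q ≋ [] mod f
      eΦ≈0 {e} {w} e⊠X-1⊠w≈e = ≋mod-trans (≋mod-sym (≋mod-⊠ e⊠X-1⊠w≈e (≋⇒≋mod (≋-refl {Φ q}))))
        (≋mod-resp (⊞⊠-solve 4 (λ e x w φ → (e :⊠ w) :⊠ (x :⊠ φ) :≋ e :⊠ x :⊠ w :⊠ φ) ≋-refl e X-1 w (Φ q)) (⊠-zeroʳ (e ⊠ w))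
                   (≋mod-⊠ (≋⇒≋mod (≋-refl {e ⊠ w})) (≋mod-resp f≋[X-1]⊠Φ ≋-refl (∣⇒≋[]mod (∣-refl f)))))

  module _ (ch0 : Char0 K) where
    open Automorphisms K

    square-roots : ∀ y → ¬ y ≈ 0# → ¬ ¬ Σ Carrier λ z → z ^ 2 ≈ y
    square-roots = Kummer.root ch0 1 (- 1#) [-1]²≈1 -1-primitive
      where
      [-1]²≈1 : (- 1#) ^ 2 ≈ 1#
      [-1]²≈1 = solve 0 (:- con (+ 1) :* (:- con (+ 1) :* con (+ 1)) := con (+ 1)) refl
      -1-primitive : ∀ k → 0 < k → k < 2 → ¬ (- 1#) ^ k ≈ 1#
      -1-primitive (suc (suc _)) _ (s≤s (s≤s ()))
      -1-primitive 1 _ _ -1≈1 = ch0 1 (trans (+-congˡ (+-identityʳ 1#)) (trans (+-congˡ (sym (trans (sym (*-identityʳ _)) -1≈1))) (-‿inverseʳ 1#)))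

    roots-of-unity : ∀ m → Prime (suc (2 ℕ.* m)) → ¬ ¬ Σ Carrier λ ζ → ζ ^ suc (2 ℕ.* m) ≈ 1# × ¬ ζ ≈ 1#
    roots-of-unity zero     (prime {{()}} _)
    -- suc (2 ℕ.* suc m′) reduces to suc (suc (m′ ℕ.+ suc (m′ ℕ.+ 0))).
    roots-of-unity (suc m′) q-prime = Cyclotomic.root ch0 (m′ ℕ.+ suc (m′ ℕ.+ 0)) q-prime

    no-automorphism-of-order-four : ∀ {τ} → IsRingMonomorphism τ → HasOrder K τ 4 → ⊥
    no-automorphism-of-order-four τ-mono (_ , τ⁴≈id , τʲ≉id) =
      OrderFour.no-order-four ¬¬-stable ch0 τ-mono τ⁴≈id square-roots (τʲ≉id 2 (s≤s z≤n) (s≤s (s≤s (s≤s z≤n))))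

    no-automorphism-of-odd-prime-order : ∀ m → Prime (suc (2 ℕ.* m)) → ∀ {τ} → IsRingMonomorphism τ → HasOrder K τ (suc (2 ℕ.* m)) → ⊥
    no-automorphism-of-odd-prime-order m q-prime τ-mono (_ , τ^q≈id , τʲ≉id) =
      OddPrimeOrder.no-odd-prime-order ¬¬-stable ch0 m q-prime τ-mono τ^q≈id
        (λ ζ^q≈1 ζ-primitive → Kummer.root ch0 (2 ℕ.* m) _ ζ^q≈1 ζ-primitive)
        (roots-of-unity m q-prime) (τʲ≉id 1 (s≤s z≤n) (1<q m q-prime))
      where
      1<q : ∀ m → Prime (suc (2 ℕ.* m)) → 1 < suc (2 ℕ.* m)
      1<q zero    (prime {{()}} _)
      1<q (suc m) _ = s≤s (s≤s z≤n)

lemma6p1 : ∀ {c ℓ : Level} (K : DiffField c ℓ) → IsDCF0 K →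
           (σ : DiffField.Carrier K → DiffField.Carrier K) → IsDiffAut K σ →
           (n : ℕ) → 2 < n → HasOrder K σ n → ⊥
lemma6p1 K (ch0 , dc) σ σ-aut n 2<n σ-order =
  [ (λ (s , n≡4s) → no-automorphism-of-order-four ch0 (σ^-mono s) (σ^-order 4 s n≡4s))
  , (λ (m , s , q-prime , n≡qs) → no-automorphism-of-odd-prime-order ch0 m q-prime (σ^-mono s) (σ^-order (suc (2 ℕ.* m)) s n≡qs))
  ] (NumberTheory.four-or-odd-prime-divides n 2<n)
  where
  open Automorphisms K
  open DifferentiallyClosed K dc
  σ^-mono : ∀ s → IsRingMonomorphism (iterate σ s)
  σ^-mono = iterate-mono (IsDiffAut⇒IsRingMonomorphism σ-aut)
  σ^-order : ∀ k s → n ≡ k ℕ.* s → HasOrder K (iterate σ s) k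
  σ^-order k s n≡ks = iterate-order k s (subst (HasOrder K σ) n≡ks σ-order)
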